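{- In system STI, let $\Pi$ be a derivation of $\Gamma, x:\sigma \vdash M:\tau$ and $\Sigma$ a derivation of $\Delta\vdash N:\sigma$, with $\Gamma\#\Delta$ and $x\notin\mathrm{dom}(\Delta)$. Then there exists a derivation of $\Gamma,\Delta\vdash M[N/x]:\tau$.
   Context: Terms of the $\lambda$-calculus: $M ::= x \mid MM \mid \lambda x.M$, modulo renaming of bound variables; $M[N/x]$ is capture-free substitution. Types of STI: linear types $A ::= a \mid \sigma \to A$ ($a$ ranging over type variables) and intersection types $\sigma ::= A \mid \sigma_1 \wedge \cdots \wedge \sigma_n$ ($n>1$), where the $n$-ary $\wedge$ is commutative but neither idempotent nor associative. A context is a finite set of assumptions $x:\sigma$ with pairwise distinct variables; $\mathrm{dom}(\Gamma)$ is its set of variables; $\Gamma \# \Delta$ means $\mathrm{dom}(\Gamma)\cap\mathrm{dom}(\Delta)=\emptyset$, and then $\Gamma,\Delta$ is their union. The intersection $\Gamma\wedge\Delta$ consists of $x:\sigma$ for $x:\sigma\in\Gamma$, $x\notin\mathrm{dom}(\Delta)$; $x:\tau$ for $x:\tau\in\Delta$, $x\notin\mathrm{dom}(\Gamma)$; and $x:\sigma\wedge\tau$ for $x:\sigma\in\Gamma$, $x:\tau\in\Delta$; $\bigwedge_{i=1}^n\Gamma_i$ is formed in the same way. Rules of STI: (Ax) $x:A \vdash x:A$. (w) from $\Gamma\vdash M:\sigma$ and $x\notin\mathrm{dom}(\Gamma)$ infer $\Gamma, x:A\vdash M:\sigma$. ($\to$I) from $\Gamma, x:\sigma\vdash M:A$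 infer $\Gamma\vdash\lambda x.M:\sigma\to A$. ($\to$E) from $\Gamma\vdash M:\sigma\to A$ and $\Delta\vdash N:\sigma$ with $\Gamma\#\Delta$ infer $\Gamma,\Delta\vdash MN:A$. ($\wedge_n$) for $n>1$, from $\Gamma_i\vdash M:\sigma_i$ ($1\le i\le n$) infer $\bigwedge_{i=1}^n\Gamma_i\vdash M:\sigma_1\wedge\cdots\wedge\sigma_n$. (m) from $\Gamma, x_1:\sigma_1,\dots,x_n:\sigma_n\vdash M:\tau$ infer $\Gamma, x:\sigma_1\wedge\cdots\wedge\sigma_n\vdash M[x/x_1,\dots,x/x_n]:\tau$. -}

module Defs where

open import Data.Nat using (ℕ; zero; suc; _≟_)
open import Data.Bool using (Bool; true; false; if_then_else_)
open import Data.List using (List; []; _∷_; _++_; map)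
open import Data.List.Membership.Propositional using (_∈_; _∉_)
open import Data.List.Membership.DecPropositional _≟_ using (_∈?_)
open import Data.List.Relation.Unary.All using (All)
open import Data.List.Relation.Binary.Pointwise using (Pointwise)
open import Data.List.Relation.Binary.Permutation.Propositional using (_↭_)
open import Data.Product using (_×_; _,_; proj₁; proj₂)
open import Data.Maybe using (Maybe; just; nothing)
open import Relation.Binary.PropositionalEquality using (_≡_)
open import Relation.Nullary.Decidable using (⌊_⌋)

-- Free variables are named
-- (ℕ), bound variables are de Bruijn indices, so a term is exactly an
-- α-equivalence class ("modulo renaming of bound variables").

Var : Set
Var = ℕ

data Term : Set where
  fv  : Var → Term
  bv  : ℕ → Term
  app : Term → Term → Term
  lam : Term → Term

close : ℕ → Var → Term → Term
close k x (fv y)    = if ⌊ y ≟ x ⌋ then bv k else fv y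
close k x (bv i)    = bv i
close k x (app M N) = app (close k x M) (close k x N)
close k x (lam M)   = lam (close (suc k) x M)

ƛ : Var → Term → Term
ƛ x M = lam (close 0 x M)

-- M[N/x]  (capture-free: bound variables are indices)
_[_/_] : Term → Term → Var → Term
fv y    [ N / x ] = if ⌊ y ≟ x ⌋ then N else fv y
bv i    [ N / x ] = bv i
app M P [ N / x ] = app (M [ N / x ]) (P [ N / x ])
lam M   [ N / x ] = lam (M [ N / x ])

rename* : List Var → Var → Term → Term
rename* xs x (fv y)    = if ⌊ y ∈? xs ⌋ then fv x else fv y
rename* xs x (bv i)    = bv i
rename* xs x (app M N) = app (rename* xs x M) (rename* xs x N)
rename* xs x (lam M)   = lam (rename* xs x M)

-- Types.  A ::= a | σ → A ;  σ ::= A | σ₁ ∧ ⋯ ∧ σₙ (n > 1)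

mutual
  data LTy : Set where
    tv  : ℕ → LTy
    _⇒_ : ITy → LTy → LTy

  data ITy : Set where
    lin : LTy → ITy
    -- ⋀ σ₁ σ₂ [σ₃,…,σₙ]  is  σ₁ ∧ σ₂ ∧ ⋯ ∧ σₙ  (n-ary, n ≥ 2, not associative)
    ⋀   : ITy → ITy → List ITy → ITy

infixr 6 _⇒_

inter : ITy → List ITy → ITy
inter σ []       = σ
inter σ (τ ∷ τs) = ⋀ σ τ τs

-- Commutativity of the n-ary ∧: the congruence generated by permuting
-- the components of an intersection.
mutual
  data _≈L_ : LTy → LTy → Set where
    tv≈ : ∀ {a} → tv a ≈L tv a
    ⇒≈  : ∀ {σ σ' A A'} → σ ≈ σ' → A ≈L A' → (σ ⇒ A) ≈L (σ' ⇒ A')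

  data _≈_ : ITy → ITy → Set where
    lin≈ : ∀ {A A'} → A ≈L A' → lin A ≈ lin A'
    ⋀≈   : ∀ {σ₁ σ₂ σs τ₁ τ₂ τs ρs} →
           (σ₁ ∷ σ₂ ∷ σs) ↭ ρs → Pointwise _≈_ ρs (τ₁ ∷ τ₂ ∷ τs) →
           ⋀ σ₁ σ₂ σs ≈ ⋀ τ₁ τ₂ τs

-- Contexts: finite lists of assumptions x : σ, regarded as sets
-- (order irrelevant, via the conversion rule below).

Ctx : Set
Ctx = List (Var × ITy)

dom : Ctx → List Var
dom Γ = map proj₁ Γ

_#_ : Ctx → Ctx → Set
Γ # Δ = ∀ {y} → y ∈ dom Γ → y ∉ dom Δ

_≈ᶜ_ : Ctx → Ctx → Set
Γ ≈ᶜ Γ' = Data.Product.Σ Ctx (λ Θ → (Γ ↭ Θ) ×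
           Pointwise (λ p q → (proj₁ p ≡ proj₁ q) × (proj₂ p ≈ proj₂ q)) Θ Γ')

lookup : Var → Ctx → Maybe ITy
lookup y []            = nothing
lookup y ((z , σ) ∷ Γ) = if ⌊ y ≟ z ⌋ then just σ else lookup y Γ

typesOf : Var → List Ctx → List ITy
typesOf y []       = []
typesOf y (Γ ∷ Γs) with lookup y Γ
... | just σ  = σ ∷ typesOf y Γs
... | nothing = typesOf y Γs

nub : List Var → List Var
nub []       = []
nub (y ∷ ys) = if ⌊ y ∈? ys ⌋ then nub ys else y ∷ nub ys

concatDom : List Ctx → List Var
concatDom []       = []
concatDom (Γ ∷ Γs) = dom Γ ++ concatDom Γs

entry : List Ctx → Var → Ctx
entry Γs y with typesOf y Γs
... | []     = []
... | σ ∷ σs = (y , inter σ σs) ∷ []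

entries : List Ctx → List Var → Ctx
entries Γs []       = []
entries Γs (y ∷ ys) = entry Γs y ++ entries Γs ys

⋀ᶜ : List Ctx → Ctx
⋀ᶜ Γs = entries Γs (nub (concatDom Γs))

infix 4 _⊢_∶_

data _⊢_∶_ : Ctx → Term → ITy → Set where
  ax  : ∀ {x A} → ((x , lin A) ∷ []) ⊢ fv x ∶ lin A
  w   : ∀ {Γ M σ x A} → Γ ⊢ M ∶ σ → x ∉ dom Γ → ((x , lin A) ∷ Γ) ⊢ M ∶ σ
  ⇒I  : ∀ {Γ x σ M A} → ((x , σ) ∷ Γ) ⊢ M ∶ lin A → Γ ⊢ ƛ x M ∶ lin (σ ⇒ A)
  ⇒E  : ∀ {Γ Δ M N σ A} → Γ ⊢ M ∶ lin (σ ⇒ A) → Δ ⊢ N ∶ σ → Γ # Δ →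
        (Γ ++ Δ) ⊢ app M N ∶ lin A
  ∧I  : ∀ {M Γ₁ σ₁ Γ₂ σ₂} (js : List (Ctx × ITy)) →
        Γ₁ ⊢ M ∶ σ₁ → Γ₂ ⊢ M ∶ σ₂ → All (λ j → proj₁ j ⊢ M ∶ proj₂ j) js →
        ⋀ᶜ (Γ₁ ∷ Γ₂ ∷ map proj₁ js) ⊢ M ∶ ⋀ σ₁ σ₂ (map proj₂ js)
  m   : ∀ {Γ M τ x x₁ σ₁} (ys : List (Var × ITy)) →
        (Γ ++ (x₁ , σ₁) ∷ ys) ⊢ M ∶ τ → x ∉ dom Γ →
        ((x , inter σ₁ (map proj₂ ys)) ∷ Γ) ⊢ rename* (x₁ ∷ dom ys) x M ∶ τ
  -- types and contexts are taken modulo commutativity of ∧ / set equality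
  conv : ∀ {Γ Γ' M σ σ'} → Γ ⊢ M ∶ σ → Γ ≈ᶜ Γ' → σ ≈ σ' → Γ' ⊢ M ∶ σ'

-- The proof is by induction on the size of the derivation Σ of N, then on the size of the
-- derivation Π of M, for a statement generalised to any context of Π that is only equivalent
-- to x : σ, Γ, and any type of N only equivalent to σ, so that it survives the conversion rule.
-- Weakening, contraction and conversion at the root of Σ are pushed below the substitution
-- (a contraction after renaming its premises apart).
-- The heart of the matter is when x has type σ₁ ∧ ⋯ ∧ σₙ and Π distributes it among several
-- places, by a contraction x₁, …, xₙ ↦ x or by the premises of an intersection: then Σ ends
-- with ∧ₙ and splits into derivations Δᵢ ⊢ N : σᵢ with Δ = ⋀ᵢ Δᵢ.  Each one is substituted
-- for its own xᵢ; as the Δᵢ may share variables, these are first renamed apart into distinct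
-- copies, which are contracted back with (m) once the substitution is done.

module Submission where

open import Defs
open import Data.Bool using (if_then_else_)
open import Data.Empty using (⊥; ⊥-elim)
open import Data.List using (List; []; _∷_; _++_; map; head)
open import Data.List.Properties using (map-++; ++-assoc; ++-identityʳ; ∷-injectiveˡ; ∷-injectiveʳ)
open import Data.List.Membership.Propositional using (_∈_; _∉_)
open import Data.List.Membership.Propositional.Properties using (∈-++⁺ˡ; ∈-++⁺ʳ; ∈-++⁻; ∈-map⁺; ∈-map⁻)
open import Data.List.Relation.Unary.Any using (here; there)
open import Data.List.Relation.Unary.All as All using (All; []; _∷_)
open import Data.List.Relation.Unary.All.Properties using () renaming (map⁺ to All-map⁺)
open import Data.List.Relation.Unary.AllPairs using (AllPairs; []; _∷_)
open import Data.List.Relation.Binary.Pointwise as PW using (Pointwise; []; _∷_)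
open import Data.List.Relation.Binary.Permutation.Propositional using (_↭_; prep; swap; ↭-sym; ↭-trans) renaming (refl to ↭refl; trans to ↭tr)
open import Data.List.Relation.Binary.Permutation.Propositional.Properties using (∈-resp-↭; map⁺; ↭-length; ↭-map-inv; ↭-singleton-inv)
open import Data.Maybe using (Maybe; just; nothing; _<∣>_)
open import Data.Maybe.Properties using (<∣>-identityʳ)
open import Data.Nat using (ℕ; zero; suc; _≟_; _+_; _≤_)
open import Data.Nat.ListAction using (sum)
open import Data.List.Membership.DecPropositional _≟_ using (_∈?_)
open import Data.Nat.Properties using (m+n≤o⇒m≤o; m+n≤o⇒n≤o; ≤-pred; ≤-refl; n≤0⇒n≡0; m≤m+n; m≤n⇒m≤o+n; n≮n)
open import Data.Product using (Σ; _×_; _,_; proj₁; proj₂)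
open import Data.Sum using (_⊎_; inj₁; inj₂)
open import Data.Unit using (⊤; tt)
open import Function.Definitions using (Injective)
open import Relation.Nullary using (Dec; yes; no)
open import Relation.Nullary.Decidable using (⌊_⌋)
open import Relation.Binary.PropositionalEquality using (_≡_; _≢_; refl; sym; trans; cong; cong₂; subst; subst₂; module ≡-Reasoning)

-- Terms and substitution

FV : Term → List Var
FV (fv y) = y ∷ []
FV (bv i) = []
FV (app M N) = FV M ++ FV N
FV (lam M) = FV M

sub : (Var → Term) → Term → Term
sub s (fv y) = s y
sub s (bv i) = bv i
sub s (app M N) = app (sub s M) (sub s N)
sub s (lam M) = lam (sub s M)

replace : Term → Var → Var → Term
replace N x y = if ⌊ y ≟ x ⌋ then N else fv y

subst-as-sub : ∀ M N x → M [ N / x ] ≡ sub (replace N x) M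
subst-as-sub (fv y) N x = refl
subst-as-sub (bv i) N x = refl
subst-as-sub (app M P) N x = cong₂ app (subst-as-sub M N x) (subst-as-sub P N x)
subst-as-sub (lam M) N x = cong lam (subst-as-sub M N x)

collapse : List Var → Var → Var → Term
collapse xs x y = if ⌊ y ∈? xs ⌋ then fv x else fv y

rename*-as-sub : ∀ xs x M → rename* xs x M ≡ sub (collapse xs x) M
rename*-as-sub xs x (fv y) = refl
rename*-as-sub xs x (bv i) = refl
rename*-as-sub xs x (app M P) = cong₂ app (rename*-as-sub xs x M) (rename*-as-sub xs x P)
rename*-as-sub xs x (lam M) = cong lam (rename*-as-sub xs x M)

sub-cong : ∀ M {s t} → (∀ y → y ∈ FV M → s y ≡ t y) → sub s M ≡ sub t M
sub-cong (fv y) h = h y (here refl)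
sub-cong (bv i) h = refl
sub-cong (app M N) h = cong₂ app (sub-cong M (λ y p → h y (∈-++⁺ˡ p))) (sub-cong N (λ y p → h y (∈-++⁺ʳ (FV M) p)))
sub-cong (lam M) h = cong lam (sub-cong M h)

sub-id : ∀ M → sub fv M ≡ M
sub-id (fv y) = refl
sub-id (bv i) = refl
sub-id (app M N) = cong₂ app (sub-id M) (sub-id N)
sub-id (lam M) = cong lam (sub-id M)

sub-sub : ∀ M s t → sub s (sub t M) ≡ sub (λ y → sub s (t y)) M
sub-sub (fv y) s t = refl
sub-sub (bv i) s t = refl
sub-sub (app M N) s t = cong₂ app (sub-sub M s t) (sub-sub N s t)
sub-sub (lam M) s t = cong lam (sub-sub M s t)

∈FV-sub⁻ : ∀ M s {y} → y ∈ FV (sub s M) → Σ Var (λ z → z ∈ FV M × y ∈ FV (s z))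
∈FV-sub⁻ (fv z) s p = z , here refl , p
∈FV-sub⁻ (bv i) s ()
∈FV-sub⁻ (app M N) s p with ∈-++⁻ (FV (sub s M)) p
... | inj₁ q = let (z , a , b) = ∈FV-sub⁻ M s q in z , ∈-++⁺ˡ a , b
... | inj₂ q = let (z , a , b) = ∈FV-sub⁻ N s q in z , ∈-++⁺ʳ (FV M) a , b
∈FV-sub⁻ (lam M) s p = ∈FV-sub⁻ M s p

∈FV-close⁻ : ∀ k x M {y} → y ∈ FV (close k x M) → y ∈ FV M × y ≢ x
∈FV-close⁻ k x (fv z) p with z ≟ x
∈FV-close⁻ k x (fv z) () | yes _
∈FV-close⁻ k x (fv z) (here refl) | no ne = here refl , ne
∈FV-close⁻ k x (app M N) p with ∈-++⁻ (FV (close k x M)) p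
... | inj₁ q = let (a , b) = ∈FV-close⁻ k x M q in ∈-++⁺ˡ a , b
... | inj₂ q = let (a , b) = ∈FV-close⁻ k x N q in ∈-++⁺ʳ (FV M) a , b
∈FV-close⁻ k x (lam M) p = ∈FV-close⁻ (suc k) x M p

close-fresh : ∀ k x M → x ∉ FV M → close k x M ≡ M
close-fresh k x (fv z) h with z ≟ x
... | yes refl = ⊥-elim (h (here refl))
... | no _ = refl
close-fresh k x (bv i) h = refl
close-fresh k x (app M N) h = cong₂ app (close-fresh k x M (λ p → h (∈-++⁺ˡ p))) (close-fresh k x N (λ p → h (∈-++⁺ʳ (FV M) p)))
close-fresh k x (lam M) h = cong lam (close-fresh (suc k) x M h)

close-sub : ∀ k z M s → s z ≡ fv z → (∀ y → y ∈ FV M → y ≢ z → z ∉ FV (s y)) →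
            close k z (sub s M) ≡ sub s (close k z M)
close-sub k z (fv y) s e h with y ≟ z
... | yes refl rewrite e with z ≟ z
...    | yes _ = refl
...    | no ne = ⊥-elim (ne refl)
close-sub k z (fv y) s e h | no ne = close-fresh k z (s y) (h y (here refl) ne)
close-sub k z (bv i) s e h = refl
close-sub k z (app M N) s e h = cong₂ app (close-sub k z M s e (λ y p → h y (∈-++⁺ˡ p))) (close-sub k z N s e
      (λ y p → h y (∈-++⁺ʳ (FV M) p)))
close-sub k z (lam M) s e h = cong lam (close-sub (suc k) z M s e h)

subst-here : ∀ x N → fv x [ N / x ] ≡ N
subst-here x N with x ≟ x
... | yes _ = refl
... | no ne = ⊥-elim (ne refl)

subst-fresh : ∀ M N x → x ∉ FV M → M [ N / x ] ≡ M
subst-fresh M N x h = trans (subst-as-sub M N x) (trans (sub-cong M pt) (sub-id M))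
  where
  pt : ∀ y → y ∈ FV M → replace N x y ≡ fv y
  pt y p with y ≟ x
  ... | yes refl = ⊥-elim (h p)
  ... | no _ = refl

collapse-∉ : ∀ xs u v → v ∉ xs → collapse xs u v ≡ fv v
collapse-∉ xs u v h with v ∈? xs
... | yes q = ⊥-elim (h q)
... | no _ = refl

collapse-∈ : ∀ xs u v → v ∈ xs → collapse xs u v ≡ fv u
collapse-∈ xs u v h with v ∈? xs
... | yes q = refl
... | no q = ⊥-elim (q h)

rename-fresh : ∀ xs x M → (∀ z → z ∈ FV M → z ∉ xs) → rename* xs x M ≡ M
rename-fresh xs x M h = trans (rename*-as-sub xs x M) (trans (sub-cong M pt) (sub-id M))
  where
  pt : ∀ z → z ∈ FV M → collapse xs x z ≡ fv z
  pt z p with z ∈? xs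
  ... | yes q = ⊥-elim (h z p q)
  ... | no _ = refl

rename*-subst-comm : ∀ xs z x N P → x ∉ xs → z ≢ x → (∀ {v} → v ∈ FV N → v ∉ xs) →
                     rename* xs z (P [ N / x ]) ≡ rename* xs z P [ N / x ]
rename*-subst-comm xs z x N P x∉xs z≢x N-avoids = begin
  rename* xs z (P [ N / x ])                             ≡⟨ rename*-as-sub xs z (P [ N / x ]) ⟩
  sub (collapse xs z) (P [ N / x ])                      ≡⟨ cong (sub (collapse xs z)) (subst-as-sub P N x) ⟩
  sub (collapse xs z) (sub (replace N x) P)              ≡⟨ sub-sub P (collapse xs z) (replace N x) ⟩
  sub (λ v → sub (collapse xs z) (replace N x v)) P      ≡⟨ sub-cong P commute ⟩
  sub (λ v → sub (replace N x) (collapse xs z v)) P      ≡⟨ sub-sub P (replace N x) (collapse xs z) ⟨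
  sub (replace N x) (sub (collapse xs z) P)              ≡⟨ cong (sub (replace N x)) (rename*-as-sub xs z P) ⟨
  sub (replace N x) (rename* xs z P)                     ≡⟨ subst-as-sub (rename* xs z P) N x ⟨
  rename* xs z P [ N / x ]                               ∎
  where
  open ≡-Reasoning
  commute : ∀ v → v ∈ FV P → sub (collapse xs z) (replace N x v) ≡ sub (replace N x) (collapse xs z v)
  commute v _ with v ≟ x
  ... | yes refl rewrite collapse-∉ xs z v x∉xs | subst-here v N =
    trans (sym (rename*-as-sub xs z N)) (rename-fresh xs z N (λ w p q → N-avoids p q))
  ... | no v≢x with v ∈? xs
  ...   | yes _ = sym (subst-fresh (fv z) N x (λ { (here e) → z≢x (sym e) }))
  ...   | no _ = sym (subst-fresh (fv v) N x (λ { (here e) → v≢x (sym e) }))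

-- Equivalence of intersection types

Pointwise-↭-swap : ∀ {A : Set} {R : A → A → Set} {xs ys zs} → Pointwise R xs ys → ys ↭ zs →
       Σ (List A) (λ ws → (xs ↭ ws) × Pointwise R ws zs)
Pointwise-↭-swap pw ↭refl = _ , ↭refl , pw
Pointwise-↭-swap (r ∷ pw) (prep x p) = let (ws , a , b) = Pointwise-↭-swap pw p in _ , prep _ a , r ∷ b
Pointwise-↭-swap (r₁ ∷ r₂ ∷ pw) (swap x y p) = let (ws , a , b) = Pointwise-↭-swap pw p in _ , swap _ _ a , r₂ ∷ r₁ ∷ b
Pointwise-↭-swap pw (↭tr p q) =
  let (ws , a , b) = Pointwise-↭-swap pw p
      (ws' , c , d) = Pointwise-↭-swap b q
  in ws' , ↭-trans a c , d

mutual
  ≈-refl : ∀ σ → σ ≈ σ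
  ≈-refl (lin A) = lin≈ (≈L-refl A)
  ≈-refl (⋀ a b cs) = ⋀≈ ↭refl (≈-refl a ∷ ≈-refl b ∷ ≈*-refl cs)

  ≈L-refl : ∀ A → A ≈L A
  ≈L-refl (tv x) = tv≈
  ≈L-refl (σ ⇒ A) = ⇒≈ (≈-refl σ) (≈L-refl A)

  ≈*-refl : ∀ cs → Pointwise _≈_ cs cs
  ≈*-refl [] = []
  ≈*-refl (c ∷ cs) = ≈-refl c ∷ ≈*-refl cs

mutual
  ≈-sym : ∀ {σ τ} → σ ≈ τ → τ ≈ σ
  ≈-sym (lin≈ e) = lin≈ (≈L-sym e)
  ≈-sym (⋀≈ p q) with Pointwise-↭-swap (≈*-sym q) (↭-sym p)
  ... | ws , a , b = ⋀≈ a b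

  ≈L-sym : ∀ {A B} → A ≈L B → B ≈L A
  ≈L-sym tv≈ = tv≈
  ≈L-sym (⇒≈ e f) = ⇒≈ (≈-sym e) (≈L-sym f)

  ≈*-sym : ∀ {xs ys} → Pointwise _≈_ xs ys → Pointwise _≈_ ys xs
  ≈*-sym [] = []
  ≈*-sym (r ∷ p) = ≈-sym r ∷ ≈*-sym p

-- Transitivity is proved against an arbitrary right-hand side, so that the recursion on the
-- components of an intersection is structural.
TransFrom : ITy → ITy → Set
TransFrom a b = ∀ {c} → b ≈ c → a ≈ c

mutual
  ≈-trans : ∀ {σ τ υ} → σ ≈ τ → τ ≈ υ → σ ≈ υ
  ≈-trans (lin≈ e) (lin≈ f) = lin≈ (≈L-trans e f)
  ≈-trans (⋀≈ p q) (⋀≈ p' q') with Pointwise-↭-swap (≈*-transFrom q) p'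
  ... | ws , a , b = ⋀≈ (↭-trans p a) (PW.transitive (λ f r → f r) b q')

  ≈L-trans : ∀ {A B C} → A ≈L B → B ≈L C → A ≈L C
  ≈L-trans tv≈ tv≈ = tv≈
  ≈L-trans (⇒≈ e f) (⇒≈ e' f') = ⇒≈ (≈-trans e e') (≈L-trans f f')

  ≈*-transFrom : ∀ {xs ys} → Pointwise _≈_ xs ys → Pointwise TransFrom xs ys
  ≈*-transFrom [] = []
  ≈*-transFrom (r ∷ p) = (λ s → ≈-trans r s) ∷ ≈*-transFrom p

-- Contexts

data Distinct : List Var → Set where
  []  : Distinct []
  _∷_ : ∀ {x xs} → x ∉ xs → Distinct xs → Distinct (x ∷ xs)

DistinctCtx : Ctx → Set
DistinctCtx Γ = Distinct (dom Γ)

Distinct-↭ : ∀ {xs ys} → xs ↭ ys → Distinct xs → Distinct ys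
Distinct-↭ ↭refl n = n
Distinct-↭ (prep x p) (h ∷ n) = (λ q → h (∈-resp-↭ (↭-sym p) q)) ∷ Distinct-↭ p n
Distinct-↭ (swap x y p) (h₁ ∷ h₂ ∷ n) =
  (λ { (here refl) → h₁ (here refl) ; (there q) → h₂ (∈-resp-↭ (↭-sym p) q) }) ∷
  ((λ q → h₁ (there (∈-resp-↭ (↭-sym p) q))) ∷ Distinct-↭ p n)
Distinct-↭ (↭tr p q) n = Distinct-↭ q (Distinct-↭ p n)

Distinct-head : ∀ {y ys} → Distinct (y ∷ ys) → y ∉ ys
Distinct-head (a ∷ _) = a

lookup-∉ : ∀ {y} Γ → y ∉ dom Γ → lookup y Γ ≡ nothing
lookup-∉ [] h = refl
lookup-∉ {y} ((z , σ) ∷ Γ) h with y ≟ z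
... | yes refl = ⊥-elim (h (here refl))
... | no _ = lookup-∉ Γ (λ p → h (there p))

lookup-just-∈ : ∀ {y σ} Γ → lookup y Γ ≡ just σ → y ∈ dom Γ
lookup-just-∈ [] ()
lookup-just-∈ {y} ((z , ρ) ∷ Γ) e with y ≟ z
... | yes refl = here refl
... | no _ = there (lookup-just-∈ Γ e)

lookup-∈ : ∀ {y} Γ → y ∈ dom Γ → Σ ITy (λ σ → lookup y Γ ≡ just σ)
lookup-∈ {y} ((z , ρ) ∷ Γ) p with y ≟ z
... | yes refl = ρ , refl
lookup-∈ {y} ((z , ρ) ∷ Γ) (here refl) | no ne = ⊥-elim (ne refl)
lookup-∈ {y} ((z , ρ) ∷ Γ) (there p) | no ne = lookup-∈ Γ p

lookup-nothing-∉ : ∀ {y} Γ → lookup y Γ ≡ nothing → y ∉ dom Γ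
lookup-nothing-∉ Γ e p with lookup-∈ Γ p
... | σ , e' = nothing≢just (trans (sym e) e')
  where
  nothing≢just : ∀ {σ : ITy} → nothing ≢ just σ
  nothing≢just ()

lookup-++ : ∀ y Γ Δ → lookup y (Γ ++ Δ) ≡ (lookup y Γ <∣> lookup y Δ)
lookup-++ y [] Δ = refl
lookup-++ y ((z , ρ) ∷ Γ) Δ with y ≟ z
... | yes _ = refl
... | no _ = lookup-++ y Γ Δ

lookup-++-∉ˡ : ∀ y Γ Δ → y ∉ dom Γ → lookup y (Γ ++ Δ) ≡ lookup y Δ
lookup-++-∉ˡ y Γ Δ h = trans (lookup-++ y Γ Δ) (cong (_<∣> lookup y Δ) (lookup-∉ Γ h))

lookup-++-just : ∀ y Γ Δ {ρ} → lookup y Γ ≡ just ρ → lookup y (Γ ++ Δ) ≡ just ρ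
lookup-++-just y Γ Δ eq = trans (lookup-++ y Γ Δ) (cong (_<∣> lookup y Δ) eq)

lookup-here : ∀ y σ Γ → lookup y ((y , σ) ∷ Γ) ≡ just σ
lookup-here y σ Γ with y ≟ y
... | yes _ = refl
... | no ne = ⊥-elim (ne refl)

lookup-there : ∀ {y z} σ Γ → y ≢ z → lookup y ((z , σ) ∷ Γ) ≡ lookup y Γ
lookup-there {y} {z} σ Γ ne with y ≟ z
... | yes e = ⊥-elim (ne e)
... | no _ = refl

delete : Var → Ctx → Ctx
delete y [] = []
delete y ((z , σ) ∷ Γ) = if ⌊ z ≟ y ⌋ then delete y Γ else (z , σ) ∷ delete y Γ

delete-∉ : ∀ y Γ → y ∉ dom Γ → delete y Γ ≡ Γ
delete-∉ y [] h = refl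
delete-∉ y ((z , σ) ∷ Γ) h with z ≟ y
... | yes refl = ⊥-elim (h (here refl))
... | no _ = cong ((z , σ) ∷_) (delete-∉ y Γ (λ p → h (there p)))

∈dom-delete⁻ : ∀ y Γ {z} → z ∈ dom (delete y Γ) → z ∈ dom Γ × z ≢ y
∈dom-delete⁻ y ((z , σ) ∷ Γ) p with z ≟ y
... | yes refl = let (a , b) = ∈dom-delete⁻ y Γ p in there a , b
∈dom-delete⁻ y ((z , σ) ∷ Γ) (here refl) | no ne = here refl , ne
∈dom-delete⁻ y ((z , σ) ∷ Γ) (there p) | no ne = let (a , b) = ∈dom-delete⁻ y Γ p in there a , b

DistinctCtx-delete : ∀ y Γ → DistinctCtx Γ → DistinctCtx (delete y Γ)
DistinctCtx-delete y [] n = n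
DistinctCtx-delete y ((z , σ) ∷ Γ) (h ∷ n) with z ≟ y
... | yes _ = DistinctCtx-delete y Γ n
... | no _ = (λ p → h (proj₁ (∈dom-delete⁻ y Γ p))) ∷ DistinctCtx-delete y Γ n

lookup-delete-same : ∀ y Γ → lookup y (delete y Γ) ≡ nothing
lookup-delete-same y Γ = lookup-∉ (delete y Γ) (λ p → proj₂ (∈dom-delete⁻ y Γ p) refl)

lookup-delete-other : ∀ {y z} Γ → z ≢ y → lookup z (delete y Γ) ≡ lookup z Γ
lookup-delete-other [] ne = refl
lookup-delete-other {y} {z} ((v , σ) ∷ Γ) ne with v ≟ y
... | yes refl = trans (lookup-delete-other Γ ne) (sym (lookup-there σ Γ ne))
... | no _ with z ≟ v
...   | yes _ = refl
...   | no _ = lookup-delete-other Γ ne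

↭-delete : ∀ {y σ} Γ → DistinctCtx Γ → lookup y Γ ≡ just σ → Γ ↭ ((y , σ) ∷ delete y Γ)
↭-delete {y} ((z , ρ) ∷ Γ) (h ∷ n) e with y ≟ z
↭-delete {y} ((z , ρ) ∷ Γ) (h ∷ n) refl | yes refl with z ≟ z
... | yes _ = prep _ (subst (Γ ↭_) (sym (delete-∉ z Γ h)) ↭refl)
... | no ne = ⊥-elim (ne refl)
↭-delete {y} ((z , ρ) ∷ Γ) (h ∷ n) e | no ne with z ≟ y
... | yes e' = ⊥-elim (ne (sym e'))
... | no _ = ↭-trans (prep _ (↭-delete Γ n e)) (swap _ _ ↭refl)

-- Equivalence of contexts

infix 4 _≈ᵐ_
data _≈ᵐ_ : Maybe ITy → Maybe ITy → Set where
  nothing : nothing ≈ᵐ nothing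
  just    : ∀ {σ τ} → σ ≈ τ → just σ ≈ᵐ just τ

≈ᵐ-refl : ∀ mm → mm ≈ᵐ mm
≈ᵐ-refl nothing = nothing
≈ᵐ-refl (just a) = just (≈-refl a)

≈ᵐ-sym : ∀ {m1 n1} → m1 ≈ᵐ n1 → n1 ≈ᵐ m1
≈ᵐ-sym nothing = nothing
≈ᵐ-sym (just e) = just (≈-sym e)

≈ᵐ-trans : ∀ {m1 n1 o1} → m1 ≈ᵐ n1 → n1 ≈ᵐ o1 → m1 ≈ᵐ o1
≈ᵐ-trans nothing nothing = nothing
≈ᵐ-trans (just e) (just f) = just (≈-trans e f)

≈ᵐ-reflexive : ∀ {m1 n1} → m1 ≡ n1 → m1 ≈ᵐ n1
≈ᵐ-reflexive {m1} refl = ≈ᵐ-refl m1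

infix 4 _≅_
-- On contexts with distinct variables this coincides with the conversion relation _≈ᶜ_
-- (≅⇒≈ᶜ, ≈ᶜ⇒≅), but it ignores the order of assumptions.
record _≅_ (Γ Δ : Ctx) : Set where
  constructor mk≅
  field at : ∀ y → lookup y Γ ≈ᵐ lookup y Δ
open _≅_ public

≅-refl : ∀ {Γ} → Γ ≅ Γ
≅-refl {Γ} = mk≅ λ y → ≈ᵐ-refl (lookup y Γ)

≅-sym : ∀ {Γ Δ} → Γ ≅ Δ → Δ ≅ Γ
≅-sym e = mk≅ λ y → ≈ᵐ-sym (at e y)

≅-trans : ∀ {Γ Δ Θ} → Γ ≅ Δ → Δ ≅ Θ → Γ ≅ Θ
≅-trans e f = mk≅ λ y → ≈ᵐ-trans (at e y) (at f y)

EntryEq : Var × ITy → Var × ITy → Set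
EntryEq p q = (proj₁ p ≡ proj₁ q) × (proj₂ p ≈ proj₂ q)

[]≅⇒≡[] : ∀ Γ → [] ≅ Γ → Γ ≡ []
[]≅⇒≡[] [] e = refl
[]≅⇒≡[] ((z , σ) ∷ Γ) e with at e z
... | r rewrite lookup-here z σ Γ with r
... | ()

≅⇒≈ᶜ : ∀ Γ Γ' → DistinctCtx Γ → DistinctCtx Γ' → Γ ≅ Γ' → Γ ≈ᶜ Γ'
≅⇒≈ᶜ [] Γ' n n' e rewrite []≅⇒≡[] Γ' e = [] , ↭refl , []
≅⇒≈ᶜ ((y , ρ) ∷ Γ) Γ' (h ∷ n) n' e = go (lookup y Γ') refl (subst (λ m1 → m1 ≈ᵐ lookup y Γ') (lookup-here y ρ Γ) (at e y))
  where
  help : ∀ z → lookup z Γ ≈ᵐ lookup z (delete y Γ')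
  help z with z ≟ y
  ... | yes refl rewrite lookup-∉ Γ h | lookup-delete-same z Γ' = nothing
  ... | no ne with at e z
  ... | r rewrite lookup-there ρ Γ ne | lookup-delete-other Γ' ne = r
  go : ∀ mm → lookup y Γ' ≡ mm → just ρ ≈ᵐ mm → ((y , ρ) ∷ Γ) ≈ᶜ Γ'
  go (just ρ') eq (just ee) =
    let pk = ↭-delete Γ' n' eq
        (Ξ , a , b) = ≅⇒≈ᶜ Γ (delete y Γ') n (DistinctCtx-delete y Γ' n') (mk≅ help)
        (ws , c , d) = Pointwise-↭-swap {R = EntryEq} ((refl , ee) ∷ b) (↭-sym pk)
    in ws , ↭-trans (prep _ a) c , d

lookup-↭ : ∀ y {Γ Θ} → Γ ↭ Θ → DistinctCtx Γ → lookup y Γ ≡ lookup y Θ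
lookup-↭ y ↭refl n = refl
lookup-↭ y (prep (z , σ) p) (h ∷ n) with y ≟ z
... | yes _ = refl
... | no _ = lookup-↭ y p n
lookup-↭ y (swap (z , σ) (v , ρ) p) (h ∷ h' ∷ n) with y ≟ z | y ≟ v
... | yes refl | yes refl = ⊥-elim (h (here refl))
... | yes _ | no _ = refl
... | no _ | yes _ = refl
... | no _ | no _ = lookup-↭ y p n
lookup-↭ y (↭tr p q) n = trans (lookup-↭ y p n) (lookup-↭ y q (Distinct-↭ (map⁺ proj₁ p) n))

lookup-Pointwise : ∀ y {Γ Θ} → Pointwise EntryEq Γ Θ → lookup y Γ ≈ᵐ lookup y Θ
lookup-Pointwise y [] = nothing
lookup-Pointwise y {(z , σ) ∷ Γ} {(.z , ρ) ∷ Θ} ((refl , e) ∷ p) with y ≟ z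
... | yes _ = just e
... | no _ = lookup-Pointwise y p

≈ᶜ⇒≅ : ∀ {Γ Γ'} → DistinctCtx Γ → Γ ≈ᶜ Γ' → Γ ≅ Γ'
≈ᶜ⇒≅ n (Θ , p , q) = mk≅ λ y → subst (λ m1 → m1 ≈ᵐ _) (sym (lookup-↭ y p n)) (lookup-Pointwise y q)

Pointwise-dom : ∀ {Γ Θ} → Pointwise EntryEq Γ Θ → dom Γ ≡ dom Θ
Pointwise-dom [] = refl
Pointwise-dom ((refl , _) ∷ p) = cong (_ ∷_) (Pointwise-dom p)

DistinctCtx-≈ᶜ : ∀ {Γ Γ'} → DistinctCtx Γ → Γ ≈ᶜ Γ' → DistinctCtx Γ'
DistinctCtx-≈ᶜ n (Θ , p , q) = subst Distinct (Pointwise-dom q) (Distinct-↭ (map⁺ proj₁ p) n)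

Distinct-++⁺ : ∀ {xs ys} → Distinct xs → Distinct ys → (∀ {y} → y ∈ xs → y ∉ ys) → Distinct (xs ++ ys)
Distinct-++⁺ [] n' h = n'
Distinct-++⁺ {x ∷ xs} {ys} (a ∷ n) n' h = (λ p → case (∈-++⁻ xs p)) ∷ Distinct-++⁺ n n' (λ p → h (there p))
  where
  case : (x ∈ xs) ⊎ (x ∈ ys) → ⊥
  case (inj₁ p) = a p
  case (inj₂ p) = h (here refl) p

Distinct-++⁻ˡ : ∀ xs {ys} → Distinct (xs ++ ys) → Distinct xs
Distinct-++⁻ˡ [] n = []
Distinct-++⁻ˡ (x ∷ xs) (a ∷ n) = (λ p → a (∈-++⁺ˡ p)) ∷ Distinct-++⁻ˡ xs n

Distinct-++⁻ʳ : ∀ xs {ys} → Distinct (xs ++ ys) → Distinct ys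
Distinct-++⁻ʳ [] n = n
Distinct-++⁻ʳ (x ∷ xs) (a ∷ n) = Distinct-++⁻ʳ xs n

Distinct-++⇒disjoint : ∀ xs {ys} → Distinct (xs ++ ys) → ∀ {y} → y ∈ xs → y ∉ ys
Distinct-++⇒disjoint (x ∷ xs) (a ∷ n) (here refl) q = a (∈-++⁺ʳ xs q)
Distinct-++⇒disjoint (x ∷ xs) (a ∷ n) (there p) q = Distinct-++⇒disjoint xs n p q

dom-++ : ∀ Γ Δ → dom (Γ ++ Δ) ≡ dom Γ ++ dom Δ
dom-++ Γ Δ = map-++ proj₁ Γ Δ

DistinctCtx-++⁺ : ∀ Γ Δ → DistinctCtx Γ → DistinctCtx Δ → Γ # Δ → DistinctCtx (Γ ++ Δ)
DistinctCtx-++⁺ Γ Δ n n' h = subst Distinct (sym (dom-++ Γ Δ)) (Distinct-++⁺ n n' h)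

DistinctCtx-++⁻ˡ : ∀ Γ Δ → DistinctCtx (Γ ++ Δ) → DistinctCtx Γ
DistinctCtx-++⁻ˡ Γ Δ n = Distinct-++⁻ˡ (dom Γ) (subst Distinct (dom-++ Γ Δ) n)

DistinctCtx-++⁻ʳ : ∀ Γ Δ → DistinctCtx (Γ ++ Δ) → DistinctCtx Δ
DistinctCtx-++⁻ʳ Γ Δ n = Distinct-++⁻ʳ (dom Γ) (subst Distinct (dom-++ Γ Δ) n)

DistinctCtx-++⇒# : ∀ Γ Δ → DistinctCtx (Γ ++ Δ) → Γ # Δ
DistinctCtx-++⇒# Γ Δ n = Distinct-++⇒disjoint (dom Γ) (subst Distinct (dom-++ Γ Δ) n)

∈dom-++⁻ : ∀ Γ Δ {y} → y ∈ dom (Γ ++ Δ) → (y ∈ dom Γ) ⊎ (y ∈ dom Δ)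
∈dom-++⁻ Γ Δ p = ∈-++⁻ (dom Γ) (subst (_ ∈_) (dom-++ Γ Δ) p)

∈dom-++ˡ : ∀ Γ Δ {y} → y ∈ dom Γ → y ∈ dom (Γ ++ Δ)
∈dom-++ˡ Γ Δ p = subst (_ ∈_) (sym (dom-++ Γ Δ)) (∈-++⁺ˡ p)

∈dom-++ʳ : ∀ Γ Δ {y} → y ∈ dom Δ → y ∈ dom (Γ ++ Δ)
∈dom-++ʳ Γ Δ p = subst (_ ∈_) (sym (dom-++ Γ Δ)) (∈-++⁺ʳ (dom Γ) p)

∉dom-++ : ∀ Γ Δ {y} → y ∉ dom Γ → y ∉ dom Δ → y ∉ dom (Γ ++ Δ)
∉dom-++ Γ Δ a b p with ∈dom-++⁻ Γ Δ p
... | inj₁ q = a q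
... | inj₂ q = b q

DistinctCtx-middle : ∀ Ξ c ρ Y → DistinctCtx (Ξ ++ (c , ρ) ∷ Y) → DistinctCtx (Ξ ++ Y) × c ∉ dom (Ξ ++ Y) × c ∉ dom Ξ
DistinctCtx-middle Ξ c ρ Y n =
  let nΞ = DistinctCtx-++⁻ˡ Ξ _ n
      nY = DistinctCtx-++⁻ʳ Ξ ((c , ρ) ∷ Y) n
      dj = DistinctCtx-++⇒# Ξ ((c , ρ) ∷ Y) n
  in DistinctCtx-++⁺ Ξ Y nΞ (tl nY) (λ p q → dj p (there q)) ,
     ∉dom-++ Ξ Y (λ p → dj p (here refl)) (hd nY) , (λ p → dj p (here refl))
  where
  hd : ∀ {y ys} → Distinct (y ∷ ys) → y ∉ ys
  hd (a ∷ _) = a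
  tl : ∀ {y ys} → Distinct (y ∷ ys) → Distinct ys
  tl (_ ∷ b) = b

#-++⁻ʳ : ∀ {D} Γ Δ → D # (Γ ++ Δ) → D # Δ
#-++⁻ʳ Γ Δ h p q = h p (∈dom-++ʳ Γ Δ q)

#-++⁻ˡ : ∀ {D} Γ Δ → D # (Γ ++ Δ) → D # Γ
#-++⁻ˡ Γ Δ h p q = h p (∈dom-++ˡ Γ Δ q)

#-++⁺ : ∀ {D} Γ Δ → D # Γ → D # Δ → D # (Γ ++ Δ)
#-++⁺ Γ Δ a b p q with ∈dom-++⁻ Γ Δ q
... | inj₁ r = a p r
... | inj₂ r = b p r

#-middle : ∀ {D} Ξ c ρ Y → D # (Ξ ++ (c , ρ) ∷ Y) → D # (Ξ ++ Y)
#-middle Ξ c ρ Y h = #-++⁺ Ξ Y (#-++⁻ˡ Ξ _ h) (λ p q → #-++⁻ʳ Ξ ((c , ρ) ∷ Y) h p (there q))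

-- Intersection of contexts

interᵐ : List ITy → Maybe ITy
interᵐ [] = nothing
interᵐ (σ ∷ σs) = just (inter σ σs)

consᵐ : Maybe ITy → List ITy → List ITy
consᵐ nothing l = l
consᵐ (just σ) l = σ ∷ l

typesOf-∷ : ∀ y Γ Γs → typesOf y (Γ ∷ Γs) ≡ consᵐ (lookup y Γ) (typesOf y Γs)
typesOf-∷ y Γ Γs with lookup y Γ
... | just σ = refl
... | nothing = refl

entry′ : Var → List ITy → Ctx
entry′ y [] = []
entry′ y (σ ∷ σs) = (y , inter σ σs) ∷ []

entry≡entry′ : ∀ Γs y → entry Γs y ≡ entry′ y (typesOf y Γs)
entry≡entry′ Γs y with typesOf y Γs
... | [] = refl
... | σ ∷ σs = refl

lookup-entry′-here : ∀ y T R → lookup y (entry′ y T ++ R) ≡ (interᵐ T <∣> lookup y R)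
lookup-entry′-here y [] R = refl
lookup-entry′-here y (σ ∷ σs) R = lookup-here y _ R

lookup-entry′-there : ∀ {y z} T R → y ≢ z → lookup y (entry′ z T ++ R) ≡ lookup y R
lookup-entry′-there [] R ne = refl
lookup-entry′-there (σ ∷ σs) R ne = lookup-there _ R ne

∈dom-entry′ : ∀ z T {y} → y ∈ dom (entry′ z T) → y ≡ z
∈dom-entry′ z (σ ∷ σs) (here refl) = refl

lookup-entries-∈ : ∀ y Γs zs → y ∈ zs → lookup y (entries Γs zs) ≡ interᵐ (typesOf y Γs)
lookup-entries-∉ : ∀ y Γs zs → y ∉ zs → lookup y (entries Γs zs) ≡ nothing
lookup-entries-∈ y Γs (z ∷ zs) p with y ≟ z
... | yes refl rewrite entry≡entry′ Γs y | lookup-entry′-here y (typesOf y Γs) (entries Γs zs) = aux (typesOf y Γs) refl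
  where
  aux : ∀ T → typesOf y Γs ≡ T → (interᵐ T <∣> lookup y (entries Γs zs)) ≡ interᵐ T
  aux [] e with y ∈? zs
  ... | yes q = trans (lookup-entries-∈ y Γs zs q) (cong interᵐ e)
  ... | no q = lookup-entries-∉ y Γs zs q
  aux (σ ∷ σs) e = refl
lookup-entries-∈ y Γs (z ∷ zs) (here refl) | no ne = ⊥-elim (ne refl)
lookup-entries-∈ y Γs (z ∷ zs) (there p) | no ne rewrite entry≡entry′ Γs z | lookup-entry′-there (typesOf z Γs) (entries Γs
      zs) ne = lookup-entries-∈ y Γs zs p
lookup-entries-∉ y Γs [] h = refl
lookup-entries-∉ y Γs (z ∷ zs) h with y ≟ z
... | yes refl = ⊥-elim (h (here refl))
... | no ne rewrite entry≡entry′ Γs z | lookup-entry′-there (typesOf z Γs) (entries Γs zs) ne = lookup-entries-∉ y Γs zs (λ p → h (there p))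

nub-∈ : ∀ {y} ys → y ∈ ys → y ∈ nub ys
nub-∈ (z ∷ zs) p with z ∈? zs
nub-∈ (z ∷ zs) (here refl) | yes q = nub-∈ zs q
nub-∈ (z ∷ zs) (there p) | yes q = nub-∈ zs p
nub-∈ (z ∷ zs) (here refl) | no q = here refl
nub-∈ (z ∷ zs) (there p) | no q = there (nub-∈ zs p)

nub-⊆ : ∀ {y} ys → y ∈ nub ys → y ∈ ys
nub-⊆ (z ∷ zs) p with z ∈? zs
... | yes q = there (nub-⊆ zs p)
nub-⊆ (z ∷ zs) (here refl) | no q = here refl
nub-⊆ (z ∷ zs) (there p) | no q = there (nub-⊆ zs p)

Distinct-nub : ∀ ys → Distinct (nub ys)
Distinct-nub [] = []
Distinct-nub (z ∷ zs) with z ∈? zs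
... | yes q = Distinct-nub zs
... | no q = (λ p → q (nub-⊆ zs p)) ∷ Distinct-nub zs

lookup-∉-concat : ∀ y Γs → y ∉ concatDom Γs → typesOf y Γs ≡ []
lookup-∉-concat y [] h = refl
lookup-∉-concat y (Γ ∷ Γs) h rewrite typesOf-∷ y Γ Γs | lookup-∉ Γ (λ p → h (∈-++⁺ˡ p)) = lookup-∉-concat y Γs (λ p → h (∈-++⁺ʳ (dom Γ) p))

lookup-⋀ᶜ : ∀ y Γs → lookup y (⋀ᶜ Γs) ≡ interᵐ (typesOf y Γs)
lookup-⋀ᶜ y Γs with y ∈? concatDom Γs
... | yes p = lookup-entries-∈ y Γs (nub (concatDom Γs)) (nub-∈ (concatDom Γs) p)
... | no p rewrite lookup-∉-concat y Γs p = lookup-entries-∉ y Γs (nub (concatDom Γs)) (λ q → p (nub-⊆ (concatDom Γs) q))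

dom-entries : ∀ Γs zs {y} → y ∈ dom (entries Γs zs) → y ∈ zs
dom-entries Γs (z ∷ zs) {y} p rewrite entry≡entry′ Γs z with ∈dom-++⁻ (entry′ z (typesOf z Γs)) (entries Γs zs) p
... | inj₁ q = here (∈dom-entry′ z _ q)
... | inj₂ q = there (dom-entries Γs zs q)

DistinctCtx-entries : ∀ Γs zs → Distinct zs → DistinctCtx (entries Γs zs)
DistinctCtx-entries Γs [] n = []
DistinctCtx-entries Γs (z ∷ zs) (a ∷ n) rewrite entry≡entry′ Γs z = DistinctCtx-++⁺ (entry′ z (typesOf z Γs)) (entries Γs
      zs) (ndent (typesOf z Γs)) (DistinctCtx-entries Γs zs n)
  (λ p q → a (subst (_∈ zs) (∈dom-entry′ z _ p) (dom-entries Γs zs q)))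
  where
  ndent : ∀ T → DistinctCtx (entry′ z T)
  ndent [] = []
  ndent (σ ∷ σs) = (λ ()) ∷ []

DistinctCtx-⋀ᶜ : ∀ Γs → DistinctCtx (⋀ᶜ Γs)
DistinctCtx-⋀ᶜ Γs = DistinctCtx-entries Γs (nub (concatDom Γs)) (Distinct-nub (concatDom Γs))

∈dom⇒lookup≢nothing : ∀ {y} Γ → y ∈ dom Γ → lookup y Γ ≢ nothing
∈dom⇒lookup≢nothing Γ p e = lookup-nothing-∉ Γ e p

lookup≢nothing⇒∈dom : ∀ {y} Γ → lookup y Γ ≢ nothing → y ∈ dom Γ
lookup≢nothing⇒∈dom {y} Γ h with lookup y Γ in eq
... | just σ = lookup-just-∈ Γ eq
... | nothing = ⊥-elim (h refl)

≈ᵐ-nothing⁻ : ∀ {a b} → a ≈ᵐ b → b ≡ nothing → a ≡ nothing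
≈ᵐ-nothing⁻ nothing e = refl
≈ᵐ-nothing⁻ (just _) ()

≈ᵐ-just⁻ : ∀ {mm σ} → mm ≈ᵐ just σ → Σ ITy (λ σ₀ → (mm ≡ just σ₀) × (σ₀ ≈ σ))
≈ᵐ-just⁻ (just r) = _ , refl , r

≅-∈ : ∀ {Γ Δ y} → Γ ≅ Δ → y ∈ dom Γ → y ∈ dom Δ
≅-∈ {Γ} {Δ} {y} e p = lookup≢nothing⇒∈dom Δ (λ q → ∈dom⇒lookup≢nothing Γ p (≈ᵐ-nothing⁻ (at e y) q))

module _ {Θ x σ Γ} (e : Θ ≅ ((x , σ) ∷ Γ)) where
  ≅-here : lookup x Θ ≈ᵐ just σ
  ≅-here = subst (lookup x Θ ≈ᵐ_) (lookup-here x σ Γ) (at e x)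

  ≅-there : ∀ y → y ≢ x → lookup y Θ ≈ᵐ lookup y Γ
  ≅-there y ne = subst (lookup y Θ ≈ᵐ_) (lookup-there σ Γ ne) (at e y)

  ≅-∈dom-here : x ∈ dom Θ
  ≅-∈dom-here = lookup≢nothing⇒∈dom Θ (λ q → case (subst (λ mm → mm ≈ᵐ just σ) q ≅-here))
    where
    case : nothing ≈ᵐ just σ → ⊥
    case ()

  ≅-∈dom-there : ∀ {y} → y ∈ dom Θ → y ≢ x → y ∈ dom Γ
  ≅-∈dom-there {y} p ne = lookup≢nothing⇒∈dom Γ (λ q → ∈dom⇒lookup≢nothing Θ p (≈ᵐ-nothing⁻ (≅-there y ne) q))

⋀ᶜ-dom : ∀ Γs {y} → y ∈ dom (⋀ᶜ Γs) → y ∈ concatDom Γs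
⋀ᶜ-dom Γs p = nub-⊆ (concatDom Γs) (dom-entries Γs (nub (concatDom Γs)) p)

∈concatDom : ∀ {y} Γ Γs → y ∈ dom Γ → Γ ∈ Γs → y ∈ concatDom Γs
∈concatDom Γ (Γ' ∷ Γs) p (here refl) = ∈-++⁺ˡ p
∈concatDom Γ (Γ' ∷ Γs) p (there q) = ∈-++⁺ʳ (dom Γ') (∈concatDom Γ Γs p q)

concatDom-⋀ᶜ : ∀ Γs {y} → y ∈ concatDom Γs → y ∈ dom (⋀ᶜ Γs)
concatDom-⋀ᶜ Γs {y} p = lookup≢nothing⇒∈dom (⋀ᶜ Γs) (λ e → nz (trans (sym (lookup-⋀ᶜ y Γs)) e))
  where
  ne : ∀ Γs → y ∈ concatDom Γs → typesOf y Γs ≢ []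
  ne (Γ ∷ Γs) p e with ∈-++⁻ (dom Γ) p
  ... | inj₁ q rewrite typesOf-∷ y Γ Γs with lookup-∈ Γ q
  ...   | σ , eq rewrite eq with e
  ...     | ()
  ne (Γ ∷ Γs) p e | inj₂ q rewrite typesOf-∷ y Γ Γs with lookup y Γ
  ...   | nothing = ne Γs q e
  ...   | just _ with e
  ...     | ()
  nz : interᵐ (typesOf y Γs) ≢ nothing
  nz e with typesOf y Γs in eq
  ... | [] = ne Γs p eq
  ... | σ ∷ σs with e
  ...   | ()

-- Derivations

⊢-cast : ∀ {Γ Γ' M M' σ σ'} → Γ ≡ Γ' → M ≡ M' → σ ≡ σ' → Γ ⊢ M ∶ σ → Γ' ⊢ M' ∶ σ'
⊢-cast refl refl refl d = d

mutual
  size : ∀ {Γ M σ} → Γ ⊢ M ∶ σ → ℕ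
  size ax = 1
  size (w d _) = suc (size d)
  size (⇒I d) = suc (size d)
  size (⇒E d e _) = suc (size d + size e)
  size (∧I js d e ds) = suc (size d + size e + sizeAll ds)
  size (m ys d _) = suc (size d)
  size (conv d _ _) = suc (size d)

  sizeAll : ∀ {M} {js : List (Ctx × ITy)} → All (λ j → proj₁ j ⊢ M ∶ proj₂ j) js → ℕ
  sizeAll [] = 0
  sizeAll (d ∷ ds) = size d + sizeAll ds

size-⊢-cast : ∀ {Γ Γ' M M' σ σ'} (p : Γ ≡ Γ') (q : M ≡ M') (r : σ ≡ σ') (d : Γ ⊢ M ∶ σ) → size (⊢-cast p q r d) ≡ size d
size-⊢-cast refl refl refl d = refl

⊢-cast-sized : ∀ {Γ Γ' M M' σ σ'} → Γ ≡ Γ' → M ≡ M' → σ ≡ σ' → (d : Γ ⊢ M ∶ σ) → Σ (Γ' ⊢ M' ∶ σ') (λ d' → size d' ≡ size d)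
⊢-cast-sized p q r d = ⊢-cast p q r d , size-⊢-cast p q r d

size≢0 : ∀ {Γ M σ} (d : Γ ⊢ M ∶ σ) → size d ≢ 0
size≢0 ax ()
size≢0 (w d x) ()
size≢0 (⇒I d) ()
size≢0 (⇒E d d₁ x) ()
size≢0 (∧I js d d₁ x) ()
size≢0 (m ys d x) ()
size≢0 (conv d x x₁) ()

typesOf-↭ : ∀ y {Γs Γs'} → Γs ↭ Γs' → typesOf y Γs ↭ typesOf y Γs'
typesOf-↭ y ↭refl = ↭refl
typesOf-↭ y {Γ ∷ Γs} {.Γ ∷ Γs'} (prep Γ p) rewrite typesOf-∷ y Γ Γs | typesOf-∷ y Γ Γs' with lookup y Γ
... | nothing = typesOf-↭ y p
... | just σ = prep σ (typesOf-↭ y p)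
typesOf-↭ y {Γ ∷ Δ ∷ Γs} {.Δ ∷ .Γ ∷ Γs'} (swap Γ Δ p) rewrite typesOf-∷ y Γ (Δ ∷ Γs) | typesOf-∷ y Δ (Γ ∷
      Γs') | typesOf-∷ y Δ Γs | typesOf-∷ y Γ Γs'
  with lookup y Γ | lookup y Δ
... | nothing | nothing = typesOf-↭ y p
... | nothing | just b = prep b (typesOf-↭ y p)
... | just a | nothing = prep a (typesOf-↭ y p)
... | just a | just b = swap a b (typesOf-↭ y p)
typesOf-↭ y (↭tr p q) = ↭tr (typesOf-↭ y p) (typesOf-↭ y q)

interᵐ-↭ : ∀ {T T'} → T ↭ T' → interᵐ T ≈ᵐ interᵐ T'
interᵐ-↭ {[]} {[]} p = nothing
interᵐ-↭ {[]} {x ∷ T'} p with ↭-length p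
... | ()
interᵐ-↭ {x ∷ T} {[]} p with ↭-length p
... | ()
interᵐ-↭ {a ∷ []} {b ∷ []} p with ↭-singleton-inv p
... | refl = just (≈-refl a)
interᵐ-↭ {a ∷ []} {b ∷ c ∷ T'} p with ↭-length p
... | ()
interᵐ-↭ {a ∷ c ∷ T} {b ∷ []} p with ↭-length p
... | ()
interᵐ-↭ {a ∷ c ∷ T} {b ∷ d ∷ T'} p = just (⋀≈ p (≈*-refl _))

⋀ᶜ-↭ : ∀ {Γs Γs'} → Γs ↭ Γs' → ⋀ᶜ Γs ≅ ⋀ᶜ Γs'
⋀ᶜ-↭ {Γs} {Γs'} p = mk≅ h
  where
  h : ∀ y → lookup y (⋀ᶜ Γs) ≈ᵐ lookup y (⋀ᶜ Γs')
  h y rewrite lookup-⋀ᶜ y Γs | lookup-⋀ᶜ y Γs' = interᵐ-↭ (typesOf-↭ y p)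

⋀ᶜ-single : ∀ Δ → ⋀ᶜ (Δ ∷ []) ≅ Δ
⋀ᶜ-single Δ = mk≅ h
  where
  h : ∀ y → lookup y (⋀ᶜ (Δ ∷ [])) ≈ᵐ lookup y Δ
  h y rewrite lookup-⋀ᶜ y (Δ ∷ []) | typesOf-∷ y Δ [] with lookup y Δ
  ... | nothing = nothing
  ... | just σ = just (≈-refl σ)

⊢-distinct : ∀ {Γ M σ} → Γ ⊢ M ∶ σ → DistinctCtx Γ
⊢-distinct ax = (λ ()) ∷ []
⊢-distinct (w d h) = h ∷ ⊢-distinct d
⊢-distinct (⇒I d) with ⊢-distinct d
... | _ ∷ n = n
⊢-distinct (⇒E {Γ = Γ} {Δ = Δ} d e h) = DistinctCtx-++⁺ Γ Δ (⊢-distinct d) (⊢-distinct e) h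
⊢-distinct (∧I {Γ₁ = Γ₁} {Γ₂ = Γ₂} js d e ds) = DistinctCtx-⋀ᶜ (Γ₁ ∷ Γ₂ ∷ map proj₁ js)
⊢-distinct (m {Γ = Γ} ys d h) = h ∷ DistinctCtx-++⁻ˡ Γ _ (⊢-distinct d)
⊢-distinct (conv d e _) = DistinctCtx-≈ᶜ (⊢-distinct d) e

⊢-FV⊆dom : ∀ {Γ M σ} → Γ ⊢ M ∶ σ → ∀ {y} → y ∈ FV M → y ∈ dom Γ
⊢-FV⊆dom ax (here refl) = here refl
⊢-FV⊆dom (w d h) p = there (⊢-FV⊆dom d p)
⊢-FV⊆dom (⇒I {x = x} {M = M} d) p with ∈FV-close⁻ 0 x M p
... | q , ne with ⊢-FV⊆dom d q
...   | here e = ⊥-elim (ne e)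
...   | there r = r
⊢-FV⊆dom (⇒E {Γ = Γ} {Δ = Δ} {M = M} d e h) p with ∈-++⁻ (FV M) p
... | inj₁ q = ∈dom-++ˡ Γ Δ (⊢-FV⊆dom d q)
... | inj₂ q = ∈dom-++ʳ Γ Δ (⊢-FV⊆dom e q)
⊢-FV⊆dom (∧I {Γ₁ = Γ₁} {Γ₂ = Γ₂} js d e ds) p = concatDom-⋀ᶜ (Γ₁ ∷ Γ₂ ∷ map proj₁ js) (∈-++⁺ˡ (⊢-FV⊆dom d p))
⊢-FV⊆dom (m {Γ = Γ} {M = M} {x = x} {x₁ = x₁} ys d h) {y} p rewrite rename*-as-sub (x₁ ∷ dom ys) x M
  with ∈FV-sub⁻ M (collapse (x₁ ∷ dom ys) x) p
... | z , q , r with z ∈? (x₁ ∷ dom ys)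
...   | yes _ with r
...     | here refl = here refl
⊢-FV⊆dom (m {Γ = Γ} {M = M} {x = x} {x₁ = x₁} ys d h) {y} p | z , q , r | no nin with r
...     | here refl with ∈dom-++⁻ Γ _ (⊢-FV⊆dom d q)
...       | inj₁ a = there a
...       | inj₂ a = ⊥-elim (nin a)
⊢-FV⊆dom (conv d e _) p = ≅-∈ (≈ᶜ⇒≅ (⊢-distinct d) e) (⊢-FV⊆dom d p)

⊢-∉dom⇒∉FV : ∀ {Γ M σ y} → Γ ⊢ M ∶ σ → y ∉ dom Γ → y ∉ FV M
⊢-∉dom⇒∉FV d h p = h (⊢-FV⊆dom d p)

⊢-FV-++ : ∀ {Ξ Y M τ} → (Ξ ++ Y) ⊢ M ∶ τ → ∀ {v} → v ∈ FV M → (v ∈ dom Ξ) ⊎ (v ∈ dom Y)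
⊢-FV-++ {Ξ} {Y} d p = ∈dom-++⁻ Ξ Y (⊢-FV⊆dom d p)

-- Renaming derivations

ren : (Var → Var) → Term → Term
ren f = sub (λ y → fv (f y))

renᵉ : (Var → Var) → Var × ITy → Var × ITy
renᵉ f p = f (proj₁ p) , proj₂ p

renᶜ : (Var → Var) → Ctx → Ctx
renᶜ f = map (renᵉ f)

module _ {f : Var → Var} (inj : Injective _≡_ _≡_ f) where

  close-ren : ∀ k x M → ren f (close k x M) ≡ close k (f x) (ren f M)
  close-ren k x (fv y) with y ≟ x | f y ≟ f x
  ... | yes _ | yes _ = refl
  ... | yes refl | no ne = ⊥-elim (ne refl)
  ... | no ne | yes e = ⊥-elim (ne (inj e))
  ... | no _ | no _ = refl
  close-ren k x (bv i) = refl
  close-ren k x (app M N) = cong₂ app (close-ren k x M) (close-ren k x N)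
  close-ren k x (lam M) = cong lam (close-ren (suc k) x M)

  ∈-map-inj : ∀ {y} xs → f y ∈ map f xs → y ∈ xs
  ∈-map-inj (x ∷ xs) (here e) = here (inj e)
  ∈-map-inj (x ∷ xs) (there p) = there (∈-map-inj xs p)

  ∈?-map : ∀ y xs → ⌊ f y ∈? map f xs ⌋ ≡ ⌊ y ∈? xs ⌋
  ∈?-map y xs with f y ∈? map f xs | y ∈? xs
  ... | yes _ | yes _ = refl
  ... | yes p | no q = ⊥-elim (q (∈-map-inj xs p))
  ... | no p | yes q = ⊥-elim (p (∈-map⁺ f q))
  ... | no _ | no _ = refl

  rename-ren : ∀ xs x M → ren f (rename* xs x M) ≡ rename* (map f xs) (f x) (ren f M)
  rename-ren xs x M = begin
      ren f (rename* xs x M)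
        ≡⟨ cong (ren f) (rename*-as-sub xs x M) ⟩
      sub (λ y → fv (f y)) (sub (collapse xs x) M)
        ≡⟨ sub-sub M _ _ ⟩
      sub (λ y → sub (λ z → fv (f z)) (collapse xs x y)) M
        ≡⟨ sub-cong M (λ y _ → pt y) ⟩
      sub (λ y → sub (collapse (map f xs) (f x)) (fv (f y))) M
        ≡⟨ sym (sub-sub M _ _) ⟩
      sub (collapse (map f xs) (f x)) (ren f M)
        ≡⟨ sym (rename*-as-sub (map f xs) (f x) (ren f M)) ⟩
      rename* (map f xs) (f x) (ren f M) ∎
    where
    open ≡-Reasoning
    pt : ∀ y → sub (λ z → fv (f z)) (collapse xs x y) ≡ collapse (map f xs) (f x) (f y)
    pt y with y ∈? xs | f y ∈? map f xs
    ... | yes _ | yes _ = refl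
    ... | yes p | no q = ⊥-elim (q (∈-map⁺ f p))
    ... | no p | yes q = ⊥-elim (p (∈-map-inj xs q))
    ... | no _ | no _ = refl

  dom-renᶜ : ∀ Γ → dom (renᶜ f Γ) ≡ map f (dom Γ)
  dom-renᶜ [] = refl
  dom-renᶜ (p ∷ Γ) = cong (_ ∷_) (dom-renᶜ Γ)

  ∉dom-renᶜ : ∀ {y} Γ → y ∉ dom Γ → f y ∉ dom (renᶜ f Γ)
  ∉dom-renᶜ Γ h p = h (∈-map-inj (dom Γ) (subst (_ ∈_) (dom-renᶜ Γ) p))

  lookup-renᶜ : ∀ y Γ → lookup (f y) (renᶜ f Γ) ≡ lookup y Γ
  lookup-renᶜ y [] = refl
  lookup-renᶜ y ((z , σ) ∷ Γ) with f y ≟ f z | y ≟ z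
  ... | yes _ | yes _ = refl
  ... | yes e | no ne = ⊥-elim (ne (inj e))
  ... | no ne | yes refl = ⊥-elim (ne refl)
  ... | no _ | no _ = lookup-renᶜ y Γ

  nub-map : ∀ ys → nub (map f ys) ≡ map f (nub ys)
  nub-map [] = refl
  nub-map (y ∷ ys) rewrite ∈?-map y ys with y ∈? ys
  ... | yes _ = nub-map ys
  ... | no _ = cong (f y ∷_) (nub-map ys)

  concatDom-map : ∀ Γs → concatDom (map (renᶜ f) Γs) ≡ map f (concatDom Γs)
  concatDom-map [] = refl
  concatDom-map (Γ ∷ Γs) = trans (cong₂ _++_ (dom-renᶜ Γ) (concatDom-map Γs)) (sym (map-++ f (dom Γ) (concatDom Γs)))

  typesOf-ren : ∀ y Γs → typesOf (f y) (map (renᶜ f) Γs) ≡ typesOf y Γs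
  typesOf-ren y [] = refl
  typesOf-ren y (Γ ∷ Γs) rewrite typesOf-∷ (f y) (renᶜ f Γ) (map (renᶜ f) Γs) | typesOf-∷ y Γ Γs
    | lookup-renᶜ y Γ | typesOf-ren y Γs = refl

  entries-ren : ∀ Γs zs → entries (map (renᶜ f) Γs) (map f zs) ≡ renᶜ f (entries Γs zs)
  entries-ren Γs [] = refl
  entries-ren Γs (z ∷ zs) rewrite entry≡entry′ (map (renᶜ f) Γs) (f z) | entry≡entry′ Γs z | typesOf-ren z Γs
    | map-++ (renᵉ f) (entry′ z (typesOf z Γs)) (entries Γs zs) | entries-ren Γs zs = cong (_++ renᶜ f (entries Γs zs)) (h (typesOf z Γs))
    where
    h : ∀ T → entry′ (f z) T ≡ renᶜ f (entry′ z T)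
    h [] = refl
    h (σ ∷ σs) = refl

  ⋀ᶜ-ren : ∀ Γs → ⋀ᶜ (map (renᶜ f) Γs) ≡ renᶜ f (⋀ᶜ Γs)
  ⋀ᶜ-ren Γs rewrite concatDom-map Γs | nub-map (concatDom Γs) = entries-ren Γs (nub (concatDom Γs))

  Pointwise-renᶜ : ∀ {Γ Θ} → Pointwise EntryEq Γ Θ → Pointwise EntryEq (renᶜ f Γ) (renᶜ f Θ)
  Pointwise-renᶜ [] = []
  Pointwise-renᶜ ((e , r) ∷ p) = (cong f e , r) ∷ Pointwise-renᶜ p

  ≈ᶜ-ren : ∀ {Γ Γ'} → Γ ≈ᶜ Γ' → renᶜ f Γ ≈ᶜ renᶜ f Γ'
  ≈ᶜ-ren (Θ , p , q) = renᶜ f Θ , map⁺ (renᵉ f) p , Pointwise-renᶜ q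

  renᶜ-++ : ∀ Γ Δ → renᶜ f (Γ ++ Δ) ≡ renᶜ f Γ ++ renᶜ f Δ
  renᶜ-++ Γ Δ = map-++ (renᵉ f) Γ Δ

  #-renᶜ : ∀ {Γ Δ} → Γ # Δ → renᶜ f Γ # renᶜ f Δ
  #-renᶜ {Γ} {Δ} h p q with ∈-map⁻ f (subst (_ ∈_) (dom-renᶜ Γ) p) | ∈-map⁻ f (subst (_ ∈_) (dom-renᶜ Δ) q)
  ... | a , a∈ , refl | b , b∈ , e = h a∈ (subst (_∈ dom Δ) (sym (inj e)) b∈)

  js-ren : List (Ctx × ITy) → List (Ctx × ITy)
  js-ren = map (λ j → renᶜ f (proj₁ j) , proj₂ j)

  js-ren₁ : ∀ js → map proj₁ (js-ren js) ≡ map (renᶜ f) (map proj₁ js)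
  js-ren₁ [] = refl
  js-ren₁ (j ∷ js) = cong (_ ∷_) (js-ren₁ js)

  js-ren₂ : ∀ js → map proj₂ (js-ren js) ≡ map proj₂ js
  js-ren₂ [] = refl
  js-ren₂ (j ∷ js) = cong (_ ∷_) (js-ren₂ js)

  ys-ren₂ : ∀ (ys : Ctx) → map proj₂ (renᶜ f ys) ≡ map proj₂ ys
  ys-ren₂ [] = refl
  ys-ren₂ (j ∷ js) = cong (_ ∷_) (ys-ren₂ js)

  mutual
    ⊢-ren : ∀ {Γ M τ} (d : Γ ⊢ M ∶ τ) → Σ (renᶜ f Γ ⊢ ren f M ∶ τ) (λ d' → size d' ≡ size d)
    ⊢-ren ax = ax , refl
    ⊢-ren (w {Γ = Γ} d h) with ⊢-ren d
    ... | d' , e = w d' (∉dom-renᶜ Γ h) , cong suc e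
    ⊢-ren (⇒I {x = x} {M = M} d) with ⊢-ren d
    ... | d' , e with ⊢-cast-sized refl (cong lam (sym (close-ren 0 x M))) refl (⇒I d')
    ...   | d'' , e' = d'' , trans e' (cong suc e)
    ⊢-ren (⇒E {Γ = Γ} {Δ = Δ} d₁ d₂ h) with ⊢-ren d₁ | ⊢-ren d₂
    ... | d₁' , e₁ | d₂' , e₂ with ⊢-cast-sized (sym (renᶜ-++ Γ Δ)) refl refl (⇒E d₁' d₂' (#-renᶜ {Γ} {Δ} h))
    ...   | d'' , e' = d'' , trans e' (cong₂ (λ a b → suc (a + b)) e₁ e₂)
    ⊢-ren (∧I {Γ₁ = Γ₁} {Γ₂ = Γ₂} js d₁ d₂ ds) with ⊢-ren d₁ | ⊢-ren d₂ | ⊢-renAll js ds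
    ... | d₁' , e₁ | d₂' , e₂ | ds' , es
      with ⊢-cast-sized (trans (cong (λ l → ⋀ᶜ (renᶜ f Γ₁ ∷ renᶜ f Γ₂ ∷ l)) (js-ren₁ js)) (⋀ᶜ-ren (Γ₁ ∷ Γ₂ ∷ map proj₁ js)))
                  refl (cong (⋀ _ _) (js-ren₂ js)) (∧I (js-ren js) d₁' d₂' ds')
    ...   | d'' , e' = d'' , trans e' (cong suc (cong₂ _+_ (cong₂ _+_ e₁ e₂) es))
    ⊢-ren (m {Γ = Γ} {M = M} {x = x} {x₁ = x₁} ys d h) with ⊢-cast-sized (renᶜ-++ Γ _) refl refl (proj₁ (⊢-ren d))
    ... | d' , e' with ⊢-cast-sized (cong₂ (λ a b → (f x , inter _ a) ∷ b) (ys-ren₂ ys) refl)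
                         (trans (cong (λ l → rename* (f x₁ ∷ l) (f x) (ren f M)) (dom-renᶜ ys)) (sym (rename-ren (x₁ ∷ dom ys) x M)))
                         refl (m (renᶜ f ys) d' (∉dom-renᶜ Γ h))
    ...   | d'' , e'' = d'' , trans e'' (cong suc (trans e' (proj₂ (⊢-ren d))))
    ⊢-ren (conv d e t) with ⊢-ren d
    ... | d' , e' = conv d' (≈ᶜ-ren e) t , cong suc e'

    ⊢-renAll : ∀ {M} js (ds : All (λ j → proj₁ j ⊢ M ∶ proj₂ j) js) →
             Σ (All (λ j → proj₁ j ⊢ ren f M ∶ proj₂ j) (js-ren js)) (λ ds' → sizeAll ds' ≡ sizeAll ds)
    ⊢-renAll [] [] = [] , refl
    ⊢-renAll (j ∷ js) (d ∷ ds) with ⊢-ren d | ⊢-renAll js ds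
    ... | d' , e | ds' , es = (d' ∷ ds') , cong₂ _+_ e es

transpose : Var → Var → Var → Var
transpose a b y = if ⌊ y ≟ a ⌋ then b else (if ⌊ y ≟ b ⌋ then a else y)

transpose-left : ∀ a b → transpose a b a ≡ b
transpose-left a b with a ≟ a
... | yes _ = refl
... | no ne = ⊥-elim (ne refl)

transpose-right : ∀ a b → transpose a b b ≡ a
transpose-right a b with b ≟ a
... | yes refl = refl
... | no _ with b ≟ b
...   | yes _ = refl
...   | no ne = ⊥-elim (ne refl)

transpose-other : ∀ a b y → y ≢ a → y ≢ b → transpose a b y ≡ y
transpose-other a b y na nb with y ≟ a
... | yes e = ⊥-elim (na e)
... | no _ with y ≟ b
...   | yes e = ⊥-elim (nb e)
...   | no _ = refl

transpose-involutive : ∀ a b y → transpose a b (transpose a b y) ≡ y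
transpose-involutive a b y with y ≟ a
... | yes refl = transpose-right y b
... | no na with y ≟ b
...   | yes refl = transpose-left a y
...   | no nb = transpose-other a b y na nb

transpose-injective : ∀ a b → Injective _≡_ _≡_ (transpose a b)
transpose-injective a b {y} {z} e = trans (sym (transpose-involutive a b y)) (trans (cong (transpose a b) e) (transpose-involutive a b z))

lookup-renᶜ-transpose : ∀ a b y Γ → lookup y (renᶜ (transpose a b) Γ) ≡ lookup (transpose a b y) Γ
lookup-renᶜ-transpose a b y Γ = trans (cong (λ z → lookup z (renᶜ (transpose a b) Γ))
      (sym (transpose-involutive a b y))) (lookup-renᶜ (transpose-injective a b) (transpose a b y) Γ)

renᶜ-id : ∀ f Γ → (∀ {z} → z ∈ dom Γ → f z ≡ z) → renᶜ f Γ ≡ Γ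
renᶜ-id f [] h = refl
renᶜ-id f ((z , σ) ∷ Γ) h = cong₂ _∷_ (cong (_, σ) (h (here refl))) (renᶜ-id f Γ (λ p → h (there p)))

ren-id : ∀ f M → (∀ {z} → z ∈ FV M → f z ≡ z) → ren f M ≡ M
ren-id f M h = trans (sub-cong M (λ y p → cong fv (h p))) (sub-id M)

∈⇒≤sum : ∀ {y} xs → y ∈ xs → y ≤ sum xs
∈⇒≤sum (x ∷ xs) (here refl) = m≤m+n x (sum xs)
∈⇒≤sum (x ∷ xs) (there p) = m≤n⇒m≤o+n x (∈⇒≤sum xs p)

fresh : List Var → Var
fresh xs = suc (sum xs)

fresh-∉ : ∀ xs → fresh xs ∉ xs
fresh-∉ xs p = n≮n (sum xs) (∈⇒≤sum xs p)

-- Conversion and weakening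

conv≅ : ∀ {Γ Γ' M τ} → Γ ⊢ M ∶ τ → DistinctCtx Γ' → Γ ≅ Γ' → Γ' ⊢ M ∶ τ
conv≅ {Γ} {Γ'} {τ = τ} d n e = conv d (≅⇒≈ᶜ Γ Γ' (⊢-distinct d) n e) (≈-refl τ)

<∣>-cong : ∀ {a a' b b'} → a ≈ᵐ a' → b ≈ᵐ b' → (a <∣> b) ≈ᵐ (a' <∣> b')
<∣>-cong nothing r = r
<∣>-cong (just e) r = just e

≅-++ : ∀ {Γ Γ' Δ Δ'} → Γ ≅ Γ' → Δ ≅ Δ' → (Γ ++ Δ) ≅ (Γ' ++ Δ')
≅-++ {Γ} {Γ'} {Δ} {Δ'} e f = mk≅ h
  where
  h : ∀ y → lookup y (Γ ++ Δ) ≈ᵐ lookup y (Γ' ++ Δ')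
  h y rewrite lookup-++ y Γ Δ | lookup-++ y Γ' Δ' = <∣>-cong (at e y) (at f y)

≅-∷ : ∀ {y σ σ' Γ Γ'} → σ ≈ σ' → Γ ≅ Γ' → ((y , σ) ∷ Γ) ≅ ((y , σ') ∷ Γ')
≅-∷ {y} {σ} {σ'} {Γ} {Γ'} r e = mk≅ h
  where
  h : ∀ z → lookup z ((y , σ) ∷ Γ) ≈ᵐ lookup z ((y , σ') ∷ Γ')
  h z with z ≟ y
  ... | yes _ = just r
  ... | no _ = at e z

≅-delete : ∀ {x t} C → lookup x C ≡ just t → C ≅ ((x , t) ∷ delete x C)
≅-delete {x} {t} C eq = mk≅ h
  where
  h : ∀ y → lookup y C ≈ᵐ lookup y ((x , t) ∷ delete x C)
  h y with y ≟ x
  ... | yes refl rewrite eq = just (≈-refl t)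
  ... | no ne rewrite lookup-delete-other C ne = ≈ᵐ-refl _

<∣>-comm-disjoint : ∀ (a b : Maybe ITy) → (∀ {s t} → a ≡ just s → b ≡ just t → ⊥) → (a <∣> b) ≡ (b <∣> a)
<∣>-comm-disjoint nothing nothing h = refl
<∣>-comm-disjoint nothing (just x) h = refl
<∣>-comm-disjoint (just x) nothing h = refl
<∣>-comm-disjoint (just x) (just y) h = ⊥-elim (h refl refl)

≅-++-comm : ∀ Γ Δ → Γ # Δ → (Γ ++ Δ) ≅ (Δ ++ Γ)
≅-++-comm Γ Δ h = mk≅ hh
  where
  hh : ∀ y → lookup y (Γ ++ Δ) ≈ᵐ lookup y (Δ ++ Γ)
  hh y rewrite lookup-++ y Γ Δ | lookup-++ y Δ Γ = ≈ᵐ-reflexive (<∣>-comm-disjoint (lookup y Γ) (lookup y Δ)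
        (λ p q → h (lookup-just-∈ Γ p) (lookup-just-∈ Δ q)))

≅-reflexive : ∀ {Γ Δ} → Γ ≡ Δ → Γ ≅ Δ
≅-reflexive {Γ} refl = ≅-refl {Γ}

#-sym : ∀ {Γ Δ} → Γ # Δ → Δ # Γ
#-sym h p q = h q p

-- A variable of type σ₁ ∧ ⋯ ∧ σₙ is introduced as n fresh variables, weakened one by one,
-- and contracted with (m).
mutual
  weaken : ∀ {Γ M τ y} → Γ ⊢ M ∶ τ → y ∉ dom Γ → ∀ ρ → ((y , ρ) ∷ Γ) ⊢ M ∶ τ
  weaken d h (lin A) = w d h
  weaken {Γ} {M} {τ} {y} d h (⋀ ρ₁ ρ₂ ρs) with weakenBlock d ρs
  ... | Z , e , fr , d₁ =
    let c₂ = fresh (dom (Z ++ Γ))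
        d₂ = weaken {y = c₂} d₁ (fresh-∉ _) ρ₂
        c₁ = fresh (dom ((c₂ , ρ₂) ∷ Z ++ Γ))
        d₃ = weaken {y = c₁} d₂ (fresh-∉ _) ρ₁
        Z' = (c₁ , ρ₁) ∷ (c₂ , ρ₂) ∷ Z
        nd₃ = ⊢-distinct d₃
        fr' : ∀ {z} → z ∈ dom Z' → z ∉ dom Γ
        fr' = λ p q → DistinctCtx-++⇒# Z' Γ nd₃ p q
        d₄ = conv≅ {Γ' = Γ ++ Z'} d₃ (DistinctCtx-++⁺ Γ Z' (DistinctCtx-++⁻ʳ Z' Γ nd₃) (DistinctCtx-++⁻ˡ Z' Γ nd₃) (λ p q → fr' q p))
                (≅-++-comm Z' Γ (λ p q → fr' p q))
        d₅ = m ((c₂ , ρ₂) ∷ Z) d₄ h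
        eqM : rename* (c₁ ∷ c₂ ∷ dom Z) y M ≡ M
        eqM = rename-fresh (dom Z') y M (λ z p q → fr' q (⊢-FV⊆dom d p))
    in ⊢-cast (cong (λ l → (y , ⋀ ρ₁ ρ₂ l) ∷ Γ) e) eqM refl d₅

  weakenBlock : ∀ {Γ M τ} → Γ ⊢ M ∶ τ → (ρs : List ITy) → Σ Ctx (λ Z → (map proj₂ Z ≡ ρs) × (∀ {z} → z ∈ dom Z → z ∉ dom Γ) ×
        ((Z ++ Γ) ⊢ M ∶ τ))
  weakenBlock d [] = [] , refl , (λ ()) , d
  weakenBlock {Γ} d (ρ ∷ ρs) with weakenBlock d ρs
  ... | Z , e , fr , d₁ =
    let c = fresh (dom (Z ++ Γ)) in
    ((c , ρ) ∷ Z) , cong (ρ ∷_) e ,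
    (λ { (here refl) q → fresh-∉ (dom (Z ++ Γ)) (∈dom-++ʳ Z Γ q) ; (there p) → fr p }) ,
    weaken d₁ (fresh-∉ _) ρ

≅-middle : ∀ z ρ Γ Δ → z ∉ dom Γ → ((z , ρ) ∷ (Γ ++ Δ)) ≅ (Γ ++ (z , ρ) ∷ Δ)
≅-middle z ρ Γ Δ h = ≅-trans {(z , ρ) ∷ (Γ ++ Δ)} {(Γ ++ (z , ρ) ∷ []) ++ Δ}
  (≅-++ {(z , ρ) ∷ Γ} {Γ ++ (z , ρ) ∷ []} {Δ} {Δ} (≅-++-comm ((z , ρ) ∷ []) Γ (λ { (here refl) q → h q })) (≅-refl {Δ}))
  (≅-reflexive (++-assoc Γ ((z , ρ) ∷ []) Δ))

≅-++-exchange : ∀ Ξ Y D → Y # D → ((Ξ ++ Y) ++ D) ≅ ((Ξ ++ D) ++ Y)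
≅-++-exchange Ξ Y D h = ≅-trans {(Ξ ++ Y) ++ D} {Ξ ++ (Y ++ D)}
  (≅-reflexive (++-assoc Ξ Y D))
  (≅-trans {Ξ ++ (Y ++ D)} {Ξ ++ (D ++ Y)} (≅-++ {Ξ} {Ξ} (≅-refl {Ξ}) (≅-++-comm Y D h)) (≅-reflexive (sym (++-assoc Ξ D Y))))

weaken-++ : ∀ {Γ M τ} Δ → Γ ⊢ M ∶ τ → Γ # Δ → DistinctCtx Δ → (Γ ++ Δ) ⊢ M ∶ τ
weaken-++ {Γ} [] d h n = subst (λ G → G ⊢ _ ∶ _) (sym (++-identityʳ Γ)) d
weaken-++ {Γ} ((y , ρ) ∷ Δ) d h (a ∷ n) =
  let d₁ = weaken-++ Δ d (λ p q → h p (there q)) n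
      d₂ = weaken {y = y} d₁ (∉dom-++ Γ Δ (λ p → h p (here refl)) a) ρ
  in conv≅ d₂ (DistinctCtx-++⁺ Γ ((y , ρ) ∷ Δ) (⊢-distinct d) (a ∷ n) h) (≅-middle y ρ Γ Δ (λ p → h p (here refl)))

-- Renaming a block of assumptions apart

record Freshening (Ξ Y : Ctx) {M τ} (d : (Ξ ++ Y) ⊢ M ∶ τ) (avoid : List Var) : Set where
  field
    block       : Ctx
    newName     : Var → Var
    deriv       : (Ξ ++ block) ⊢ ren newName M ∶ τ
    size-deriv  : size deriv ≡ size d
    block-types : map proj₂ block ≡ map proj₂ Y
    block-fresh : ∀ {c} → c ∈ dom block → c ∉ avoid
    block-#Ξ    : ∀ {c} → c ∈ dom block → c ∉ dom Ξ
    maps-block  : ∀ {v} → v ∈ FV M → v ∈ dom Y → newName v ∈ dom block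
    fixes-rest  : ∀ {v} → v ∈ FV M → v ∉ dom Y → newName v ≡ v

-- One transposition per variable of the block.
freshen : ∀ Ξ Y {M τ} (d : (Ξ ++ Y) ⊢ M ∶ τ) (avoid : List Var) → Freshening Ξ Y d avoid
freshen Ξ [] {M} d avoid = record
  { block = [] ; newName = λ v → v
  ; deriv = ⊢-cast refl (sym (sub-id M)) refl d ; size-deriv = size-⊢-cast refl (sym (sub-id M)) refl d
  ; block-types = refl ; block-fresh = λ () ; block-#Ξ = λ () ; maps-block = λ _ () ; fixes-rest = λ _ _ → refl }
freshen Ξ ((y , ρ) ∷ Y) {M} {τ} d avoid = record
  { block = (c , ρ) ∷ block
  ; newName = λ v → t (newName v)
  ; deriv = d₂
  ; size-deriv = trans (size-⊢-cast ctx-eq (sub-sub M _ _) refl (proj₁ d₁))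
      (trans (proj₂ d₁) (trans (size-⊢-cast (++-assoc Ξ _ block) refl refl deriv)
        (trans size-deriv (size-⊢-cast (sym (++-assoc Ξ _ Y)) refl refl d))))
  ; block-types = cong (ρ ∷_) block-types
  ; block-fresh = λ { (here refl) → c∉avoid ; (there p) → block-fresh p }
  ; block-#Ξ = λ { (here refl) → c∉Ξ ; (there p) q → block-#Ξ p (∈dom-++ˡ Ξ _ q) }
  ; maps-block = maps
  ; fixes-rest = fixes }
  where
  open Freshening (freshen (Ξ ++ (y , ρ) ∷ []) Y (⊢-cast (sym (++-assoc Ξ ((y , ρ) ∷ []) Y)) refl refl d) avoid)
  c = fresh (avoid ++ dom (Ξ ++ (y , ρ) ∷ block))
  c-fresh : c ∉ avoid ++ dom (Ξ ++ (y , ρ) ∷ block)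
  c-fresh = fresh-∉ _
  c∉avoid : c ∉ avoid
  c∉avoid p = c-fresh (∈-++⁺ˡ p)
  c∉Ξ : c ∉ dom Ξ
  c∉Ξ p = c-fresh (∈-++⁺ʳ avoid (∈dom-++ˡ Ξ _ p))
  c∉block : c ∉ dom block
  c∉block p = c-fresh (∈-++⁺ʳ avoid (∈dom-++ʳ Ξ ((y , ρ) ∷ block) (there p)))
  distinct = ⊢-distinct d
  y∉Ξ : y ∉ dom Ξ
  y∉Ξ p = DistinctCtx-++⇒# Ξ ((y , ρ) ∷ Y) distinct p (here refl)
  y∉block : y ∉ dom block
  y∉block p = block-#Ξ p (∈dom-++ʳ Ξ ((y , ρ) ∷ []) (here refl))
  y∉Y : y ∉ dom Y
  y∉Y with DistinctCtx-++⁻ʳ Ξ ((y , ρ) ∷ Y) distinct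
  ... | y∉ ∷ _ = y∉
  t = transpose y c
  d₁ = ⊢-ren (transpose-injective y c) (⊢-cast (++-assoc Ξ ((y , ρ) ∷ []) block) refl refl deriv)
  fixed : ∀ {Z} → y ∉ dom Z → c ∉ dom Z → renᶜ t Z ≡ Z
  fixed y∉ c∉ = renᶜ-id t _ (λ p → transpose-other y c _ (λ e → y∉ (subst (_∈ dom _) e p)) (λ e → c∉ (subst (_∈ dom _) e p)))
  ctx-eq : renᶜ t (Ξ ++ (y , ρ) ∷ block) ≡ Ξ ++ (c , ρ) ∷ block
  ctx-eq = trans (renᶜ-++ (transpose-injective y c) Ξ ((y , ρ) ∷ block))
             (cong₂ _++_ (fixed y∉Ξ c∉Ξ) (cong₂ _∷_ (cong (_, ρ) (transpose-left y c)) (fixed y∉block c∉block)))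
  d₂ = ⊢-cast ctx-eq (sub-sub M _ _) refl (proj₁ d₁)
  maps : ∀ {v} → v ∈ FV M → v ∈ dom ((y , ρ) ∷ Y) → t (newName v) ∈ dom ((c , ρ) ∷ block)
  maps {v} p (here refl) = here (trans (cong t (fixes-rest p y∉Y)) (transpose-left y c))
  maps {v} p (there q) = let r = maps-block p q in
    there (subst (_∈ dom block) (sym (transpose-other y c (newName v) (λ e → y∉block (subst (_∈ dom block) e r))
          (λ e → c∉block (subst (_∈ dom block) e r)))) r)
  fixes : ∀ {v} → v ∈ FV M → v ∉ dom ((y , ρ) ∷ Y) → t (newName v) ≡ v
  fixes {v} p q with ⊢-FV-++ {Ξ} {(y , ρ) ∷ Y} d p
  ... | inj₂ r = ⊥-elim (q r)
  ... | inj₁ r = trans (cong t (fixes-rest p (λ r' → q (there r')))) (transpose-other y c v (λ e → q (here e))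
        (λ e → c∉Ξ (subst (_∈ dom Ξ) e r)))

freshen-rename* : ∀ {Ξ Y Y' M g τ} → (Ξ ++ Y) ⊢ M ∶ τ → (∀ {c} → c ∈ dom Y' → c ∉ dom Ξ) →
  (∀ {v} → v ∈ FV M → v ∈ dom Y → g v ∈ dom Y') → (∀ {v} → v ∈ FV M → v ∉ dom Y → g v ≡ v) →
  ∀ z → rename* (dom Y) z M ≡ rename* (dom Y') z (ren g M)
freshen-rename* {Ξ} {Y} {Y'} {M} {g} d frΞ mp fx z =
  trans (rename*-as-sub (dom Y) z M) (sym (trans (rename*-as-sub (dom Y') z (ren g M)) (trans (sub-sub M _ _) (sub-cong M pt))))
  where
  pt : ∀ v → v ∈ FV M → sub (collapse (dom Y') z) (fv (g v)) ≡ collapse (dom Y) z v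
  pt v q with v ∈? dom Y
  ... | yes r = collapse-∈ (dom Y') z (g v) (mp q r)
  ... | no r with ⊢-FV-++ {Ξ} {Y} d q
  ...   | inj₂ s = ⊥-elim (r s)
  ...   | inj₁ s rewrite fx q r = collapse-∉ (dom Y') z v (λ t → frΞ t s)

-- Substituting several derivations at once

record Piece (n' : ℕ) : Set where
  constructor piece
  field
    pCtx : Ctx
    pTerm : Term
    pType : ITy
    pDeriv : pCtx ⊢ pTerm ∶ pType
    pSize : size pDeriv ≤ n'
open Piece public

ctxsOf : ∀ {n'} → List (Piece n') → List Ctx
ctxsOf = map pCtx

SubstGoal : ∀ {Δ N σ'} → Δ ⊢ N ∶ σ' → Ctx → Term → ITy → Set
SubstGoal {Δ} {N} {σ'} Σd Θ M τ = ∀ {x σ Γ} → σ' ≈ σ → DistinctCtx Γ → x ∉ dom Γ → Θ ≅ ((x , σ) ∷ Γ) → Γ # Δ → x ∉ dom Δ → (Γ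
      ++ Δ) ⊢ M [ N / x ] ∶ τ

SubstBelow : ℕ → Set
SubstBelow n' = ∀ {D N s Θ M τ} (d : D ⊢ N ∶ s) → size d ≤ n' → (Π : Θ ⊢ M ∶ τ) → SubstGoal d Θ M τ

SubstBelowOf : Term → ℕ → ℕ → Set
SubstBelowOf N nb k' = ∀ {D s Θ M τ} (d : D ⊢ N ∶ s) → size d ≤ nb → (Π : Θ ⊢ M ∶ τ) → size Π ≤ k' → SubstGoal d Θ M τ

concatCtx : List Ctx → Ctx
concatCtx [] = []
concatCtx (D ∷ Ds) = D ++ concatCtx Ds

substAll : List (Var × Term) → Var → Term
substAll [] v = fv v
substAll ((c , N) ∷ ps) v = if ⌊ v ≟ c ⌋ then N else substAll ps v

bindings : ∀ {n'} → Ctx → List (Piece n') → List (Var × Term)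
bindings [] Ps = []
bindings (y ∷ Y) [] = []
bindings ((c , ρ) ∷ Y) (p ∷ Ps) = (c , pTerm p) ∷ bindings Y Ps

substAll-∉ : ∀ {n'} Y (Ps : List (Piece n')) {v} → v ∉ dom Y → substAll (bindings Y Ps) v ≡ fv v
substAll-∉ [] Ps h = refl
substAll-∉ (y ∷ Y) [] h = refl
substAll-∉ ((c , ρ) ∷ Y) (p ∷ Ps) {v} h with v ≟ c
... | yes refl = ⊥-elim (h (here refl))
... | no _ = substAll-∉ Y Ps (λ q → h (there q))

substAll-∷ : ∀ ps c N M → (∀ v → v ∈ FV N → substAll ps v ≡ fv v) →
            sub (substAll ps) (M [ N / c ]) ≡ sub (substAll ((c , N) ∷ ps)) M
substAll-∷ ps c N M h = trans (cong (sub (substAll ps)) (subst-as-sub M N c)) (trans (sub-sub M _ _) (sub-cong M pt))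
  where
  pt : ∀ v → v ∈ FV M → sub (substAll ps) (replace N c v) ≡ substAll ((c , N) ∷ ps) v
  pt v _ with v ≟ c
  ... | yes _ = trans (sub-cong N h) (sub-id N)
  ... | no _ = refl

-- Pieces with pairwise disjoint contexts are substituted one after the other.
module _ {n' : ℕ} (rec : SubstBelow n') where

  substDisjoint : ∀ Ξ Y (Ps : List (Piece n')) {M τ} → (Ξ ++ Y) ⊢ M ∶ τ →
    Pointwise (λ p y → pType p ≈ proj₂ y) Ps Y → All (λ p → pCtx p # (Ξ ++ Y)) Ps → AllPairs _#_ (ctxsOf Ps) →
    (Ξ ++ concatCtx (ctxsOf Ps)) ⊢ sub (substAll (bindings Y Ps)) M ∶ τ
  substDisjoint Ξ [] [] {M} d [] [] [] = ⊢-cast refl (sym (sub-id M)) refl d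
  substDisjoint Ξ ((c , ρ) ∷ Y) (p ∷ Ps) {M} {τ} d (r ∷ al) (dj ∷ djs) (pd₀ ∷ pds) =
    let (nΞY , cΞY , cΞ) = DistinctCtx-middle Ξ c ρ Y (⊢-distinct d)
        D = pCtx p
        djY : D # (Ξ ++ Y)
        djY = #-middle Ξ c ρ Y dj
        d₁ = rec (pDeriv p) (pSize p) d {x = c} {σ = ρ} {Γ = Ξ ++ Y} r nΞY cΞY (≅-sym (≅-middle c ρ Ξ Y cΞ)) (#-sym {D} {Ξ ++ Y} djY)
               (λ q → dj q (∈dom-++ʳ Ξ ((c , ρ) ∷ Y) (here refl)))
        nd₁ = ⊢-distinct d₁
        nd₂ : DistinctCtx ((Ξ ++ D) ++ Y)
        nd₂ = DistinctCtx-≈ᶜ nd₁ (≅⇒≈ᶜ _ _ nd₁ (DistinctCtx-++⁺ (Ξ ++ D) Y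
              (DistinctCtx-++⁺ Ξ D (DistinctCtx-++⁻ˡ Ξ Y nΞY) (⊢-distinct (pDeriv p)) (#-sym {D} {Ξ} (#-++⁻ˡ Ξ Y djY)))
                                   (DistinctCtx-++⁻ʳ Ξ Y nΞY) (λ q₁ q₂ → ctrY q₁ q₂))
                             (≅-++-exchange Ξ Y D (λ q₁ q₂ → #-++⁻ʳ Ξ Y djY q₂ q₁)))
        d₂ = conv≅ d₁ nd₂ (≅-++-exchange Ξ Y D (λ q₁ q₂ → #-++⁻ʳ Ξ Y djY q₂ q₁))
        djs' : All (λ p' → pCtx p' # ((Ξ ++ D) ++ Y)) Ps
        djs' = djsf Ps djs pd₀
        d₃ = substDisjoint (Ξ ++ D) Y Ps d₂ al djs' pds
        e₁ : ((Ξ ++ D) ++ concatCtx (ctxsOf Ps)) ≡ (Ξ ++ concatCtx (ctxsOf (p ∷ Ps)))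
        e₁ = ++-assoc Ξ D (concatCtx (ctxsOf Ps))
        e₂ : sub (substAll (bindings Y Ps)) (M [ pTerm p / c ]) ≡ sub (substAll ((c , pTerm p) ∷ bindings Y Ps)) M
        e₂ = substAll-∷ (bindings Y Ps) c (pTerm p) M (λ v q → substAll-∉ Y Ps (λ q' → djY (⊢-FV⊆dom (pDeriv p) q) (∈dom-++ʳ Ξ Y q')))
    in ⊢-cast e₁ e₂ refl d₃
    where
    ctrY : ∀ {y} → y ∈ dom (Ξ ++ pCtx p) → y ∉ dom Y
    ctrY q₁ q₂ with ∈dom-++⁻ Ξ (pCtx p) q₁
    ... | inj₁ a = DistinctCtx-++⇒# Ξ ((c , ρ) ∷ Y) (⊢-distinct d) a (there q₂)
    ... | inj₂ a = dj a (∈dom-++ʳ Ξ ((c , ρ) ∷ Y) (there q₂))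
    djsf : ∀ (Qs : List (Piece n')) → All (λ p' → pCtx p' # (Ξ ++ (c , ρ) ∷ Y)) Qs → All (λ D' → pCtx p # D') (ctxsOf Qs) →
           All (λ p' → pCtx p' # ((Ξ ++ pCtx p) ++ Y)) Qs
    djsf [] [] [] = []
    djsf (q ∷ Qs) (a ∷ as) (b ∷ bs) =
      #-++⁺ (Ξ ++ pCtx p) Y (#-++⁺ Ξ (pCtx p) (#-++⁻ˡ Ξ _ a) (λ z₁ z₂ → b z₂ z₁)) (λ z₁ z₂ → #-++⁻ʳ Ξ ((c , ρ) ∷ Y) a z₁ (there z₂))
      ∷ djsf Qs as bs

data AtMostOne : List ITy → Set where
  none : AtMostOne []
  one : ∀ t → AtMostOne (t ∷ [])

lookup-concatCtx : ∀ y Ds → lookup y (concatCtx Ds) ≡ head (typesOf y Ds)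
lookup-concatCtx y [] = refl
lookup-concatCtx y (D ∷ Ds) rewrite lookup-++ y D (concatCtx Ds) | typesOf-∷ y D Ds | lookup-concatCtx y Ds with lookup y D
... | nothing = refl
... | just t = refl

interᵐ-AtMostOne : ∀ {T} → AtMostOne T → interᵐ T ≡ head T
interᵐ-AtMostOne none = refl
interᵐ-AtMostOne (one t) = refl

concatCtx≅⋀ᶜ : ∀ Ds → (∀ y → AtMostOne (typesOf y Ds)) → concatCtx Ds ≅ ⋀ᶜ Ds
concatCtx≅⋀ᶜ Ds h = mk≅ λ y → ≈ᵐ-reflexive (trans (lookup-concatCtx y Ds) (trans (sym (interᵐ-AtMostOne (h y))) (sym (lookup-⋀ᶜ y Ds))))

∈concatDom⁻ : ∀ Ds {y} → y ∈ concatDom Ds → Σ Ctx (λ D → D ∈ Ds × y ∈ dom D)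
∈concatDom⁻ (D ∷ Ds) p with ∈-++⁻ (dom D) p
... | inj₁ q = D , here refl , q
... | inj₂ q = let (D' , a , b) = ∈concatDom⁻ Ds q in D' , there a , b

typesOf≢[]⇒∈concatDom : ∀ y Ds → typesOf y Ds ≢ [] → y ∈ concatDom Ds
typesOf≢[]⇒∈concatDom y Ds h with y ∈? concatDom Ds
... | yes p = p
... | no p = ⊥-elim (h (lookup-∉-concat y Ds p))

∈dom⇒typesOf≢[] : ∀ {y D} Ds → y ∈ dom D → D ∈ Ds → typesOf y Ds ≢ []
∈dom⇒typesOf≢[] {y} (D ∷ Ds) p (here refl) e rewrite typesOf-∷ y D Ds with lookup-∈ D p
... | t , eq rewrite eq with e
... | ()
∈dom⇒typesOf≢[] {y} (D' ∷ Ds) p (there q) e rewrite typesOf-∷ y D' Ds with lookup y D'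
... | nothing = ∈dom⇒typesOf≢[] Ds p q e
... | just _ with e
... | ()

AtMostOne⇒AllPairs# : ∀ Ds → (∀ y → AtMostOne (typesOf y Ds)) → AllPairs _#_ Ds
AtMostOne⇒AllPairs# [] h = []
AtMostOne⇒AllPairs# (D ∷ Ds) h = all Ds (λ q → q) ∷ AtMostOne⇒AllPairs# Ds h'
  where
  h' : ∀ y → AtMostOne (typesOf y Ds)
  h' y with h y
  ... | r rewrite typesOf-∷ y D Ds with lookup y D
  ... | nothing = r
  ... | just t = am1-tl r
    where
    am1-tl : ∀ {t T} → AtMostOne (t ∷ T) → AtMostOne T
    am1-tl (one _) = none
  all : ∀ Es → (∀ {E} → E ∈ Es → E ∈ Ds) → All (λ D' → D # D') Es
  all [] inc = []
  all (E ∷ Es) inc = (λ {y} p q → bad y p (∈dom⇒typesOf≢[] Ds q (inc (here refl)))) ∷ all Es (λ r → inc (there r))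
    where
    bad : ∀ y → y ∈ dom D → typesOf y Ds ≢ [] → ⊥
    bad y p ne with h y
    ... | r rewrite typesOf-∷ y D Ds with lookup-∈ D p
    ... | t , eq rewrite eq with typesOf y Ds | r
    ... | [] | _ = ne refl
    ... | _ ∷ _ | ()

DistinctCtx-++-⋀ᶜ : ∀ Ξ Ds → DistinctCtx Ξ → All (λ D → D # Ξ) Ds → DistinctCtx (Ξ ++ ⋀ᶜ Ds)
DistinctCtx-++-⋀ᶜ Ξ Ds n a = DistinctCtx-++⁺ Ξ (⋀ᶜ Ds) n (DistinctCtx-⋀ᶜ Ds) (λ p q →
  let (D , D∈ , yD) = ∈concatDom⁻ Ds (⋀ᶜ-dom Ds q) in All.lookup a D∈ yD p)

interᵐ-consᵐ : ∀ mm → interᵐ (consᵐ mm []) ≡ mm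
interᵐ-consᵐ nothing = refl
interᵐ-consᵐ (just x) = refl

-- A variable u shared by several pieces is renamed, in every piece containing it, to a fresh
-- copy of its own; the copies keep the types that u had in the pieces.
module _ {n' : ℕ} (u : Var) (avoid : List Var) where

  Renamed : Ctx → Piece n' → Piece n' → Set
  Renamed copies p₂ p = (u ∉ dom (pCtx p) × pTerm p₂ ≡ pTerm p) ⊎ Σ Var (λ c → c ∈ dom copies × pTerm p₂ ≡ ren (transpose u c) (pTerm p))

  DomBound : Ctx → Piece n' → Piece n' → Set
  DomBound copies p₂ p = ∀ {y} → y ∈ dom (pCtx p₂) → (y ∈ dom (pCtx p)) ⊎ (y ∈ dom copies)

  record Separation (Ps : List (Piece n')) : Set where
    field
      pieces : List (Piece n')
      copies : Ctx
      types-other : ∀ y → y ≢ u → y ∉ dom copies → typesOf y (ctxsOf pieces) ≡ typesOf y (ctxsOf Ps)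
      types-pivot : typesOf u (ctxsOf pieces) ≡ []
      types-copy : ∀ y → y ∈ dom copies → typesOf y (ctxsOf pieces) ≡ consᵐ (lookup y copies) []
      copies-types : map proj₂ copies ≡ typesOf u (ctxsOf Ps)
      copies-distinct : Distinct (dom copies)
      copies-fresh : ∀ {c} → c ∈ dom copies → c ∉ avoid
      renamed : Pointwise (Renamed copies) pieces Ps
      dom-bound : Pointwise (DomBound copies) pieces Ps
      same-types : Pointwise (λ p₂ p → pType p₂ ≡ pType p) pieces Ps

  DomBound-concat : ∀ {copies pieces Ps} → Pointwise (DomBound copies) pieces Ps → ∀ {y} → y ∈ concatDom (ctxsOf pieces) → (y
        ∈ concatDom (ctxsOf Ps)) ⊎ (y ∈ dom copies)
  DomBound-concat {pieces = p₂ ∷ pieces} {Ps = p ∷ Ps} (r ∷ rs) q with ∈-++⁻ (dom (pCtx p₂)) q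
  ... | inj₁ a with r a
  ...   | inj₁ b = inj₁ (∈-++⁺ˡ b)
  ...   | inj₂ b = inj₂ b
  DomBound-concat {pieces = p₂ ∷ pieces} {Ps = p ∷ Ps} (r ∷ rs) q | inj₂ a with DomBound-concat rs a
  ...   | inj₁ b = inj₁ (∈-++⁺ʳ (dom (pCtx p)) b)
  ...   | inj₂ b = inj₂ b

  separate : (uA : u ∈ avoid) → ∀ (Ps : List (Piece n')) → (∀ {y} → y ∈ concatDom (ctxsOf Ps) → y ∈ avoid) → Separation Ps
  separate uA [] h = record { pieces = [] ; copies = [] ; types-other = λ _ _ _ → refl ; types-pivot = refl ; types-copy = λ
        _ () ; copies-types = refl ; copies-distinct = [] ; copies-fresh = λ () ; renamed = [] ; dom-bound = [] ; same-types = [] }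
  separate uA (p ∷ Ps) h with separate uA Ps (λ q → h (∈-++⁺ʳ (dom (pCtx p)) q)) | lookup u (pCtx p) in eq
  ... | rs | nothing = record
    { pieces = p ∷ Separation.pieces rs ; copies = Separation.copies rs
    ; types-other = λ y ne nc → trans (typesOf-∷ y (pCtx p) _) (trans
          (cong (consᵐ (lookup y (pCtx p))) (Separation.types-other rs y ne nc)) (sym (typesOf-∷ y (pCtx p) _)))
    ; types-pivot = trans (typesOf-∷ u (pCtx p) _) (trans (cong (λ mm → consᵐ mm (typesOf u (ctxsOf (Separation.pieces rs))))
          eq) (Separation.types-pivot rs))
    ; types-copy = λ y q → trans (typesOf-∷ y (pCtx p) _) (trans
          (cong (λ mm → consᵐ mm (typesOf y (ctxsOf (Separation.pieces rs))))
          (lookup-∉ (pCtx p) (λ r → Separation.copies-fresh rs q (h (∈-++⁺ˡ r))))) (Separation.types-copy rs y q))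
    ; copies-types = trans (Separation.copies-types rs) (sym
          (trans (typesOf-∷ u (pCtx p) _) (cong (λ mm → consᵐ mm (typesOf u (ctxsOf Ps))) eq)))
    ; copies-distinct = Separation.copies-distinct rs ; copies-fresh = Separation.copies-fresh rs
    ; renamed = inj₁ (lookup-nothing-∉ (pCtx p) eq , refl) ∷ Separation.renamed rs
    ; dom-bound = (λ q → inj₁ q) ∷ Separation.dom-bound rs
    ; same-types = refl ∷ Separation.same-types rs }
  ... | rs | just t = record
    { pieces = p₂ ∷ Separation.pieces rs ; copies = (c , t) ∷ Separation.copies rs
    ; types-other = r1 ; types-pivot = r2 ; types-copy = r3
    ; copies-types = trans (cong (t ∷_) (Separation.copies-types rs)) (sym
          (trans (typesOf-∷ u (pCtx p) (ctxsOf Ps)) (cong (λ mm → consᵐ mm (typesOf u (ctxsOf Ps))) eq)))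
    ; copies-distinct = (λ q → cfr (∈-++⁺ʳ avoid q)) ∷ Separation.copies-distinct rs
    ; copies-fresh = λ { (here refl) → λ q → cfr (∈-++⁺ˡ q) ; (there q) → Separation.copies-fresh rs q }
    ; renamed = inj₂ (c , here refl , refl) ∷ PW.map (λ { (inj₁ a) → inj₁ a ; (inj₂ (c' , a , b)) → inj₂
          (c' , there a , b) }) (Separation.renamed rs)
    ; dom-bound = r7 ∷ PW.map (λ r {y} q → case (r q)) (Separation.dom-bound rs)
    ; same-types = refl ∷ Separation.same-types rs }
    where
    c = fresh (avoid ++ dom (Separation.copies rs))
    cfr : c ∉ avoid ++ dom (Separation.copies rs)
    cfr = fresh-∉ _
    cA : c ∉ avoid
    cA q = cfr (∈-++⁺ˡ q)
    f = transpose u c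
    ed = ⊢-ren (transpose-injective u c) (pDeriv p)
    p₂ : Piece n'
    p₂ = piece (renᶜ f (pCtx p)) (ren f (pTerm p)) (pType p) (proj₁ ed) (subst (_≤ n') (sym (proj₂ ed)) (pSize p))
    inD : ∀ {y} → y ∈ dom (pCtx p) → y ∈ avoid
    inD q = h (∈-++⁺ˡ q)
    lk : ∀ y → lookup y (renᶜ f (pCtx p)) ≡ lookup (transpose u c y) (pCtx p)
    lk y = lookup-renᶜ-transpose u c y (pCtx p)
    case : ∀ {y} {E : Ctx} → (y ∈ dom E) ⊎ (y ∈ dom (Separation.copies rs)) → (y ∈ dom E) ⊎ (y ∈ dom ((c , t) ∷ Separation.copies rs))
    case (inj₁ a) = inj₁ a
    case (inj₂ a) = inj₂ (there a)
    r1 : ∀ y → y ≢ u → y ∉ dom ((c , t) ∷ Separation.copies rs) → typesOf y (ctxsOf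
          (p₂ ∷ Separation.pieces rs)) ≡ typesOf y (ctxsOf (p ∷ Ps))
    r1 y ne nc = trans (typesOf-∷ y (pCtx p₂) (ctxsOf (Separation.pieces rs))) (trans
          (cong₂ consᵐ (trans (lk y) (cong (λ z → lookup z (pCtx p)) (transpose-other u c y ne (λ e → nc (here e)))))
                  (Separation.types-other rs y ne (λ q → nc (there q)))) (sym (typesOf-∷ y (pCtx p) _)))
    r2 : typesOf u (ctxsOf (p₂ ∷ Separation.pieces rs)) ≡ []
    r2 = trans (typesOf-∷ u (pCtx p₂) (ctxsOf (Separation.pieces rs))) (trans
          (cong₂ consᵐ (trans (lk u) (trans (cong (λ z → lookup z (pCtx p)) (transpose-left u c))
          (lookup-∉ (pCtx p) (λ q → cA (inD q))))) (Separation.types-pivot rs)) refl)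
    cnot : c ∉ concatDom (ctxsOf (Separation.pieces rs))
    cnot q with DomBound-concat (Separation.dom-bound rs) q
    ... | inj₁ a = cA (h (∈-++⁺ʳ (dom (pCtx p)) a))
    ... | inj₂ a = cfr (∈-++⁺ʳ avoid a)
    r3 : ∀ y → y ∈ dom ((c , t) ∷ Separation.copies rs) → typesOf y (ctxsOf (p₂ ∷ Separation.pieces rs)) ≡ consᵐ (lookup y
          ((c , t) ∷ Separation.copies rs)) []
    r3 y (here refl) = trans (typesOf-∷ y (pCtx p₂) (ctxsOf (Separation.pieces rs))) (trans
          (cong₂ consᵐ (trans (lk y) (trans (cong (λ z → lookup z (pCtx p)) (transpose-right u c)) eq))
          (lookup-∉-concat y (ctxsOf (Separation.pieces rs)) cnot))
                        (cong (λ mm → consᵐ mm []) (sym (lookup-here y t (Separation.copies rs)))))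
    r3 y (there q) = trans (typesOf-∷ y (pCtx p₂) (ctxsOf (Separation.pieces rs))) (trans
          (cong₂ consᵐ (trans (lk y) (trans (cong (λ z → lookup z (pCtx p)) (transpose-other u c y yu yc))
          (lookup-∉ (pCtx p) (λ r → Separation.copies-fresh rs q (inD r))))) refl)
                      (trans (Separation.types-copy rs y q) (cong (λ mm → consᵐ mm []) (sym (lookup-there t (Separation.copies rs) yc)))))
      where
      yu : y ≢ u
      yu e = Separation.copies-fresh rs q (subst (_∈ avoid) (sym e) uA)
      yc : y ≢ c
      yc e = cfr (∈-++⁺ʳ avoid (subst (_∈ dom (Separation.copies rs)) e q))
    r7 : ∀ {y} → y ∈ dom (pCtx p₂) → (y ∈ dom (pCtx p)) ⊎ (y ∈ dom ((c , t) ∷ Separation.copies rs))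
    r7 {y} q with ∈-map⁻ f (subst (y ∈_) (dom-renᶜ (transpose-injective u c) (pCtx p)) q)
    ... | z , zD , refl = r7h z zD (z ≟ u)
      where
      r7h : ∀ z → z ∈ dom (pCtx p) → Dec (z ≡ u) → (f z ∈ dom (pCtx p)) ⊎ (f z ∈ dom ((c , t) ∷ Separation.copies rs))
      r7h z zD (yes e) = inj₂ (here (trans (cong f e) (transpose-left u c)))
      r7h z zD (no zu) = inj₁ (subst (_∈ dom (pCtx p)) (sym (transpose-other u c z zu (λ e → cA (inD (subst (_∈ dom (pCtx p)) e zD))))) zD)

∈piece⇒∈concatDom : ∀ {n'} (Ps : List (Piece n')) {p y} → p ∈ Ps → y ∈ dom (pCtx p) → y ∈ concatDom (ctxsOf Ps)
∈piece⇒∈concatDom Ps {p} q r = ∈concatDom (pCtx p) (ctxsOf Ps) r (∈-map⁺ pCtx q)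

concatDom-# : ∀ {n'} {Ξ'} (Ps : List (Piece n')) → All (λ p → pCtx p # Ξ') Ps → ∀ {y} → y ∈ concatDom (ctxsOf Ps) → y ∉ dom Ξ'
concatDom-# Ps a q with ∈concatDom⁻ (ctxsOf Ps) q
... | D , D∈ , yD with ∈-map⁻ pCtx D∈
...   | p , p∈ , refl = All.lookup a p∈ yD

module _ {n' : ℕ} (u : Var) (avoid : List Var) (copies : Ctx)
         (copies-fresh : ∀ {c} → c ∈ dom copies → c ∉ avoid) (uA : u ∈ avoid) where

  collapse-renamed : ∀ (p₂ p : Piece n') → Renamed u avoid copies p₂ p → (∀ {v} → v ∈ FV (pTerm p) → v ∈ avoid) →
             sub (collapse (dom copies) u) (pTerm p₂) ≡ pTerm p
  collapse-renamed p₂ p (inj₁ (_ , e)) h rewrite e = trans (sub-cong (pTerm p)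
        (λ v q → collapse-∉ (dom copies) u v (λ r → copies-fresh r (h q)))) (sub-id (pTerm p))
  collapse-renamed p₂ p (inj₂ (c , c∈ , e)) h rewrite e = trans (sub-sub (pTerm p) _ _) (trans (sub-cong (pTerm p) pt) (sub-id (pTerm p)))
    where
    pt : ∀ v → v ∈ FV (pTerm p) → sub (collapse (dom copies) u) (fv (transpose u c v)) ≡ fv v
    pt v q = ptd (v ≟ u)
      where
      ptd : Dec (v ≡ u) → sub (collapse (dom copies) u) (fv (transpose u c v)) ≡ fv v
      ptd (yes e) = trans (cong (collapse (dom copies) u) (trans (cong (transpose u c) e) (transpose-left u c))) (trans
            (collapse-∈ (dom copies) u c c∈) (cong fv (sym e)))
      ptd (no vu) = trans (cong (collapse (dom copies) u) (transpose-other u c v vu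
            (λ e' → copies-fresh c∈ (subst (_∈ avoid) e' (h q))))) (collapse-∉ (dom copies) u v (λ r → copies-fresh r (h q)))

  collapse-substAll : ∀ Y {pieces Ps : List (Piece n')} → Pointwise (Renamed u avoid copies) pieces Ps → All (λ p → ∀ {v} → v
        ∈ FV (pTerm p) → v ∈ avoid) Ps →
             ∀ v → v ∉ dom copies → sub (collapse (dom copies) u) (substAll (bindings Y pieces) v) ≡ substAll (bindings Y Ps) v
  collapse-substAll [] [] a v h = collapse-∉ (dom copies) u v h
  collapse-substAll [] (r ∷ rs) a v h = collapse-∉ (dom copies) u v h
  collapse-substAll (y ∷ Y) [] a v h = collapse-∉ (dom copies) u v h
  collapse-substAll ((c , ρ) ∷ Y) {p₂ ∷ pieces} {p ∷ Ps} (r ∷ rs) (a ∷ as) v h with v ≟ c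
  ... | yes _ = collapse-renamed p₂ p r a
  ... | no vc = collapse-substAll Y rs as v h

-- The copies of u are contracted back into u with (m).
rejoin : ∀ {n'} u avoid Ξ Y (Ps : List (Piece n')) (S : Separation u avoid Ps) {M τ} → (d : (Ξ ++ Y) ⊢ M ∶ τ) →
  (Ξ ++ ⋀ᶜ (ctxsOf (Separation.pieces S))) ⊢ sub (substAll (bindings Y (Separation.pieces S))) M ∶ τ →
  u ∈ avoid → (∀ {y} → y ∈ dom Ξ → y ∈ avoid) → (∀ {y} → y ∈ dom Y → y ∈ avoid) → (∀ {y} → y ∈ concatDom (ctxsOf Ps) → y ∈ avoid) →
  All (λ p → pCtx p # (Ξ ++ Y)) Ps →
  (Ξ ++ ⋀ᶜ (ctxsOf Ps)) ⊢ sub (substAll (bindings Y Ps)) M ∶ τ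
rejoin {n'} u avoid Ξ Y Ps S {M} {τ} d d₂ uA ΞA YA DA djs = res copies refl
  where
  open Separation S renaming (types-other to r1; types-pivot to r2; types-copy to r3; copies-types to r4;
                              copies-distinct to r5; copies-fresh to r5'; renamed to r6)
  nΞ = DistinctCtx-++⁻ˡ Ξ Y (⊢-distinct d)
  djΞ : All (λ p → pCtx p # Ξ) Ps
  djΞ = All.map {P = λ p → pCtx p # (Ξ ++ Y)} {Q = λ p → pCtx p # Ξ} (λ {p} h → #-++⁻ˡ {pCtx p} Ξ Y h) djs
  nd₂ : DistinctCtx (Ξ ++ ⋀ᶜ (ctxsOf Ps))
  nd₂ = DistinctCtx-++-⋀ᶜ Ξ (ctxsOf Ps) nΞ (All-map⁺ djΞ)
  FVA : All (λ p → ∀ {v} → v ∈ FV (pTerm p) → v ∈ avoid) Ps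
  FVA = mk Ps (λ q → q)
    where
    mk : ∀ Qs → (∀ {p} → p ∈ Qs → p ∈ Ps) → All (λ p → ∀ {v} → v ∈ FV (pTerm p) → v ∈ avoid) Qs
    mk [] inc = []
    mk (q ∷ Qs) inc = (λ r → DA (∈piece⇒∈concatDom Ps (inc (here refl)) (⊢-FV⊆dom (pDeriv q) r))) ∷ mk Qs (λ z → inc (there z))
  tmeq : rename* (dom copies) u (sub (substAll (bindings Y pieces)) M) ≡ sub (substAll (bindings Y Ps)) M
  tmeq = trans (rename*-as-sub (dom copies) u (sub (substAll (bindings Y pieces)) M)) (trans
        (sub-sub M (collapse (dom copies) u) (substAll (bindings Y pieces))) (sub-cong M
        (λ v q → collapse-substAll u avoid copies r5' uA Y r6 FVA v (cpout q))))
    where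
    cpout : ∀ {v} → v ∈ FV M → v ∉ dom copies
    cpout q r with ⊢-FV-++ {Ξ} {Y} d q
    ... | inj₁ a = r5' r (ΞA a)
    ... | inj₂ a = r5' r (YA a)
  res : ∀ Cp' → Cp' ≡ copies → (Ξ ++ ⋀ᶜ (ctxsOf Ps)) ⊢ sub (substAll (bindings Y Ps)) M ∶ τ
  res [] refl = ⊢-cast refl (trans (sym (rename-fresh [] u _ (λ _ _ ()))) tmeq) refl (conv≅ d₂ nd₂ (≅-++ {Ξ} {Ξ} (≅-refl {Ξ}) (mk≅ eqv0)))
    where
    eqv0 : ∀ y → lookup y (⋀ᶜ (ctxsOf pieces)) ≈ᵐ lookup y (⋀ᶜ (ctxsOf Ps))
    eqv0 y rewrite lookup-⋀ᶜ y (ctxsOf pieces) | lookup-⋀ᶜ y (ctxsOf Ps) with y ≟ u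
    ... | yes refl rewrite r2 | sym r4 = nothing
    ... | no ne rewrite r1 y ne (λ ()) = ≈ᵐ-refl _
  res ((c₁ , t₁) ∷ Cp') refl = ⊢-cast refl tmeq refl d₅
    where
    G₀ = Ξ ++ delete u (⋀ᶜ (ctxsOf Ps))
    uCp : u ∉ dom copies
    uCp q = r5' q uA
    uconc : u ∈ concatDom (ctxsOf Ps)
    uconc = typesOf≢[]⇒∈concatDom u (ctxsOf Ps) (λ e → case (trans r4 e))
      where
      case : t₁ ∷ map proj₂ Cp' ≢ []
      case ()
    uΞ : u ∉ dom Ξ
    uΞ = concatDom-# Ps djΞ uconc
    delA : ∀ {y} → y ∈ dom (delete u (⋀ᶜ (ctxsOf Ps))) → y ∈ avoid
    delA q = DA (⋀ᶜ-dom (ctxsOf Ps) (proj₁ (∈dom-delete⁻ u _ q)))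
    nG₀ : DistinctCtx G₀
    nG₀ = DistinctCtx-++⁺ Ξ _ nΞ (DistinctCtx-delete u _ (DistinctCtx-⋀ᶜ (ctxsOf Ps))) (λ p q → concatDom-# Ps djΞ
          (⋀ᶜ-dom (ctxsOf Ps) (proj₁ (∈dom-delete⁻ u _ q))) p)
    nd₁ : DistinctCtx (G₀ ++ copies)
    nd₁ = DistinctCtx-++⁺ G₀ copies nG₀ r5 (λ p q → r5' q (case (∈dom-++⁻ Ξ _ p)))
      where
      case : ∀ {y} → (y ∈ dom Ξ) ⊎ (y ∈ dom (delete u (⋀ᶜ (ctxsOf Ps)))) → y ∈ avoid
      case (inj₁ a) = ΞA a
      case (inj₂ a) = delA a
    E1' : ∀ y → lookup y (⋀ᶜ (ctxsOf pieces)) ≈ᵐ lookup y (delete u (⋀ᶜ (ctxsOf Ps)) ++ copies)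
    E1' y rewrite lookup-⋀ᶜ y (ctxsOf pieces) | lookup-++ y (delete u (⋀ᶜ (ctxsOf Ps))) copies with y ≟ u
    ... | yes refl rewrite r2 | lookup-delete-same y (⋀ᶜ (ctxsOf Ps)) | lookup-∉ copies uCp = nothing
    ... | no ne rewrite lookup-delete-other (⋀ᶜ (ctxsOf Ps)) ne | lookup-⋀ᶜ y (ctxsOf Ps) with y ∈? dom copies
    ...   | yes q rewrite r3 y q | lookup-∉-concat y (ctxsOf Ps) (λ z → r5' q (DA z)) = ≈ᵐ-reflexive (interᵐ-consᵐ (lookup y copies))
    ...   | no q rewrite r1 y ne q | lookup-∉ copies q = ≈ᵐ-reflexive (sym (<∣>-identityʳ _))
    E1 : (Ξ ++ ⋀ᶜ (ctxsOf pieces)) ≅ (G₀ ++ copies)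
    E1 = ≅-trans {Ξ ++ ⋀ᶜ (ctxsOf pieces)} {Ξ ++ (delete u (⋀ᶜ (ctxsOf Ps)) ++ copies)} (≅-++ {Ξ} {Ξ} (≅-refl {Ξ})
          (mk≅ E1')) (≅-reflexive (sym (++-assoc Ξ _ copies)))
    d₃ = conv≅ d₂ nd₁ E1
    uG₀ : u ∉ dom G₀
    uG₀ = ∉dom-++ Ξ (delete u (⋀ᶜ (ctxsOf Ps))) uΞ (λ q → proj₂ (∈dom-delete⁻ u (⋀ᶜ (ctxsOf Ps)) q) refl)
    d₄ = m Cp' d₃ uG₀
    E2 : ∀ y → lookup y ((u , inter t₁ (map proj₂ Cp')) ∷ G₀) ≈ᵐ lookup y (Ξ ++ ⋀ᶜ (ctxsOf Ps))
    E2 y with y ≟ u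
    ... | yes refl rewrite lookup-++ y Ξ (⋀ᶜ (ctxsOf Ps)) | lookup-∉ Ξ uΞ | lookup-⋀ᶜ y (ctxsOf Ps) | sym r4 = just (≈-refl _)
    ... | no ne rewrite lookup-++ y Ξ (delete u (⋀ᶜ (ctxsOf Ps))) | lookup-++ y Ξ (⋀ᶜ (ctxsOf Ps)) | lookup-delete-other (⋀ᶜ
          (ctxsOf Ps)) ne = ≈ᵐ-refl _
    d₅ = conv≅ {(u , inter t₁ (map proj₂ Cp')) ∷ G₀} {Ξ ++ ⋀ᶜ (ctxsOf Ps)} d₄ nd₂ (mk≅ E2)

-- Induction on a list L covering the variables shared between pieces.
substMany : ∀ {n'} → SubstBelow n' → ∀ L Ξ Y (Ps : List (Piece n')) {M τ} → (d : (Ξ ++ Y) ⊢ M ∶ τ) →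
  Pointwise (λ p y → pType p ≈ proj₂ y) Ps Y → All (λ p → pCtx p # (Ξ ++ Y)) Ps → (∀ y → y ∉ L → AtMostOne (typesOf y (ctxsOf Ps))) →
  (Ξ ++ ⋀ᶜ (ctxsOf Ps)) ⊢ sub (substAll (bindings Y Ps)) M ∶ τ
substMany rec [] Ξ Y Ps d al djs inv =
  conv≅ (substDisjoint rec Ξ Y Ps d al djs (AtMostOne⇒AllPairs# (ctxsOf Ps) (λ y → inv y (λ ()))))
        (DistinctCtx-++-⋀ᶜ Ξ (ctxsOf Ps) (DistinctCtx-++⁻ˡ Ξ Y (⊢-distinct d))
              (All-map⁺ (All.map {P = λ p → pCtx p # (Ξ ++ Y)} {Q = λ p → pCtx p # Ξ} (λ {p} h → #-++⁻ˡ {pCtx p} Ξ Y h) djs)))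
        (≅-++ {Ξ} {Ξ} (≅-refl {Ξ}) (concatCtx≅⋀ᶜ (ctxsOf Ps) (λ y → inv y (λ ()))))
substMany {n'} rec (u ∷ L) Ξ Y Ps {M} {τ} d al djs inv =
  rejoin u avoid Ξ Y Ps rs d d₂ (here refl) ΞA YA DA djs
  where
  avoid = u ∷ (dom Ξ ++ (dom Y ++ concatDom (ctxsOf Ps)))
  ΞA : ∀ {y} → y ∈ dom Ξ → y ∈ avoid
  ΞA q = there (∈-++⁺ˡ q)
  YA : ∀ {y} → y ∈ dom Y → y ∈ avoid
  YA q = there (∈-++⁺ʳ (dom Ξ) (∈-++⁺ˡ q))
  DA : ∀ {y} → y ∈ concatDom (ctxsOf Ps) → y ∈ avoid
  DA q = there (∈-++⁺ʳ (dom Ξ) (∈-++⁺ʳ (dom Y) q))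
  rs = separate u avoid (here refl) Ps DA
  al₂ : Pointwise (λ p y → pType p ≈ proj₂ y) (Separation.pieces rs) Y
  al₂ = PW.transitive (λ e r → subst (λ t → t ≈ _) (sym e) r) (Separation.same-types rs) al
  djs₂ : ∀ {Qs₂ Qs} → Pointwise (DomBound u avoid (Separation.copies rs)) Qs₂ Qs → All (λ p → pCtx p # (Ξ ++ Y)) Qs → All (λ
        p → pCtx p # (Ξ ++ Y)) Qs₂
  djs₂ [] [] = []
  djs₂ (r ∷ rs') (a ∷ as) = (λ p q → case (r p) q a) ∷ djs₂ rs' as
    where
    case : ∀ {y} {E : Ctx} → (y ∈ dom E) ⊎ (y ∈ dom (Separation.copies rs)) → y ∈ dom (Ξ ++ Y) → E # (Ξ ++ Y) → ⊥
    case (inj₁ a) q h = h a q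
    case (inj₂ a) q h with ∈dom-++⁻ Ξ Y q
    ... | inj₁ b = Separation.copies-fresh rs a (ΞA b)
    ... | inj₂ b = Separation.copies-fresh rs a (YA b)
  am1m : ∀ mm → AtMostOne (consᵐ mm [])
  am1m nothing = none
  am1m (just t) = one t
  inv₂ : ∀ y → y ∉ L → AtMostOne (typesOf y (ctxsOf (Separation.pieces rs)))
  inv₂ y h with y ≟ u
  ... | yes refl rewrite Separation.types-pivot rs = none
  ... | no ne with y ∈? dom (Separation.copies rs)
  ...   | yes q rewrite Separation.types-copy rs y q = am1m _
  ...   | no q rewrite Separation.types-other rs y ne q = inv y (λ { (here e) → ne e ; (there z) → h z })
  d₂ = substMany rec L Ξ Y (Separation.pieces rs) d al₂ (djs₂ (Separation.dom-bound rs) djs) inv₂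

-- Inversion of the intersection rule

record PieceOf (N : Term) (nb : ℕ) : Set where
  constructor pieceOf
  field
    ctxOf : Ctx
    typeOf : ITy
    derivOf : ctxOf ⊢ N ∶ typeOf
    sizeOf : size derivOf ≤ nb
open PieceOf public

forget : ∀ {N nb} → PieceOf N nb → Piece nb
forget {N} p = piece (ctxOf p) N (typeOf p) (derivOf p) (sizeOf p)

ctxsOf-forget : ∀ {N nb} (Ps : List (PieceOf N nb)) → ctxsOf (map forget Ps) ≡ map ctxOf Ps
ctxsOf-forget [] = refl
ctxsOf-forget (p ∷ Ps) = cong (_ ∷_) (ctxsOf-forget Ps)

Pointwise-forget : ∀ {N nb} {Ps : List (PieceOf N nb)} {Y : Ctx} → Pointwise (λ p t → typeOf p ≈ t) Ps (map proj₂ Y) →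
          Pointwise (λ p y → pType p ≈ proj₂ y) (map forget Ps) Y
Pointwise-forget {Ps = []} {[]} [] = []
Pointwise-forget {Ps = p ∷ Ps} {y ∷ Y} (r ∷ rs) = r ∷ Pointwise-forget rs

substAll-∈ : ∀ {N nb} (Y : Ctx) (Ps : List (PieceOf N nb)) → Pointwise (λ p t → typeOf p ≈ t) Ps (map proj₂ Y) → ∀ {v} → v ∈ dom Y →
         substAll (bindings Y (map forget Ps)) v ≡ N
substAll-∈ ((c , ρ) ∷ Y) (p ∷ Ps) (r ∷ rs) {v} q with v ≟ c
... | yes _ = refl
substAll-∈ ((c , ρ) ∷ Y) (p ∷ Ps) (r ∷ rs) {v} (here e) | no ne = ⊥-elim (ne e)
substAll-∈ ((c , ρ) ∷ Y) (p ∷ Ps) (r ∷ rs) {v} (there q) | no ne = substAll-∈ Y Ps rs q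

Logical : ∀ {Δ N σ} → Δ ⊢ N ∶ σ → Set
Logical ax = ⊤
Logical (⇒I _) = ⊤
Logical (⇒E _ _ _) = ⊤
Logical (∧I _ _ _ _) = ⊤
Logical (w _ _) = ⊥
Logical (m _ _ _) = ⊥
Logical (conv _ _ _) = ⊥

Pointwise-map⁻ˡ : ∀ {A : Set} {f : A → ITy} {xs ts} → Pointwise _≈_ (map f xs) ts → Pointwise (λ p t → f p ≈ t) xs ts
Pointwise-map⁻ˡ {xs = []} [] = []
Pointwise-map⁻ˡ {xs = x ∷ xs} (r ∷ rs) = r ∷ Pointwise-map⁻ˡ rs

piecesOfAll : ∀ {N nb} (js : List (Ctx × ITy)) (ds : All (λ j → proj₁ j ⊢ N ∶ proj₂ j) js) → sizeAll ds ≤ nb →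
        Σ (List (PieceOf N nb)) (λ Ps → (map ctxOf Ps ≡ map proj₁ js) × (map typeOf Ps ≡ map proj₂ js))
piecesOfAll [] [] le = [] , refl , refl
piecesOfAll (j ∷ js) (d ∷ ds) le with piecesOfAll js ds (m+n≤o⇒n≤o (size d) le)
... | Ps , e₁ , e₂ = (pieceOf (proj₁ j) (proj₂ j) d (m+n≤o⇒m≤o (size d) le) ∷ Ps) , cong (_ ∷_) e₁ , cong (_ ∷_) e₂

∧I-pieces : ∀ {Γ₁ Γ₂ σ₁ σ₂ n' N} (d₁ : Γ₁ ⊢ N ∶ σ₁) (d₂ : Γ₂ ⊢ N ∶ σ₂) {r} → suc (size d₁ + size d₂ +
      r) ≤ suc n' → List (PieceOf N n') → List (PieceOf N n')
∧I-pieces d₁ d₂ le Ps = pieceOf _ _ d₁ (m+n≤o⇒m≤o (size d₁) l12) ∷ pieceOf _ _ d₂ (m+n≤o⇒n≤o (size d₁) l12) ∷ Ps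
  where
  l12 = m+n≤o⇒m≤o (size d₁ + size d₂) (≤-pred le)

∧-inversion : ∀ {Δ N σ' n'} (Σd : Δ ⊢ N ∶ σ') → Logical Σd → size Σd ≤ suc n' → ∀ {t₁ t₂ ts} → σ' ≈ ⋀ t₁ t₂ ts →
   Σ (List (PieceOf N n')) λ Ps → Pointwise (λ p t → typeOf p ≈ t) Ps (t₁ ∷ t₂ ∷ ts) × Δ ≅ ⋀ᶜ (map ctxOf Ps)
∧-inversion ax _ _ ()
∧-inversion (⇒I _) _ _ ()
∧-inversion (⇒E _ _ _) _ _ ()
∧-inversion (w _ _) () _ _
∧-inversion (m _ _ _) () _ _
∧-inversion (conv _ _ _) () _ _
∧-inversion {N = N} {n' = n'} (∧I {Γ₁ = Γ₁} {σ₁ = σ₁} {Γ₂ = Γ₂} {σ₂ = σ₂} js d₁ d₂ ds) _ le (⋀≈ {ρs = κ} p q)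
  with piecesOfAll js ds (m+n≤o⇒n≤o (size d₁ + size d₂) (≤-pred le))
... | Ps , e₁ , e₂ with ↭-map-inv typeOf {xs = ∧I-pieces d₁ d₂ le Ps} (subst (λ l → (σ₁ ∷ σ₂ ∷ l) ↭ κ) (sym e₂) p)
... | Ps' , eκ , perm = Ps' , Pointwise-map⁻ˡ (subst (λ l → Pointwise _≈_ l _) eκ q) ,
     ≅-trans {⋀ᶜ (Γ₁ ∷ Γ₂ ∷ map proj₁ js)} {⋀ᶜ (map ctxOf (∧I-pieces d₁ d₂ le Ps))} {⋀ᶜ (map ctxOf Ps')} (≅-reflexive
           (cong (λ l → ⋀ᶜ (Γ₁ ∷ Γ₂ ∷ l)) (sym e₁))) (⋀ᶜ-↭ (map⁺ ctxOf perm))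

record SubstitutedPremises {nb} (N : Term) (x : Var) (M : Term) (Cs : List (Ctx × ITy)) (Ps : List (PieceOf N nb)) : Set where
  constructor substituted
  field
    premises     : List (Ctx × ITy)
    derivs       : All (λ j → proj₁ j ⊢ M [ N / x ] ∶ proj₂ j) premises
    types-kept   : map proj₂ premises ≡ map proj₂ Cs
    x-removed    : typesOf x (map proj₁ premises) ≡ []
    others-kept  : ∀ y → y ≢ x → y ∉ concatDom (map ctxOf Ps) → typesOf y (map proj₁ premises) ≡ typesOf y (map proj₁ Cs)
    pieces-added : ∀ y → y ∉ concatDom (map proj₁ Cs) → typesOf y (map proj₁ premises) ≡ typesOf y (map ctxOf Ps)

-- The i-th piece is substituted into the i-th premise in which x occurs.
substComponents : ∀ {N nb k' M} → SubstBelowOf N nb k' → ∀ x (Cs : List (Ctx × ITy)) → All (λ j → Σ (proj₁ j ⊢ M ∶ proj₂ j)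
      (λ d → size d ≤ k')) Cs →
  (Ps : List (PieceOf N nb)) → Pointwise (λ p t → typeOf p ≈ t) Ps (typesOf x (map proj₁ Cs)) →
  (∀ {y} → y ∈ concatDom (map ctxOf Ps) → y ∉ concatDom (map proj₁ Cs)) → SubstitutedPremises N x M Cs Ps
substComponents cb x [] [] [] [] hd = substituted [] [] refl refl (λ _ _ _ → refl) (λ _ _ → refl)
substComponents {N} {nb} {k'} {M} cb x ((C , τ) ∷ Cs) ((dC , sz) ∷ dCs) Ps al hd with lookup x C in eq
... | nothing with substComponents cb x Cs dCs Ps al (λ q r → hd q (∈-++⁺ʳ (dom C) r))
...   | substituted Cs' ds' e₂ f1 f2 f3 = substituted
  ((C , τ) ∷ Cs') (⊢-cast refl (sym (subst-fresh M N x (⊢-∉dom⇒∉FV dC xC))) refl dC ∷ ds') (cong (τ ∷_) e₂)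
  (trans (typesOf-∷ x C (map proj₁ Cs')) (trans (cong (λ mm → consᵐ mm (typesOf x (map proj₁ Cs'))) eq) f1))
  (λ y ne nP → trans (typesOf-∷ y C (map proj₁ Cs')) (trans (cong (consᵐ (lookup y C)) (f2 y ne nP)) (sym (typesOf-∷ y C (map proj₁ Cs)))))
  (λ y nC → trans (typesOf-∷ y C (map proj₁ Cs')) (trans (cong₂ consᵐ (lookup-∉ C (λ q → nC (∈-++⁺ˡ q)))
        (f3 y (λ q → nC (∈-++⁺ʳ (dom C) q)))) refl))
  where
  xC : x ∉ dom C
  xC = lookup-nothing-∉ C eq
substComponents {N} {nb} {k'} {M} cb x ((C , τ) ∷ Cs) ((dC , sz) ∷ dCs) (p ∷ Ps) (r ∷ al) hd | just t
  with substComponents cb x Cs dCs Ps al (λ q r' → hd (∈-++⁺ʳ (dom (ctxOf p)) q) (∈-++⁺ʳ (dom C) r'))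
... | substituted Cs' ds' e₂ f1 f2 f3 = substituted
  ((C' , τ) ∷ Cs') (dnew ∷ ds') (cong (τ ∷_) e₂)
  (trans (typesOf-∷ x C' (map proj₁ Cs')) (trans (cong (λ mm → consᵐ mm (typesOf x (map proj₁ Cs'))) lxC') f1))
  (λ y ne nP → trans (typesOf-∷ y C' (map proj₁ Cs'))
     (trans (cong₂ consᵐ (l2 y ne (λ q → nP (∈-++⁺ˡ q))) (f2 y ne (λ q → nP (∈-++⁺ʳ (dom (ctxOf p)) q))))
           (sym (typesOf-∷ y C (map proj₁ Cs)))))
  (λ y nC → trans (typesOf-∷ y C' (map proj₁ Cs'))
     (trans (cong₂ consᵐ (l3 y (λ q → nC (∈-++⁺ˡ q))) (f3 y (λ q → nC (∈-++⁺ʳ (dom C) q)))) (sym (typesOf-∷ y (ctxOf p) (map ctxOf Ps)))))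
  where
  C' = delete x C ++ ctxOf p
  xC : x ∈ dom C
  xC = lookup-just-∈ C eq
  pC : ∀ {y} → y ∈ dom (ctxOf p) → y ∉ dom C
  pC q r' = hd (∈-++⁺ˡ q) (∈-++⁺ˡ r')
  xP : x ∉ dom (ctxOf p)
  xP q = pC q xC
  ndC = ⊢-distinct dC
  dnew : C' ⊢ M [ N / x ] ∶ τ
  dnew = cb (derivOf p) (sizeOf p) dC sz {x} {t} {delete x C} r (DistinctCtx-delete x C ndC) (λ q → proj₂
        (∈dom-delete⁻ x C q) refl) (≅-delete C eq)
           (λ q q' → pC q' (proj₁ (∈dom-delete⁻ x C q))) xP
  lxC' : lookup x C' ≡ nothing
  lxC' = trans (lookup-++ x (delete x C) (ctxOf p)) (trans (cong (_<∣> lookup x (ctxOf p)) (lookup-delete-same x C))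
        (lookup-∉ (ctxOf p) xP))
  l2 : ∀ y → y ≢ x → y ∉ dom (ctxOf p) → lookup y C' ≡ lookup y C
  l2 y ne nP = trans (lookup-++ y (delete x C) (ctxOf p)) (trans
        (cong₂ _<∣>_ (lookup-delete-other C ne) (lookup-∉ (ctxOf p) nP)) (<∣>-identityʳ _))
  l3 : ∀ y → y ∉ dom C → lookup y C' ≡ lookup y (ctxOf p)
  l3 y nC = trans (lookup-++ y (delete x C) (ctxOf p)) (cong (_<∣> lookup y (ctxOf p))
        (lookup-∉ (delete x C) (λ q → nC (proj₁ (∈dom-delete⁻ x C q)))))

-- The substitution lemma

module ArgumentCases {Θ M τ} (Πd : Θ ⊢ M ∶ τ) (n' : ℕ)
  (ih : ∀ {Δ' N' σ''} (Σ' : Δ' ⊢ N' ∶ σ'') → size Σ' ≤ n' → SubstGoal Σ' Θ M τ) where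

  arg-w : ∀ {Δ N σ' u A} (Σ' : Δ ⊢ N ∶ σ') (hu : u ∉ dom Δ) → size Σ' ≤ n' → SubstGoal (w {A = A} Σ' hu) Θ M τ
  arg-w {Δ} {N} {σ'} {u} {A} Σ' hu sz {x} {σ} {Γ} r nΓ xΓ e hΓΔ xΔ =
    conv≅ d₁ (DistinctCtx-++⁺ Γ ((u , lin A) ∷ Δ) nΓ (hu ∷ ⊢-distinct Σ') hΓΔ) (≅-middle u (lin A) Γ Δ uΓ)
    where
    uΓ : u ∉ dom Γ
    uΓ p = hΓΔ p (here refl)
    d₀ = ih Σ' sz r nΓ xΓ e (λ p q → hΓΔ p (there q)) (λ q → xΔ (there q))
    d₁ = w {A = A} d₀ (∉dom-++ Γ Δ uΓ hu)

  arg-conv : ∀ {Δ₀ Δ N σ₀ σ'} (Σ' : Δ₀ ⊢ N ∶ σ₀) (e₀ : Δ₀ ≈ᶜ Δ) (t : σ₀ ≈ σ') → size Σ' ≤ n' → SubstGoal (conv Σ' e₀ t) Θ M τ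
  arg-conv {Δ₀} {Δ} {N} Σ' e₀ t sz {x} {σ} {Γ} r nΓ xΓ e hΓΔ xΔ =
    conv≅ d₀ (DistinctCtx-++⁺ Γ Δ nΓ (DistinctCtx-≈ᶜ (⊢-distinct Σ') e₀) hΓΔ) (≅-++ {Γ} {Γ} (≅-refl {Γ}) e₁)
    where
    e₁ : Δ₀ ≅ Δ
    e₁ = ≈ᶜ⇒≅ (⊢-distinct Σ') e₀
    d₀ = ih Σ' sz (≈-trans t r) nΓ xΓ e (λ p q → hΓΔ p (≅-∈ e₁ q)) (λ q → xΔ (≅-∈ e₁ q))

  arg-m : ∀ {Δ₀ N' σ' u u₁ π₁} (us : Ctx) (Σ' : (Δ₀ ++ (u₁ , π₁) ∷ us) ⊢ N' ∶ σ') (hu : u ∉ dom Δ₀) → size Σ' ≤ n' →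
           SubstGoal (m us Σ' hu) Θ M τ
  arg-m {Δ₀} {N'} {σ'} {u} {u₁} {π₁} us Σ' hu sz {x} {σ} {Γ} r nΓ xΓ e hΓΔ xΔ = res Y' refl ty
    where
    Y = (u₁ , π₁) ∷ us
    Δ = (u , inter π₁ (map proj₂ us)) ∷ Δ₀
    avoid = x ∷ dom Γ
    open Freshening (freshen Δ₀ Y Σ' avoid)
      renaming (block to Y'; newName to g; deriv to Σ''; size-deriv to sz''; block-types to ty;
                block-fresh to frL; block-#Ξ to frΞ; maps-block to mp; fixes-rest to fx)
    renEq : ∀ z → rename* (dom Y) z N' ≡ rename* (dom Y') z (ren g N')
    renEq = freshen-rename* {Δ₀} {Y} {Y'} Σ' frΞ mp fx
    uΓ : u ∉ dom Γ
    uΓ p = hΓΔ p (here refl)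
    ΓΔ₀ : Γ # Δ₀
    ΓΔ₀ p q = hΓΔ p (there q)
    ΓY' : Γ # Y'
    ΓY' p q = frL q (there p)
    xY' : x ∉ dom Y'
    xY' q = frL q (here refl)
    d₀ : (Γ ++ (Δ₀ ++ Y')) ⊢ M [ ren g N' / x ] ∶ τ
    d₀ = ih Σ'' (subst (_≤ n') (sym sz'') sz) r nΓ xΓ e (#-++⁺ {Γ} Δ₀ Y' ΓΔ₀ ΓY')
           (∉dom-++ Δ₀ Y' (λ q → xΔ (there q)) xY')
    d₁ : ((Γ ++ Δ₀) ++ Y') ⊢ M [ ren g N' / x ] ∶ τ
    d₁ = subst (λ G → G ⊢ M [ ren g N' / x ] ∶ τ) (sym (++-assoc Γ Δ₀ Y')) d₀
    FVM : ∀ {v} → v ∈ FV M → v ≢ x → v ∈ dom Γ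
    FVM q ne = ≅-∈dom-there e (⊢-FV⊆dom Πd q) ne
    tmeq : rename* (dom Y') u (M [ ren g N' / x ]) ≡ M [ rename* (dom Y) u N' / x ]
    tmeq = trans (rename*-as-sub (dom Y') u (M [ ren g N' / x ])) (trans (cong (sub (collapse (dom Y') u)) (subst-as-sub M (ren g N') x))
             (trans (sub-sub M (collapse (dom Y') u) (replace (ren g N') x))
                   (trans (sub-cong M pt) (sym (subst-as-sub M (rename* (dom Y) u N') x)))))
      where
      pt : ∀ v → v ∈ FV M → sub (collapse (dom Y') u) (replace (ren g N') x v) ≡ replace (rename* (dom Y) u N') x v
      pt v q with v ≟ x
      ... | yes _ = trans (sym (rename*-as-sub (dom Y') u (ren g N'))) (sym (renEq u))
      ... | no ne = collapse-∉ (dom Y') u v (λ r → ΓY' (FVM q ne) r)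
    res : ∀ Y'' → Y'' ≡ Y' → map proj₂ Y'' ≡ map proj₂ Y → (Γ ++ Δ) ⊢ M [ rename* (u₁ ∷ dom us) u N' / x ] ∶ τ
    res [] _ ()
    res ((c₁ , π₁') ∷ ys') eqY ty' = conv≅ d₃ (DistinctCtx-++⁺ Γ Δ nΓ (⊢-distinct (m us Σ' hu)) hΓΔ) (≅-middle u _ Γ Δ₀ uΓ)
      where
      d₁' : ((Γ ++ Δ₀) ++ (c₁ , π₁') ∷ ys') ⊢ M [ ren g N' / x ] ∶ τ
      d₁' = subst (λ Z → ((Γ ++ Δ₀) ++ Z) ⊢ M [ ren g N' / x ] ∶ τ) (sym eqY) d₁
      d₂ = m {x = u} {x₁ = c₁} {σ₁ = π₁'} ys' d₁' (∉dom-++ Γ Δ₀ uΓ hu)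
      d₃ : ((u , inter π₁ (map proj₂ us)) ∷ (Γ ++ Δ₀)) ⊢ M [ rename* (dom Y) u N' / x ] ∶ τ
      d₃ = ⊢-cast (cong₂ (λ a l → (u , inter a l) ∷ (Γ ++ Δ₀)) (∷-injectiveˡ ty') (∷-injectiveʳ ty'))
                  (trans (cong (λ Z → rename* (dom Z) u (M [ ren g N' / x ])) eqY) tmeq) refl d₂

module BodyCases {Δ N σ'} (Σd : Δ ⊢ N ∶ σ') (n' k' : ℕ) (sΣ : size Σd ≤ suc n')
  (ih-body : SubstBelowOf N (suc n') k') (ih-arg : SubstBelow n') where

  nΔ = ⊢-distinct Σd

  ih : ∀ {Θ M τ} (Π' : Θ ⊢ M ∶ τ) → size Π' ≤ k' → SubstGoal Σd Θ M τ
  ih Π' sz = ih-body Σd sΣ Π' sz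

  ndT : ∀ {Γ} → DistinctCtx Γ → Γ # Δ → DistinctCtx (Γ ++ Δ)
  ndT {Γ} nΓ h = DistinctCtx-++⁺ Γ Δ nΓ nΔ h

  ≅-singleton : ∀ {x A σ Γ} → x ∉ dom Γ → ((x , lin A) ∷ []) ≅ ((x , σ) ∷ Γ) → Γ ≡ []
  ≅-singleton {x} {A} {σ} {Γ} xΓ e = []≅⇒≡[] Γ (mk≅ emp)
    where
    emp : ∀ y → lookup y [] ≈ᵐ lookup y Γ
    emp y with y ≟ x
    ... | yes refl rewrite lookup-∉ Γ xΓ = nothing
    ... | no ne = subst (λ mm → mm ≈ᵐ lookup y Γ) (lookup-there (lin A) [] ne) (≅-there e y ne)

  body-ax : ∀ {x₀ A} → SubstGoal Σd ((x₀ , lin A) ∷ []) (fv x₀) (lin A)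
  body-ax {x₀} {A} {x} {σ} {Γ} r nΓ xΓ e hΓΔ xΔ with x₀ ≟ x
  ... | no ne = ⊥-elim (bad (subst (λ mm → mm ≈ᵐ just σ) (lookup-there (lin A) [] (λ q → ne (sym q))) (≅-here e)))
    where
    bad : nothing ≈ᵐ just σ → ⊥
    bad ()
  ... | yes refl with ≈ᵐ-just⁻ (subst (λ mm → mm ≈ᵐ just σ) (lookup-here x (lin A) []) (≅-here e))
  ...   | σ₀ , refl , rA rewrite ≅-singleton xΓ e =
    conv Σd (≅⇒≈ᶜ Δ Δ nΔ nΔ (≅-refl {Δ})) (≈-trans r (≈-sym rA))

  ≈ᵐ-<∣>ʳ : ∀ {s b} c → just s ≈ᵐ b → just s ≈ᵐ (b <∣> c)
  ≈ᵐ-<∣>ʳ c (just r) = just r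

  body-w : ∀ {Θ₀ M τ y A} (Π' : Θ₀ ⊢ M ∶ τ) (hy : y ∉ dom Θ₀) → size Π' ≤ k' → SubstGoal Σd ((y , lin A) ∷ Θ₀) M τ
  body-w {Θ₀} {M} {τ} {y} {A} Π' hy sz {x} {σ} {Γ} r nΓ xΓ e hΓΔ xΔ with y ≟ x
  ... | yes refl = ⊢-cast refl (sym (subst-fresh M N y (⊢-∉dom⇒∉FV Π' hy))) refl (conv≅ d₀ (ndT nΓ hΓΔ)
        (≅-++ {Θ₀} {Γ} {Δ} {Δ} e' (≅-refl {Δ})))
    where
    e'h : ∀ z → lookup z Θ₀ ≈ᵐ lookup z Γ
    e'h z with z ≟ y
    ... | yes refl rewrite lookup-∉ Θ₀ hy | lookup-∉ Γ xΓ = nothing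
    ... | no ne = subst (λ mm → mm ≈ᵐ lookup z Γ) (lookup-there (lin A) Θ₀ ne) (≅-there e z ne)
    e' : Θ₀ ≅ Γ
    e' = mk≅ e'h
    d₀ = weaken-++ Δ Π' (λ p q → hΓΔ (≅-∈ e' p) q) nΔ
  ... | no yx = conv≅ d₁ (ndT nΓ hΓΔ) (mk≅ fin)
    where
    Γ' = delete y Γ
    yΓ : y ∈ dom Γ
    yΓ = ≅-∈dom-there e (here refl) yx
    yΔ : y ∉ dom Δ
    yΔ = hΓΔ yΓ
    eqr : ∀ z → z ≢ y → lookup z ((x , σ) ∷ Γ') ≡ lookup z ((x , σ) ∷ Γ)
    eqr z zy with z ≟ x
    ... | yes _ = refl
    ... | no _ = lookup-delete-other Γ zy
    e'h : ∀ z → lookup z Θ₀ ≈ᵐ lookup z ((x , σ) ∷ Γ')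
    e'h z with z ≟ y
    ... | yes refl rewrite lookup-∉ Θ₀ hy | lookup-there σ Γ' yx | lookup-delete-same z Γ = nothing
    ... | no zy = subst (λ mm → mm ≈ᵐ lookup z ((x , σ) ∷ Γ')) (lookup-there (lin A) Θ₀ zy)
                   (subst (λ mm → lookup z ((y , lin A) ∷ Θ₀) ≈ᵐ mm) (sym (eqr z zy)) (at e z))
    d₀ = ih Π' sz r (DistinctCtx-delete y Γ nΓ) (λ q → xΓ (proj₁ (∈dom-delete⁻ y Γ q))) (mk≅ e'h) (λ p q → hΓΔ
          (proj₁ (∈dom-delete⁻ y Γ p)) q) xΔ
    d₁ = w {A = A} d₀ (∉dom-++ Γ' Δ (λ q → proj₂ (∈dom-delete⁻ y Γ q) refl) yΔ)
    fin : ∀ z → lookup z ((y , lin A) ∷ (Γ' ++ Δ)) ≈ᵐ lookup z (Γ ++ Δ)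
    fin z with z ≟ y
    ... | yes refl rewrite lookup-++ z Γ Δ =
      ≈ᵐ-<∣>ʳ (lookup z Δ) (subst (λ mm → mm ≈ᵐ lookup z Γ) (lookup-here z (lin A) Θ₀) (≅-there e z yx))
    ... | no zy rewrite lookup-++ z Γ' Δ | lookup-++ z Γ Δ | lookup-delete-other Γ zy = ≈ᵐ-refl _

  body-conv : ∀ {Θ₀ Θ M τ₀ τ} (Π' : Θ₀ ⊢ M ∶ τ₀) (e₀ : Θ₀ ≈ᶜ Θ) (t : τ₀ ≈ τ) → size Π' ≤ k' → SubstGoal Σd Θ M τ
  body-conv {Θ₀} {Θ} Π' e₀ t sz {x} {σ} {Γ} r nΓ xΓ e hΓΔ xΔ =
    conv d₀ (≅⇒≈ᶜ (Γ ++ Δ) (Γ ++ Δ) (ndT nΓ hΓΔ) (ndT nΓ hΓΔ) (≅-refl {Γ ++ Δ})) t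
    where
    d₀ = ih Π' sz r nΓ xΓ (≅-trans {Θ₀} {Θ} (≈ᶜ⇒≅ (⊢-distinct Π') e₀) e) hΓΔ xΔ

  body-⇒I : ∀ {Θ y ρ P A} (Π' : ((y , ρ) ∷ Θ) ⊢ P ∶ lin A) → size Π' ≤ k' → SubstGoal Σd Θ (ƛ y P) (lin (ρ ⇒ A))
  body-⇒I {Θ} {y} {ρ} {P} {A} Π' sz {x} {σ} {Γ} r nΓ xΓ e hΓΔ xΔ = ⊢-cast refl tmeq refl (⇒I d₀)
    where
    L₀ = y ∷ x ∷ (dom Θ ++ (dom Δ ++ dom Γ))
    z = fresh L₀
    zfr : z ∉ L₀
    zfr = fresh-∉ L₀
    zy : z ≢ y
    zy q = zfr (here q)
    zx : z ≢ x
    zx q = zfr (there (here q))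
    zΘ : z ∉ dom Θ
    zΘ q = zfr (there (there (∈-++⁺ˡ q)))
    zΔ : z ∉ dom Δ
    zΔ q = zfr (there (there (∈-++⁺ʳ (dom Θ) (∈-++⁺ˡ q))))
    zΓ : z ∉ dom Γ
    zΓ q = zfr (there (there (∈-++⁺ʳ (dom Θ) (∈-++⁺ʳ (dom Δ) q))))
    yΘ : y ∉ dom Θ
    yΘ = Distinct-head (⊢-distinct Π')
    f = transpose y z
    ed = ⊢-ren (transpose-injective y z) Π'
    P' = ren f P
    ctxeq : renᶜ f ((y , ρ) ∷ Θ) ≡ (z , ρ) ∷ Θ
    ctxeq = cong₂ _∷_ (cong (_, ρ) (transpose-left y z))
              (renᶜ-id f Θ (λ q → transpose-other y z _ (λ e' → yΘ (subst (_∈ dom Θ) e' q)) (λ e' → zΘ (subst (_∈ dom Θ) e' q))))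
    Π'' : ((z , ρ) ∷ Θ) ⊢ P' ∶ lin A
    Π'' = ⊢-cast ctxeq refl refl (proj₁ ed)
    sz'' : size Π'' ≤ k'
    sz'' = subst (_≤ k') (sym (trans (size-⊢-cast ctxeq refl refl (proj₁ ed)) (proj₂ ed))) sz
    e'h : ∀ v → lookup v ((z , ρ) ∷ Θ) ≈ᵐ lookup v ((x , σ) ∷ (z , ρ) ∷ Γ)
    e'h v with v ≟ z
    ... | yes e' with v ≟ x
    ...   | yes e'' = ⊥-elim (zx (trans (sym e') e''))
    ...   | no _ = just (≈-refl ρ)
    e'h v | no vz = at e v
    d₀ : (((z , ρ) ∷ Γ) ++ Δ) ⊢ P' [ N / x ] ∶ lin A
    d₀ = ih Π'' sz'' r (zΓ ∷ nΓ) (λ { (here q) → zx (sym q) ; (there q) → xΓ q }) (mk≅ e'h)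
           (λ { (here refl) q → zΔ q ; (there p) q → hΓΔ p q }) xΔ
    FVN : ∀ {v} → v ∈ FV N → v ∈ dom Δ
    FVN = ⊢-FV⊆dom Σd
    tmeq : ƛ z (P' [ N / x ]) ≡ (ƛ y P) [ N / x ]
    tmeq = cong lam (trans (cong (close 0 z) (subst-as-sub P' N x))
             (trans (close-sub 0 z P' (replace N x) sxz frsh)
               (trans (cong (sub (replace N x)) c1) (sym (subst-as-sub (close 0 y P) N x)))))
      where
      sxz : replace N x z ≡ fv z
      sxz with z ≟ x
      ... | yes q = ⊥-elim (zx q)
      ... | no _ = refl
      frsh : ∀ v → v ∈ FV P' → v ≢ z → z ∉ FV (replace N x v)
      frsh v _ vz q with v ≟ x
      ... | yes _ = zΔ (FVN q)
      frsh v _ vz (here q) | no _ = vz (sym q)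
      c1 : close 0 z P' ≡ close 0 y P
      c1 = trans (cong (λ c → close 0 c P') (sym (transpose-left y z))) (trans (sym (close-ren (transpose-injective y z) 0 y P))
             (ren-id f (close 0 y P) (λ {v} q → let (q₁ , vy) = ∈FV-close⁻ 0 y P q in
                transpose-other y z v vy (λ vz → zΘ (subst (_∈ dom Θ) vz (ΘP q₁ vy))))))
        where
        ΘP : ∀ {v} → v ∈ FV P → v ≢ y → v ∈ dom Θ
        ΘP q vy with ⊢-FV⊆dom Π' q
        ... | here e' = ⊥-elim (vy e')
        ... | there q' = q'

  body-⇒E : ∀ {Θ₁ Θ₂ P Q ρ A} (Π₁ : Θ₁ ⊢ P ∶ lin (ρ ⇒ A)) (Π₂ : Θ₂ ⊢ Q ∶ ρ) (h : Θ₁ # Θ₂) → size Π₁ ≤ k' → size Π₂ ≤ k' →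
          SubstGoal Σd (Θ₁ ++ Θ₂) (app P Q) (lin A)
  body-⇒E {Θ₁} {Θ₂} {P} {Q} {ρ} {A} Π₁ Π₂ h sz₁ sz₂ {x} {σ} {Γ} r nΓ xΓ e hΓΔ xΔ with ∈dom-++⁻ Θ₁ Θ₂ (≅-∈dom-here e)
  ... | inj₁ x₁ = conv≅ d₁ (ndT nΓ hΓΔ) (mk≅ fin)
    where
    Θ = Θ₁ ++ Θ₂
    lk = lookup-∈ Θ₁ x₁
    σ₁ = proj₁ lk
    eq₁ : lookup x Θ₁ ≡ just σ₁
    eq₁ = proj₂ lk
    r₁ : σ₁ ≈ σ
    r₁ with ≈ᵐ-just⁻ (subst (λ mm → mm ≈ᵐ just σ) (lookup-++-just x Θ₁ Θ₂ eq₁) (≅-here e))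
    ... | _ , refl , q = q
    Γ₁ = delete x Θ₁
    ΘΓ' : ∀ {y} → y ∈ dom Θ → y ≢ x → y ∈ dom Γ
    ΘΓ' = ≅-∈dom-there e
    x∉₂ : x ∉ dom Θ₂
    x∉₂ = h x₁
    d₀ = ih Π₁ sz₁ r (DistinctCtx-delete x Θ₁ (⊢-distinct Π₁)) (λ q → proj₂ (∈dom-delete⁻ x Θ₁ q) refl)
           (≅-trans {Θ₁} {(x , σ₁) ∷ Γ₁} (≅-delete Θ₁ eq₁) (≅-∷ {x} {σ₁} {σ} {Γ₁} {Γ₁} r₁ (≅-refl {Γ₁})))
           (λ p q → let (a , b) = ∈dom-delete⁻ x Θ₁ p in hΓΔ (ΘΓ' (∈dom-++ˡ Θ₁ Θ₂ a) b) q) xΔ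
    d₀' : (Γ₁ ++ Δ) ⊢ P [ N / x ] ∶ lin (ρ ⇒ A)
    d₀' = d₀
    hh : (Γ₁ ++ Δ) # Θ₂
    hh p q with ∈dom-++⁻ Γ₁ Δ p
    ... | inj₁ a = h (proj₁ (∈dom-delete⁻ x Θ₁ a)) q
    ... | inj₂ a = hΓΔ (ΘΓ' (∈dom-++ʳ Θ₁ Θ₂ q) (λ e' → x∉₂ (subst (_∈ dom Θ₂) e' q))) a
    d₁ : ((Γ₁ ++ Δ) ++ Θ₂) ⊢ (app P Q) [ N / x ] ∶ lin A
    d₁ = ⊢-cast refl (cong (app (P [ N / x ])) (sym (subst-fresh Q N x (⊢-∉dom⇒∉FV Π₂ x∉₂)))) refl (⇒E d₀' Π₂ hh)
    fin : ∀ y → lookup y ((Γ₁ ++ Δ) ++ Θ₂) ≈ᵐ lookup y (Γ ++ Δ)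
    fin y rewrite lookup-++ y (Γ₁ ++ Δ) Θ₂ | lookup-++ y Γ₁ Δ | lookup-++ y Γ Δ with y ≟ x
    ... | yes refl rewrite lookup-delete-same y Θ₁ | lookup-∉ Δ xΔ | lookup-∉ Θ₂ x∉₂ | lookup-∉ Γ xΓ = nothing
    ... | no yx rewrite lookup-delete-other Θ₁ yx with lookup y Δ in eqΔ
    ...   | just t rewrite lookup-∉ Θ₁ (λ q → hΓΔ (ΘΓ' (∈dom-++ˡ Θ₁ Θ₂ q) yx) (lookup-just-∈ Δ eqΔ))
                         | lookup-∉ Γ (λ q → hΓΔ q (lookup-just-∈ Δ eqΔ)) = just (≈-refl t)
    ...   | nothing = subst₂ _≈ᵐ_ (trans (lookup-++ y Θ₁ Θ₂) (cong (_<∣> lookup y Θ₂) (sym (<∣>-identityʳ _)))) (sym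
          (<∣>-identityʳ _)) (≅-there e y yx)
  ... | inj₂ x₂ = conv≅ d₁ (ndT nΓ hΓΔ) (mk≅ fin)
    where
    Θ = Θ₁ ++ Θ₂
    x∉₁ : x ∉ dom Θ₁
    x∉₁ q = h q x₂
    lk = lookup-∈ Θ₂ x₂
    σ₂ = proj₁ lk
    eq₂ : lookup x Θ₂ ≡ just σ₂
    eq₂ = proj₂ lk
    r₂ : σ₂ ≈ σ
    r₂ with ≈ᵐ-just⁻ (subst (λ mm → mm ≈ᵐ just σ) (trans (lookup-++-∉ˡ x Θ₁ Θ₂ x∉₁) eq₂) (≅-here e))
    ... | _ , refl , q = q
    Γ₂ = delete x Θ₂
    ΘΓ' : ∀ {y} → y ∈ dom Θ → y ≢ x → y ∈ dom Γ
    ΘΓ' = ≅-∈dom-there e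
    d₀ : (Γ₂ ++ Δ) ⊢ Q [ N / x ] ∶ ρ
    d₀ = ih Π₂ sz₂ r (DistinctCtx-delete x Θ₂ (⊢-distinct Π₂)) (λ q → proj₂ (∈dom-delete⁻ x Θ₂ q) refl)
           (≅-trans {Θ₂} {(x , σ₂) ∷ Γ₂} (≅-delete Θ₂ eq₂) (≅-∷ {x} {σ₂} {σ} {Γ₂} {Γ₂} r₂ (≅-refl {Γ₂})))
           (λ p q → let (a , b) = ∈dom-delete⁻ x Θ₂ p in hΓΔ (ΘΓ' (∈dom-++ʳ Θ₁ Θ₂ a) b) q) xΔ
    hh : Θ₁ # (Γ₂ ++ Δ)
    hh p q with ∈dom-++⁻ Γ₂ Δ q
    ... | inj₁ a = h p (proj₁ (∈dom-delete⁻ x Θ₂ a))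
    ... | inj₂ a = hΓΔ (ΘΓ' (∈dom-++ˡ Θ₁ Θ₂ p) (λ e' → x∉₁ (subst (_∈ dom Θ₁) e' p))) a
    d₁ : (Θ₁ ++ (Γ₂ ++ Δ)) ⊢ (app P Q) [ N / x ] ∶ lin A
    d₁ = ⊢-cast refl (cong (λ T → app T (Q [ N / x ])) (sym (subst-fresh P N x (⊢-∉dom⇒∉FV Π₁ x∉₁)))) refl (⇒E Π₁ d₀ hh)
    fin : ∀ y → lookup y (Θ₁ ++ (Γ₂ ++ Δ)) ≈ᵐ lookup y (Γ ++ Δ)
    fin y rewrite lookup-++ y Θ₁ (Γ₂ ++ Δ) | lookup-++ y Γ₂ Δ | lookup-++ y Γ Δ with y ≟ x
    ... | yes refl rewrite lookup-delete-same y Θ₂ | lookup-∉ Δ xΔ | lookup-∉ Θ₁ x∉₁ | lookup-∉ Γ xΓ = nothing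
    ... | no yx rewrite lookup-delete-other Θ₂ yx with lookup y Δ in eqΔ
    ...   | just t rewrite lookup-∉ Θ₁ (λ q → hΓΔ (ΘΓ' (∈dom-++ˡ Θ₁ Θ₂ q) yx) (lookup-just-∈ Δ eqΔ))
                         | lookup-∉ Θ₂ (λ q → hΓΔ (ΘΓ' (∈dom-++ʳ Θ₁ Θ₂ q) yx) (lookup-just-∈ Δ eqΔ))
                         | lookup-∉ Γ (λ q → hΓΔ q (lookup-just-∈ Δ eqΔ)) = just (≈-refl t)
    ...   | nothing = subst₂ _≈ᵐ_ (trans (lookup-++ y Θ₁ Θ₂) (cong (lookup y Θ₁ <∣>_) (sym (<∣>-identityʳ _)))) (sym
          (<∣>-identityʳ _)) (≅-there e y yx)

module LogicalBodyCases {Δ N σ'} (Σd : Δ ⊢ N ∶ σ') (ns : Logical Σd) (n' k' : ℕ) (sΣ : size Σd ≤ suc n')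
  (ih-body : SubstBelowOf N (suc n') k') (ih-arg : SubstBelow n') where

  open BodyCases Σd n' k' sΣ ih-body ih-arg

  module FreshContraction {Θ₀ P τ z y₁ ρ₁} (ys : Ctx) (Π : (Θ₀ ++ (y₁ , ρ₁) ∷ ys) ⊢ P ∶ τ) (sΠ : size Π ≤ k')
    (z∉Θ₀ : z ∉ dom Θ₀) (Δ#Y : ∀ {v} → v ∈ dom Δ → v ∉ dom ((y₁ , ρ₁) ∷ ys))
    {x σ Γ} (x∉Y : x ∉ dom ((y₁ , ρ₁) ∷ ys)) (r : σ' ≈ σ) (nΓ : DistinctCtx Γ) (xΓ : x ∉ dom Γ)
    (e : ((z , inter ρ₁ (map proj₂ ys)) ∷ Θ₀) ≅ ((x , σ) ∷ Γ)) (hΓΔ : Γ # Δ) (xΔ : x ∉ dom Δ) where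

    Y = (y₁ , ρ₁) ∷ ys
    T = inter ρ₁ (map proj₂ ys)
    Θ = (z , T) ∷ Θ₀
    nΘ₀ : DistinctCtx Θ₀
    nΘ₀ = DistinctCtx-++⁻ˡ Θ₀ Y (⊢-distinct Π)
    nY : DistinctCtx Y
    nY = DistinctCtx-++⁻ʳ Θ₀ Y (⊢-distinct Π)
    Θ₀#Y : ∀ {v} → v ∈ dom Y → v ∉ dom Θ₀
    Θ₀#Y q p = DistinctCtx-++⇒# Θ₀ Y (⊢-distinct Π) p q

    -- The contracted variable is not x: substitute in the premise, then contract.
    other : z ≢ x → (Γ ++ Δ) ⊢ rename* (y₁ ∷ dom ys) z P [ N / x ] ∶ τ
    other zx = conv≅ d₃ (ndT nΓ hΓΔ) (mk≅ fin)
      where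
      xΘ₀ : x ∈ dom Θ₀
      xΘ₀ with ≅-∈dom-here e
      ... | here q = ⊥-elim (zx (sym q))
      ... | there q = q
      Γ₀ = delete x Θ₀
      Γ'' = Γ₀ ++ Y
      e'h : ∀ v → lookup v (Θ₀ ++ Y) ≈ᵐ lookup v ((x , σ) ∷ Γ'')
      e'h v with v ≟ x
      ... | yes refl rewrite lookup-++-just v Θ₀ Y (proj₂ (lookup-∈ Θ₀ xΘ₀)) =
            subst (λ mm → mm ≈ᵐ just σ) (trans (lookup-there _ Θ₀ (λ q → zx (sym q))) (proj₂ (lookup-∈ Θ₀ xΘ₀))) (≅-here e)
      ... | no vx rewrite lookup-++ v Θ₀ Y | lookup-++ v Γ₀ Y | lookup-delete-other Θ₀ vx = ≈ᵐ-refl _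
      nd'' : DistinctCtx Γ''
      nd'' = DistinctCtx-++⁺ Γ₀ Y (DistinctCtx-delete x Θ₀ nΘ₀) nY (λ p q → Θ₀#Y q (proj₁ (∈dom-delete⁻ x Θ₀ p)))
      Γ₀Γ : ∀ {v} → v ∈ dom Γ₀ → v ∈ dom Γ
      Γ₀Γ p = let (a , b) = ∈dom-delete⁻ x Θ₀ p in ≅-∈dom-there e (there a) b
      d₀ : ((Γ₀ ++ Y) ++ Δ) ⊢ P [ N / x ] ∶ τ
      d₀ = ih Π sΠ r nd'' (∉dom-++ Γ₀ Y (λ q → proj₂ (∈dom-delete⁻ x Θ₀ q) refl) x∉Y) (mk≅ e'h)
             (λ p q → case (∈dom-++⁻ Γ₀ Y p) q) xΔ
        where
        case : ∀ {v} → (v ∈ dom Γ₀) ⊎ (v ∈ dom Y) → v ∉ dom Δ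
        case (inj₁ a) = hΓΔ (Γ₀Γ a)
        case (inj₂ a) q = Δ#Y q a
      d₁ : ((Γ₀ ++ Δ) ++ Y) ⊢ P [ N / x ] ∶ τ
      d₁ = conv≅ d₀ (DistinctCtx-++⁺ (Γ₀ ++ Δ) Y (DistinctCtx-++⁺ Γ₀ Δ (DistinctCtx-delete x Θ₀ nΘ₀) nΔ (λ p → hΓΔ (Γ₀Γ p))) nY dj)
                 (≅-++-exchange Γ₀ Y Δ (λ p q → Δ#Y q p))
        where
        dj : ∀ {v} → v ∈ dom (Γ₀ ++ Δ) → v ∉ dom Y
        dj p with ∈dom-++⁻ Γ₀ Δ p
        ... | inj₁ a = λ q → Θ₀#Y q (proj₁ (∈dom-delete⁻ x Θ₀ a))
        ... | inj₂ a = Δ#Y a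
      zΓ₀Δ : z ∉ dom (Γ₀ ++ Δ)
      zΓ₀Δ = ∉dom-++ Γ₀ Δ (λ q → z∉Θ₀ (proj₁ (∈dom-delete⁻ x Θ₀ q))) (hΓΔ (≅-∈dom-there e (here refl) zx))
      d₃ : ((z , T) ∷ (Γ₀ ++ Δ)) ⊢ rename* (y₁ ∷ dom ys) z P [ N / x ] ∶ τ
      d₃ = ⊢-cast refl (rename*-subst-comm (dom Y) z x N P x∉Y zx (λ q r → Δ#Y (⊢-FV⊆dom Σd q) r)) refl
             (m {x = z} {x₁ = y₁} {σ₁ = ρ₁} ys d₁ zΓ₀Δ)
      fin : ∀ v → lookup v ((z , T) ∷ (Γ₀ ++ Δ)) ≈ᵐ lookup v (Γ ++ Δ)
      fin v with v ≟ z
      ... | yes refl rewrite lookup-++ v Γ Δ = ≈ᵐ-<∣>ʳ (lookup v Δ) (subst (λ mm → mm ≈ᵐ lookup v Γ) (lookup-here v T Θ₀) (≅-there e v zx))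
      ... | no vz rewrite lookup-++ v Γ₀ Δ | lookup-++ v Γ Δ with v ≟ x
      ...   | yes refl rewrite lookup-delete-same v Θ₀ | lookup-∉ Γ xΓ = ≈ᵐ-refl _
      ...   | no vx rewrite lookup-delete-other Θ₀ vx = <∣>-cong (subst (λ mm → mm ≈ᵐ lookup v Γ) (lookup-there T Θ₀ vz)
            (≅-there e v vx)) (≈ᵐ-refl _)

    module AtX (zx : z ≡ x) where
      rI : T ≈ σ
      rI with ≈ᵐ-just⁻ (subst (λ mm → mm ≈ᵐ just σ) (lookup-here z T Θ₀) (subst (λ u → lookup u Θ ≈ᵐ just σ) (sym zx) (≅-here e)))
      ... | _ , refl , q = q
      xΘ₀ : x ∉ dom Θ₀
      xΘ₀ q = z∉Θ₀ (subst (_∈ dom Θ₀) (sym zx) q)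
      e₀h : ∀ v → lookup v Θ₀ ≈ᵐ lookup v Γ
      e₀h v with v ≟ x
      ... | yes refl rewrite lookup-∉ Θ₀ xΘ₀ | lookup-∉ Γ xΓ = nothing
      ... | no vx = subst (λ mm → mm ≈ᵐ lookup v Γ) (lookup-there T Θ₀ (λ q → vx (trans q zx))) (≅-there e v vx)
      e₀ : Θ₀ ≅ Γ
      e₀ = mk≅ e₀h
      Θ₀Δ : Θ₀ # Δ
      Θ₀Δ p q = hΓΔ (≅-∈ e₀ p) q
      xP : x ∉ FV P
      xP q with ∈dom-++⁻ Θ₀ Y (⊢-FV⊆dom Π q)
      ... | inj₁ a = xΘ₀ a
      ... | inj₂ a = x∉Y a
      fresh-var : ∀ {v} → v ∈ FV P → fv v [ N / x ] ≡ fv v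
      fresh-var q = subst-fresh (fv _) N x (λ { (here e') → xP (subst (_∈ FV P) (sym e') q) })

  -- A block of one variable is a mere renaming of x.
  single : ∀ {Θ₀ P τ z y₁ ρ₁} (Π : (Θ₀ ++ (y₁ , ρ₁) ∷ []) ⊢ P ∶ τ) (sΠ : size Π ≤ k') (z∉Θ₀ : z ∉ dom Θ₀)
    (Δ#Y : ∀ {v} → v ∈ dom Δ → v ∉ y₁ ∷ []) {x σ Γ} (x∉Y : x ∉ y₁ ∷ []) (r : σ' ≈ σ) (nΓ : DistinctCtx Γ) (xΓ : x ∉ dom Γ)
    (e : ((z , ρ₁) ∷ Θ₀) ≅ ((x , σ) ∷ Γ)) (hΓΔ : Γ # Δ) (xΔ : x ∉ dom Δ) → z ≡ x →
    (Γ ++ Δ) ⊢ rename* (y₁ ∷ []) z P [ N / x ] ∶ τ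
  single {Θ₀} {P} {τ} {z} {y₁} {ρ₁} Π sΠ z∉Θ₀ Δ#Y {x} {σ} {Γ} x∉Y r nΓ xΓ e hΓΔ xΔ zx =
    conv≅ (⊢-cast refl tmeq refl d₀) (ndT nΓ hΓΔ) (≅-++ {Θ₀} {Γ} {Δ} {Δ} e₀ (≅-refl {Δ}))
    where
    open FreshContraction [] Π sΠ z∉Θ₀ Δ#Y x∉Y r nΓ xΓ e hΓΔ xΔ
    open AtX zx
    y₁∉Θ₀ : y₁ ∉ dom Θ₀
    y₁∉Θ₀ = Θ₀#Y (here refl)
    e₁ : (Θ₀ ++ (y₁ , ρ₁) ∷ []) ≅ ((y₁ , ρ₁) ∷ Θ₀)
    e₁ = ≅-trans {Θ₀ ++ (y₁ , ρ₁) ∷ []} {(y₁ , ρ₁) ∷ (Θ₀ ++ [])} (≅-sym (≅-middle y₁ ρ₁ Θ₀ [] y₁∉Θ₀))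
           (≅-reflexive (cong ((y₁ , ρ₁) ∷_) (++-identityʳ Θ₀)))
    d₀ : (Θ₀ ++ Δ) ⊢ P [ N / y₁ ] ∶ τ
    d₀ = ih Π sΠ (≈-trans r (≈-sym rI)) nΘ₀ y₁∉Θ₀ e₁ Θ₀Δ (λ q → Δ#Y q (here refl))
    tmeq : P [ N / y₁ ] ≡ rename* (y₁ ∷ []) z P [ N / x ]
    tmeq = trans (subst-as-sub P N y₁) (trans (sub-cong P pt)
             (sym (trans (subst-as-sub (rename* (y₁ ∷ []) z P) N x)
               (trans (cong (sub (replace N x)) (rename*-as-sub (y₁ ∷ []) z P)) (sub-sub P (replace N x) (collapse (y₁ ∷ []) z))))))
      where
      pt : ∀ v → v ∈ FV P → replace N y₁ v ≡ sub (replace N x) (collapse (y₁ ∷ []) z v)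
      pt v q with v ≟ y₁
      ... | yes refl rewrite zx = sym (subst-here x N)
      ... | no _ = sym (fresh-var q)

  -- With two or more variables in the block, Σ ends with ∧ₙ, whose components are substituted for them.
  several : ∀ {Θ₀ P τ z y₁ ρ₁ y₂ ρ₂} (ys : Ctx) (Π : (Θ₀ ++ (y₁ , ρ₁) ∷ (y₂ , ρ₂) ∷ ys) ⊢ P ∶ τ) (sΠ : size Π ≤ k')
    (z∉Θ₀ : z ∉ dom Θ₀) (Δ#Y : ∀ {v} → v ∈ dom Δ → v ∉ y₁ ∷ y₂ ∷ dom ys) {x σ Γ} (x∉Y : x ∉ y₁ ∷ y₂ ∷ dom ys) (r : σ' ≈ σ)
    (nΓ : DistinctCtx Γ) (xΓ : x ∉ dom Γ) (e : ((z , ⋀ ρ₁ ρ₂ (map proj₂ ys)) ∷ Θ₀) ≅ ((x , σ) ∷ Γ)) (hΓΔ : Γ # Δ) (xΔ : x ∉ dom Δ) →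
    z ≡ x → (Γ ++ Δ) ⊢ rename* (y₁ ∷ y₂ ∷ dom ys) z P [ N / x ] ∶ τ
  several {Θ₀} {P} {τ} {z} {y₁} {ρ₁} {y₂} {ρ₂} ys Π sΠ z∉Θ₀ Δ#Y {x} {σ} {Γ} x∉Y r nΓ xΓ e hΓΔ xΔ zx =
    conv≅ (⊢-cast refl tmeq refl d₀) (ndT nΓ hΓΔ) (≅-++ {Θ₀} {Γ} {⋀ᶜ (ctxsOf GPs)} {Δ} e₀ eD)
    where
    open FreshContraction ((y₂ , ρ₂) ∷ ys) Π sΠ z∉Θ₀ Δ#Y x∉Y r nΓ xΓ e hΓΔ xΔ
    open AtX zx
    dc = ∧-inversion Σd ns sΣ (≈-trans r (≈-sym rI))
    Ps = proj₁ dc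
    al = proj₁ (proj₂ dc)
    eΔ : Δ ≅ ⋀ᶜ (map ctxOf Ps)
    eΔ = proj₂ (proj₂ dc)
    GPs = map forget Ps
    eD : ⋀ᶜ (ctxsOf GPs) ≅ Δ
    eD = ≅-trans {⋀ᶜ (ctxsOf GPs)} {⋀ᶜ (map ctxOf Ps)} (≅-reflexive (cong ⋀ᶜ (ctxsOf-forget Ps))) (≅-sym eΔ)
    inΔ : ∀ {v} → v ∈ concatDom (map ctxOf Ps) → v ∈ dom Δ
    inΔ q = ≅-∈ (≅-sym eΔ) (concatDom-⋀ᶜ (map ctxOf Ps) q)
    mkdj : ∀ Qs → (∀ {p} → p ∈ Qs → p ∈ Ps) → All (λ p → pCtx p # (Θ₀ ++ Y)) (map forget Qs)
    mkdj [] inc = []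
    mkdj (p ∷ Qs) inc = (λ {v} a b → case v (inΔ (∈concatDom (ctxOf p) (map ctxOf Ps) a (∈-map⁺ ctxOf (inc (here refl)))))
          b) ∷ mkdj Qs (λ q → inc (there q))
      where
      case : ∀ v → v ∈ dom Δ → v ∉ dom (Θ₀ ++ Y)
      case v a b with ∈dom-++⁻ Θ₀ Y b
      ... | inj₁ c = Θ₀Δ c a
      ... | inj₂ c = Δ#Y a c
    inv : ∀ y → y ∉ concatDom (ctxsOf GPs) → AtMostOne (typesOf y (ctxsOf GPs))
    inv y h rewrite lookup-∉-concat y (ctxsOf GPs) h = none
    d₀ : (Θ₀ ++ ⋀ᶜ (ctxsOf GPs)) ⊢ sub (substAll (bindings Y GPs)) P ∶ τ
    d₀ = substMany ih-arg (concatDom (ctxsOf GPs)) Θ₀ Y GPs Π (Pointwise-forget {Y = Y} al) (mkdj Ps (λ q → q)) inv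
    tmeq : sub (substAll (bindings Y GPs)) P ≡ rename* (dom Y) z P [ N / x ]
    tmeq = trans (sub-cong P pt) (sym (trans (subst-as-sub (rename* (dom Y) z P) N x)
             (trans (cong (sub (replace N x)) (rename*-as-sub (dom Y) z P)) (sub-sub P (replace N x) (collapse (dom Y) z)))))
      where
      pt : ∀ v → v ∈ FV P → substAll (bindings Y GPs) v ≡ sub (replace N x) (collapse (dom Y) z v)
      pt v q with v ∈? dom Y
      ... | yes a rewrite substAll-∈ Y Ps al a | zx = sym (subst-here x N)
      ... | no a rewrite substAll-∉ Y GPs a = sym (fresh-var q)

  contract : ∀ {Θ₀ P τ z y₁ ρ₁} (ys : Ctx) (Π : (Θ₀ ++ (y₁ , ρ₁) ∷ ys) ⊢ P ∶ τ) → size Π ≤ k' → z ∉ dom Θ₀ →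
    (∀ {v} → v ∈ dom Δ → v ∉ y₁ ∷ dom ys) → ∀ {x σ Γ} → x ∉ y₁ ∷ dom ys → σ' ≈ σ → DistinctCtx Γ → x ∉ dom Γ →
    ((z , inter ρ₁ (map proj₂ ys)) ∷ Θ₀) ≅ ((x , σ) ∷ Γ) → Γ # Δ → x ∉ dom Δ → Dec (z ≡ x) →
    (Γ ++ Δ) ⊢ rename* (y₁ ∷ dom ys) z P [ N / x ] ∶ τ
  contract ys Π sΠ z∉Θ₀ Δ#Y x∉Y r nΓ xΓ e hΓΔ xΔ (no zx) = FreshContraction.other ys Π sΠ z∉Θ₀ Δ#Y x∉Y r nΓ xΓ e hΓΔ xΔ zx
  contract [] Π sΠ z∉Θ₀ Δ#Y x∉Y r nΓ xΓ e hΓΔ xΔ (yes zx) = single Π sΠ z∉Θ₀ Δ#Y x∉Y r nΓ xΓ e hΓΔ xΔ zx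
  contract (_ ∷ ys) Π sΠ z∉Θ₀ Δ#Y x∉Y r nΓ xΓ e hΓΔ xΔ (yes zx) = several ys Π sΠ z∉Θ₀ Δ#Y x∉Y r nΓ xΓ e hΓΔ xΔ zx

  body-m : ∀ {Θ₀ M' τ z z₁ ρ₁} (ys : Ctx) (Π' : (Θ₀ ++ (z₁ , ρ₁) ∷ ys) ⊢ M' ∶ τ) (hz : z ∉ dom Θ₀) → size Π' ≤ k' →
          SubstGoal Σd ((z , inter ρ₁ (map proj₂ ys)) ∷ Θ₀) (rename* (z₁ ∷ dom ys) z M') τ
  body-m {Θ₀} {M'} {τ} {z} {z₁} {ρ₁} ys Π' hz sz {x} {σ} {Γ} r nΓ xΓ e hΓΔ xΔ = res Y' refl
    where
    Y = (z₁ , ρ₁) ∷ ys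
    -- The contracted block is first renamed apart from x and Δ.
    open Freshening (freshen Θ₀ Y Π' (x ∷ dom Δ))
      renaming (block to Y'; newName to g; deriv to Π''; size-deriv to sz''; block-types to ty;
                block-fresh to frL; block-#Ξ to frΞ; maps-block to mp; fixes-rest to fx)
    M'' = ren g M'
    res : ∀ Y'' → Y'' ≡ Y' → (Γ ++ Δ) ⊢ rename* (z₁ ∷ dom ys) z M' [ N / x ] ∶ τ
    res [] eq = ⊥-elim (nil (trans (cong (map proj₂) eq) ty))
      where
      nil : [] ≢ ρ₁ ∷ map proj₂ ys
      nil ()
    res ((c₁ , ρ₁') ∷ ys') eqY = ⊢-cast refl (cong (_[ N / x ]) (sym renEq)) refl (contract ys' Π₃ sz₃ hz ΔY'' xY'' r nΓ xΓ
          e' hΓΔ xΔ (z ≟ x))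
      where
      Y'' = (c₁ , ρ₁') ∷ ys'
      toY' : ∀ {v} → v ∈ dom Y'' → v ∈ dom Y'
      toY' {v} q = subst (λ Z → v ∈ dom Z) eqY q
      Π₃ : (Θ₀ ++ Y'') ⊢ M'' ∶ τ
      Π₃ = ⊢-cast (cong (Θ₀ ++_) (sym eqY)) refl refl Π''
      sz₃ : size Π₃ ≤ k'
      sz₃ = subst (_≤ k') (sym (trans (size-⊢-cast (cong (Θ₀ ++_) (sym eqY)) refl refl Π'') sz'')) sz
      ty' : ρ₁' ∷ map proj₂ ys' ≡ ρ₁ ∷ map proj₂ ys
      ty' = trans (cong (map proj₂) eqY) ty
      renEq : rename* (dom Y) z M' ≡ rename* (dom Y'') z M''
      renEq = trans (freshen-rename* {Θ₀} {Y} {Y'} Π' frΞ mp fx z) (cong (λ Z → rename* (dom Z) z M'') (sym eqY))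
      xY'' : x ∉ dom Y''
      xY'' q = frL (toY' q) (here refl)
      ΔY'' : ∀ {v} → v ∈ dom Δ → v ∉ dom Y''
      ΔY'' p q = frL (toY' q) (there p)
      e' : ((z , inter ρ₁' (map proj₂ ys')) ∷ Θ₀) ≅ ((x , σ) ∷ Γ)
      e' = subst (λ T → ((z , T) ∷ Θ₀) ≅ ((x , σ) ∷ Γ)) (sym (cong₂ inter (∷-injectiveˡ ty') (∷-injectiveʳ ty'))) e

  compsAll : ∀ {M} (js : List (Ctx × ITy)) (ds : All (λ j → proj₁ j ⊢ M ∶ proj₂ j) js) → sizeAll ds ≤ k' →
             All (λ j → Σ (proj₁ j ⊢ M ∶ proj₂ j) (λ d → size d ≤ k')) js
  compsAll [] [] le = []
  compsAll (j ∷ js) (d ∷ ds) le = (d , m+n≤o⇒m≤o (size d) le) ∷ compsAll js ds (m+n≤o⇒n≤o (size d) le)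

  build : ∀ {M' σ₁ σ₂} {js : List (Ctx × ITy)} (Cs' : List (Ctx × ITy)) → All (λ j → proj₁ j ⊢ M' ∶ proj₂
        j) Cs' → map proj₂ Cs' ≡ σ₁ ∷ σ₂ ∷ map proj₂ js →
          ⋀ᶜ (map proj₁ Cs') ⊢ M' ∶ ⋀ σ₁ σ₂ (map proj₂ js)
  build {M'} ((C₁ , τ₁) ∷ (C₂ , τ₂) ∷ rest) (a ∷ b ∷ cs) eq =
    subst (λ t → ⋀ᶜ (C₁ ∷ C₂ ∷ map proj₁ rest) ⊢ M' ∶ t) (cong₂ (λ p l → ⋀ (proj₁ p) (proj₂ p) l)
          (cong₂ _,_ (∷-injectiveˡ eq) (∷-injectiveˡ (∷-injectiveʳ eq))) (∷-injectiveʳ (∷-injectiveʳ eq))) (∧I rest a b cs)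

  body-∧I : ∀ {M Γ₁ σ₁ Γ₂ σ₂} (js : List (Ctx × ITy)) (d₁ : Γ₁ ⊢ M ∶ σ₁) (d₂ : Γ₂ ⊢ M ∶ σ₂) (ds : All (λ j → proj₁ j ⊢ M ∶ proj₂ j) js) →
            size (∧I js d₁ d₂ ds) ≤ suc k' → SubstGoal Σd (⋀ᶜ (Γ₁ ∷ Γ₂ ∷ map proj₁ js)) M (⋀ σ₁ σ₂ (map proj₂ js))
  body-∧I {M} {Γ₁} {σ₁} {Γ₂} {σ₂} js d₁ d₂ ds le {x} {σ} {Γ} r nΓ xΓ e hΓΔ xΔ = dispatch (typesOf x Cs₁) refl
    where
    Cs : List (Ctx × ITy)
    Cs = (Γ₁ , σ₁) ∷ (Γ₂ , σ₂) ∷ js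
    Cs₁ = map proj₁ Cs
    Θ = ⋀ᶜ Cs₁
    le' = ≤-pred le
    l12 = m+n≤o⇒m≤o (size d₁ + size d₂) le'
    comps : All (λ j → Σ (proj₁ j ⊢ M ∶ proj₂ j) (λ d → size d ≤ k')) Cs
    comps = (d₁ , m+n≤o⇒m≤o (size d₁) l12) ∷ (d₂ , m+n≤o⇒n≤o (size d₁) l12) ∷ compsAll js ds (m+n≤o⇒n≤o (size d₁ + size d₂) le')
    xT : interᵐ (typesOf x Cs₁) ≈ᵐ just σ
    xT = subst (λ mm → mm ≈ᵐ just σ) (lookup-⋀ᶜ x Cs₁) (≅-here e)
    finish : ∀ {nb} (Ps : List (PieceOf N nb)) → SubstBelowOf N nb k' → Pointwise (λ p t → typeOf p ≈ t) Ps (typesOf x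
          Cs₁) → Δ ≅ ⋀ᶜ (map ctxOf Ps) →
             (Γ ++ Δ) ⊢ M [ N / x ] ∶ ⋀ σ₁ σ₂ (map proj₂ js)
    finish Ps cb al eΔ = conv≅ (build Cs' ds' e₂) (ndT nΓ hΓΔ) (mk≅ fin)
      where
      inΔ : ∀ {v} → v ∈ concatDom (map ctxOf Ps) → v ∈ dom Δ
      inΔ q = ≅-∈ (≅-sym eΔ) (concatDom-⋀ᶜ (map ctxOf Ps) q)
      hd : ∀ {y} → y ∈ concatDom (map ctxOf Ps) → y ∉ concatDom Cs₁
      hd {y} q q' = hΓΔ (≅-∈dom-there e (concatDom-⋀ᶜ Cs₁ q') (λ yx → xΔ (subst (_∈ dom Δ) yx (inΔ q)))) (inΔ q)
      open SubstitutedPremises (substComponents cb x Cs comps Ps al hd)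
        renaming (premises to Cs'; derivs to ds'; types-kept to e₂; x-removed to f1; others-kept to f2; pieces-added to f3)
      fin : ∀ y → lookup y (⋀ᶜ (map proj₁ Cs')) ≈ᵐ lookup y (Γ ++ Δ)
      fin y rewrite lookup-⋀ᶜ y (map proj₁ Cs') | lookup-++ y Γ Δ with y ≟ x
      ... | yes refl rewrite f1 | lookup-∉ Γ xΓ | lookup-∉ Δ xΔ = nothing
      ... | no yx with y ∈? concatDom (map ctxOf Ps)
      ...   | yes q rewrite f3 y (hd q) | lookup-∉ Γ (λ p → hΓΔ p (inΔ q)) =
                subst (λ mm → mm ≈ᵐ lookup y Δ) (lookup-⋀ᶜ y (map ctxOf Ps)) (at (≅-sym eΔ) y)
      ...   | no q rewrite f2 y yx q =
                subst₂ _≈ᵐ_ (lookup-⋀ᶜ y Cs₁) (trans (sym (<∣>-identityʳ _)) (cong (lookup y Γ <∣>_) (sym lΔ))) (≅-there e y yx)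
        where
        lΔ : lookup y Δ ≡ nothing
        lΔ = ≈ᵐ-nothing⁻ (at eΔ y) (trans (lookup-⋀ᶜ y (map ctxOf Ps)) (cong interᵐ (lookup-∉-concat y (map ctxOf Ps) q)))
    bad : nothing ≈ᵐ just σ → ⊥
    bad ()
    dispatch : ∀ T → typesOf x Cs₁ ≡ T → (Γ ++ Δ) ⊢ M [ N / x ] ∶ ⋀ σ₁ σ₂ (map proj₂ js)
    dispatch [] eq = ⊥-elim (bad (subst (λ l → interᵐ l ≈ᵐ just σ) eq xT))
    -- x occurs in a single premise: substitute Σ there.  In several: split Σ by ∧-inversion.
    dispatch (t ∷ []) eq with ≈ᵐ-just⁻ (subst (λ l → interᵐ l ≈ᵐ just σ) eq xT)
    ... | _ , refl , rt = finish (pieceOf Δ σ' Σd sΣ ∷ []) ih-body (subst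
          (Pointwise (λ p t → typeOf p ≈ t) (pieceOf Δ σ' Σd sΣ ∷ [])) (sym eq) (≈-trans r (≈-sym rt) ∷ []))
                          (≅-sym (⋀ᶜ-single Δ))
    dispatch (t₁ ∷ t₂ ∷ ts) eq with ≈ᵐ-just⁻ (subst (λ l → interᵐ l ≈ᵐ just σ) eq xT)
    ... | _ , refl , rt with ∧-inversion Σd ns sΣ (≈-trans r (≈-sym rt))
    ...   | Ps , al , eΔ = finish Ps (λ d dsz Π _ → ih-arg d dsz Π) (subst (Pointwise (λ p t → typeOf p ≈ t) Ps) (sym eq) al) eΔ

byLastRule : ∀ {Δ N σ'} (Σd : Δ ⊢ N ∶ σ') → Logical Σd → ∀ n k → size Σd ≤ suc n →
             SubstBelowOf N (suc n) k → SubstBelow n → ∀ {Θ M τ} (Π : Θ ⊢ M ∶ τ) → size Π ≤ suc k → SubstGoal Σd Θ M τ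
byLastRule Σd ℓ n k sΣ ih-body ih-arg = go
  where
  open BodyCases Σd n k sΣ ih-body ih-arg
  open LogicalBodyCases Σd ℓ n k sΣ ih-body ih-arg
  go : ∀ {Θ M τ} (Π : Θ ⊢ M ∶ τ) → size Π ≤ suc k → SubstGoal Σd Θ M τ
  go ax _ = body-ax
  go (w Π h) sΠ = body-w Π h (≤-pred sΠ)
  go (⇒I Π) sΠ = body-⇒I Π (≤-pred sΠ)
  go (⇒E Π₁ Π₂ h) sΠ = body-⇒E Π₁ Π₂ h (m+n≤o⇒m≤o (size Π₁) (≤-pred sΠ)) (m+n≤o⇒n≤o (size Π₁) (≤-pred sΠ))
  go (∧I js d₁ d₂ ds) sΠ = body-∧I js d₁ d₂ ds sΠ
  go (m ys Π h) sΠ = body-m ys Π h (≤-pred sΠ)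
  go (conv Π e t) sΠ = body-conv Π e t (≤-pred sΠ)

-- Lexicographic induction on the bounds n, for the argument derivation, and k, for the body.
mutual
  substitution : ∀ (n k : ℕ) {Δ N σ' Θ M τ} (Σd : Δ ⊢ N ∶ σ') (Πd : Θ ⊢ M ∶ τ) → size Σd ≤ n → size Πd ≤ k → SubstGoal Σd Θ M τ
  substitution n k ax Πd sΣ sΠ = substitutionLogical n k ax tt Πd sΣ sΠ
  substitution n k (⇒I d) Πd sΣ sΠ = substitutionLogical n k (⇒I d) tt Πd sΣ sΠ
  substitution n k (⇒E d e h) Πd sΣ sΠ = substitutionLogical n k (⇒E d e h) tt Πd sΣ sΠ
  substitution n k (∧I js d₁ d₂ ds) Πd sΣ sΠ = substitutionLogical n k (∧I js d₁ d₂ ds) tt Πd sΣ sΠ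
  substitution zero k (w _ _) Πd () sΠ
  substitution zero k (conv _ _ _) Πd () sΠ
  substitution zero k (m _ _ _) Πd () sΠ
  substitution (suc n) k (w Σ' h) Πd sΣ sΠ =
    ArgumentCases.arg-w Πd n (λ Σ'' sz → substitution n k Σ'' Πd sz sΠ) Σ' h (≤-pred sΣ)
  substitution (suc n) k (conv Σ' e t) Πd sΣ sΠ =
    ArgumentCases.arg-conv Πd n (λ Σ'' sz → substitution n k Σ'' Πd sz sΠ) Σ' e t (≤-pred sΣ)
  substitution (suc n) k (m us Σ' h) Πd sΣ sΠ =
    ArgumentCases.arg-m Πd n (λ Σ'' sz → substitution n k Σ'' Πd sz sΠ) us Σ' h (≤-pred sΣ)

  substitutionLogical : ∀ (n k : ℕ) {Δ N σ' Θ M τ} (Σd : Δ ⊢ N ∶ σ') → Logical Σd → (Πd : Θ ⊢ M ∶ τ) →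
                        size Σd ≤ n → size Πd ≤ k → SubstGoal Σd Θ M τ
  substitutionLogical zero k Σd ℓ Πd sΣ sΠ = ⊥-elim (size≢0 Σd (n≤0⇒n≡0 sΣ))
  substitutionLogical (suc n) zero Σd ℓ Πd sΣ sΠ = ⊥-elim (size≢0 Πd (n≤0⇒n≡0 sΠ))
  substitutionLogical (suc n) (suc k) Σd ℓ Πd sΣ sΠ =
    byLastRule Σd ℓ n k sΣ (λ d sd Π sΠ' → substitution (suc n) k d Π sd sΠ')
                           (λ d sd Π → substitution n (size Π) d Π sd ≤-refl) Πd sΠ

mainTheorem2 : ∀ (Γ Δ : Ctx) (x : Var) (σ τ : ITy) (M N : Term) →
    x ∉ dom Γ → ((x , σ) ∷ Γ) ⊢ M ∶ τ → Δ ⊢ N ∶ σ → Γ # Δ → x ∉ dom Δ →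
    (Γ ++ Δ) ⊢ M [ N / x ] ∶ τ
mainTheorem2 Γ Δ x σ τ M N x∉Γ Π Σd Γ#Δ x∉Δ =
  substitution (size Σd) (size Π) Σd Π ≤-refl ≤-refl (≈-refl σ) Γ-distinct x∉Γ (≅-refl {(x , σ) ∷ Γ}) Γ#Δ x∉Δ
  where
  Γ-distinct : DistinctCtx Γ
  Γ-distinct with ⊢-distinct Π
  ... | _ ∷ distinct = distinct
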